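{- Let $t' \ltimes t$. Then the mapping $\mathbb{D}_{\lambda}(t) \to \mathbb{D}_{\#}(t')$ given by $[\rho] \mapsto [\rho/t']$ is a morphism of upper semilattices.
   Context: Setting: the distributive $\lambda$-calculus $\lambda^{\#}$. Its types are $\mathcal{A} ::= \alpha^{\ell} \mid \mathcal{M} \xrightarrow{\ell} \mathcal{A}$ with $\mathcal{M}$ a finite multiset of types; its terms are $t ::= x^{\mathcal{A}} \mid \lambda^{\ell} x.t \mid t[t_1,\dots,t_n]$, typed by non-idempotent intersection rules. A term is correct if it is typable, its lambdas carry pairwise distinct labels, and all typing contexts and argument multisets in arrow types are sequential (pairwise distinct external labels). Reduction $\to_{\#}$ on correct terms: $(\lambda^{\ell} x.t)[s_1,\dots,s_n] \to_{\#} t\{x:=[s_1,\dots,s_n]\}$ (linear, type-directed substitution), closed under contexts. Refinement $t' \ltimes t$ of a $\lambda$-term $t$ by a correct term $t'$: $x^{\mathcal{A}} \ltimes x$; $\lambda^{\ell}x.t' \ltimes \lambda x.t$ if $t' \ltimes t$; $t'[s'_1,\dots,s'_n] \ltimes t\,s$ if $t' \ltimes t$ and each $s'_i \ltimes s$. Simulation residuals: for $t' \ltimes t$ and a $\beta$-step $R : t \to_\beta s$, simulation yields a set $R/t'$ of $\to_{\#}$-steps from $t'$ (also denoting a complete development) ending in a common term $t'/R \ltimes s$; extended to $\beta$-derivations by $\epsilon/t' = \epsilon$, $R\sigma/t' = (R/t')(\sigma/(t'/R))$, $t'/\epsilon = t'$, $t'/R\sigma = (t'/R)/\sigma$. $\mathbb{D}_{\lambda}(t)$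 denotes the set of $\beta$-derivations from $t$ modulo permutation equivalence $\equiv$, and $\mathbb{D}_{\#}(t')$ the set of $\to_{\#}$-derivations from $t'$ modulo $\equiv$; both are upper semilattices ordered by the prefix order ($\rho \sqsubseteq \sigma$ iff $\rho/\sigma = \epsilon$), with bottom $[\epsilon]$ and join $[\rho] \sqcup [\sigma] = [\rho(\sigma/\rho)]$. A morphism of upper semilattices is a monotonic map preserving bottom and joins. -}

module Defs where

open import Data.Nat using (ℕ; zero; suc; pred; _≡ᵇ_; _<ᵇ_)
open import Data.Bool using (Bool; true; false; _∧_; _∨_; if_then_else_)
open import Data.List using (List; []; _∷_; _++_; [_])
open import Data.List.Relation.Unary.All using (All)
open import Data.List.Relation.Unary.Unique.Propositional using (Unique)
open import Data.Product using (Σ; _×_; _,_)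
open import Relation.Binary.PropositionalEquality using (_≡_)

Label : Set
Label = ℕ

-- PART 1. The pure λ-calculus (de Bruijn indices)

data Λ : Set where
  var : ℕ → Λ
  lam : Λ → Λ
  app : Λ → Λ → Λ

-- A set of redex occurrences of a λ-term is represented by marking
-- application nodes (flag true = the redex at this node is in the set).
data MΛ : Set where
  mvar : ℕ → MΛ
  mlam : MΛ → MΛ
  mapp : Bool → MΛ → MΛ → MΛ

erase : MΛ → Λ
erase (mvar n)     = var n
erase (mlam a)     = lam (erase a)
erase (mapp _ a b) = app (erase a) (erase b)

valid : MΛ → Bool
valid (mvar _)                 = true
valid (mlam a)                 = valid a
valid (mapp false a b)         = valid a ∧ valid b
valid (mapp true (mlam a) b)   = valid a ∧ valid b
valid (mapp true _ _)          = false

hasMark : MΛ → Bool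
hasMark (mvar _)     = false
hasMark (mlam a)     = hasMark a
hasMark (mapp m a b) = m ∨ hasMark a ∨ hasMark b

lift : ℕ → MΛ → MΛ
lift c (mvar n)     = mvar (if n <ᵇ c then n else suc n)
lift c (mlam a)     = mlam (lift (suc c) a)
lift c (mapp m a b) = mapp m (lift c a) (lift c b)

-- sub k u a  =  a{k := u}, free indices above k are decremented
sub : ℕ → MΛ → MΛ → MΛ
sub k u (mvar n)     = if n ≡ᵇ k then u else (if k <ᵇ n then mvar (pred n) else mvar n)
sub k u (mlam a)     = mlam (sub (suc k) (lift 0 u) a)
sub k u (mapp m a b) = mapp m (sub k u a) (sub k u b)

-- Residual a/b of the set of redexes a after the complete development
-- of the set b (both sets of redexes of the same term).
res : MΛ → MΛ → MΛ
res (mvar n)     (mvar _)     = mvar n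
res (mlam a)     (mlam b)     = mlam (res a b)
res (mapp _ (mlam a1) a2) (mapp true (mlam b1) b2) = sub 0 (res a2 b2) (res a1 b1)
res (mapp m a1 a2) (mapp _ b1 b2) = mapp m (res a1 b1) (res a2 b2)
res a _ = a

-- complete development of a set of redexes (target term of the multistep)
dev : MΛ → Λ
dev a = erase (res a a)

-- β-derivations: sequences of (complete developments of) sets of redexes
DerΛ : Set
DerΛ = List MΛ

data DerFrom : Λ → DerΛ → Set where
  []  : ∀ {t} → DerFrom t []
  _∷_ : ∀ {t a ρ} → (erase a ≡ t) × (valid a ≡ true) → DerFrom (dev a) ρ → DerFrom t (a ∷ ρ)

-- a / σ  (set of redexes after a derivation)
resSD : MΛ → DerΛ → MΛ
resSD a []      = a
resSD a (b ∷ σ) = resSD (res a b) σ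

-- σ / a  (derivation after one multistep)
resDS : DerΛ → MΛ → DerΛ
resDS []      a = []
resDS (b ∷ σ) a = res b a ∷ resDS σ (res a b)

resD : DerΛ → DerΛ → DerΛ
resD []      σ = []
resD (a ∷ ρ) σ = resSD a σ ∷ resD ρ (resDS σ a)

IsEmpty : DerΛ → Set
IsEmpty ρ = All (λ a → hasMark a ≡ false) ρ

_⊑λ_ : DerΛ → DerΛ → Set
ρ ⊑λ σ = IsEmpty (resD ρ σ)

_≡λ_ : DerΛ → DerΛ → Set
ρ ≡λ σ = (ρ ⊑λ σ) × (σ ⊑λ ρ)

⊥λ : DerΛ
⊥λ = []

_⊔λ_ : DerΛ → DerΛ → DerΛ
ρ ⊔λ σ = ρ ++ resD σ ρ

-- PART 2. The distributive λ-calculus λ#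

data Ty : Set where
  base : ℕ → Label → Ty
  arr  : List Ty → Label → Ty → Ty    -- M →ℓ A  (M a multiset, as a list)

ext : Ty → Label
ext (base _ ℓ)  = ℓ
ext (arr _ ℓ _) = ℓ

-- equality of types, with multisets taken up to permutation
mutual
  data _≈T_ : Ty → Ty → Set where
    base : ∀ {α ℓ} → base α ℓ ≈T base α ℓ
    arr  : ∀ {M N ℓ A B} → M ≈M N → A ≈T B → arr M ℓ A ≈T arr N ℓ B

  data _≈M_ : List Ty → List Ty → Set where
    []  : [] ≈M []
    cons : ∀ {A M N₁ B N₂} → A ≈T B → M ≈M (N₁ ++ N₂) → (A ∷ M) ≈M (N₁ ++ B ∷ N₂)

SeqM : List Ty → Set
SeqM M = Unique (Data.List.map ext M)
  where import Data.List

data SeqTy : Ty → Set where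
  base : ∀ {α ℓ} → SeqTy (base α ℓ)
  arr  : ∀ {M ℓ A} → SeqM M → All SeqTy M → SeqTy A → SeqTy (arr M ℓ A)

data Tm : Set where
  var : ℕ → Ty → Tm
  lam : Label → Tm → Tm
  app : Tm → List Tm → Tm

-- marked terms of λ# (sets of redex occurrences)
data MTm : Set where
  var : ℕ → Ty → MTm
  lam : Label → MTm → MTm
  app : Bool → MTm → List MTm → MTm

mutual
  erase# : MTm → Tm
  erase# (var n A)   = var n A
  erase# (lam ℓ a)   = lam ℓ (erase# a)
  erase# (app _ a as) = app (erase# a) (erases# as)

  erases# : List MTm → List Tm
  erases# []       = []
  erases# (a ∷ as) = erase# a ∷ erases# as

mutual
  valid# : MTm → Bool
  valid# (var _ _)             = true
  valid# (lam _ a)             = valid# a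
  valid# (app false a as)      = valid# a ∧ valids# as
  valid# (app true (lam _ a) as) = valid# a ∧ valids# as
  valid# (app true _ _)        = false

  valids# : List MTm → Bool
  valids# []       = true
  valids# (a ∷ as) = valid# a ∧ valids# as

mutual
  hasMark# : MTm → Bool
  hasMark# (var _ _)    = false
  hasMark# (lam _ a)    = hasMark# a
  hasMark# (app m a as) = m ∨ hasMark# a ∨ hasMarks# as

  hasMarks# : List MTm → Bool
  hasMarks# []       = false
  hasMarks# (a ∷ as) = hasMark# a ∨ hasMarks# as

mutual
  unmark : Tm → MTm
  unmark (var n A)  = var n A
  unmark (lam ℓ t)  = lam ℓ (unmark t)
  unmark (app t ts) = app false (unmark t) (unmarks ts)

  unmarks : List Tm → List MTm
  unmarks []       = []
  unmarks (t ∷ ts) = unmark t ∷ unmarks ts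

mutual
  occ : ℕ → MTm → List Ty
  occ k (var n A)    = if n ≡ᵇ k then [ A ] else []
  occ k (lam _ a)    = occ (suc k) a
  occ k (app _ a as) = occ k a ++ occs k as

  occs : ℕ → List MTm → List Ty
  occs k []       = []
  occs k (a ∷ as) = occ k a ++ occs k as

cod : Ty → Ty
cod (arr _ _ B) = B
cod A           = A

typeOf : MTm → Ty
typeOf (var _ A)    = A
typeOf (lam ℓ a)    = arr (occ 0 a) ℓ (typeOf a)
typeOf (app _ a _)  = cod (typeOf a)

mutual
  lift# : ℕ → MTm → MTm
  lift# c (var n A)    = var (if n <ᵇ c then n else suc n) A
  lift# c (lam ℓ a)    = lam ℓ (lift# (suc c) a)
  lift# c (app m a as) = app m (lift# c a) (lifts# c as)

  lifts# : ℕ → List MTm → List MTm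
  lifts# c []       = []
  lifts# c (a ∷ as) = lift# c a ∷ lifts# c as

-- the argument whose type has the external label of A (in a correct
-- term this is the unique argument of type A)
data Pick : Set where
  none : Pick
  some : MTm → Pick

pick : Ty → List MTm → Pick
pick A []       = none
pick A (u ∷ us) = if ext (typeOf u) ≡ᵇ ext A then some u else pick A us

fromPick : Pick → MTm → MTm
fromPick none     d = d
fromPick (some u) _ = u

-- linear, type-directed substitution  a{k := [u₁,…,uₙ]}
mutual
  sub# : ℕ → List MTm → MTm → MTm
  sub# k us (var n A) =
    if n ≡ᵇ k then fromPick (pick A us) (var n A)
    else (if k <ᵇ n then var (pred n) A else var n A)
  sub# k us (lam ℓ a)    = lam ℓ (sub# (suc k) (lifts# 0 us) a)
  sub# k us (app m a as) = app m (sub# k us a) (subs# k us as)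

  subs# : ℕ → List MTm → List MTm → List MTm
  subs# k us []       = []
  subs# k us (a ∷ as) = sub# k us a ∷ subs# k us as

mutual
  res# : MTm → MTm → MTm
  res# (var n A) (var _ _) = var n A
  res# (lam ℓ a) (lam _ b) = lam ℓ (res# a b)
  res# (app _ (lam _ a1) as) (app true (lam _ b1) bs) = sub# 0 (ress# as bs) (res# a1 b1)
  res# (app m a1 as) (app _ b1 bs) = app m (res# a1 b1) (ress# as bs)
  res# a _ = a

  ress# : List MTm → List MTm → List MTm
  ress# (a ∷ as) (b ∷ bs) = res# a b ∷ ress# as bs
  ress# as _ = as

dev# : MTm → Tm
dev# a = erase# (res# a a)

-- Typing (non-idempotent intersection types) and correctness

Ctx : Set
Ctx = ℕ → List Ty

_≈C_ : Ctx → Ctx → Set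
Γ ≈C Δ = ∀ n → Γ n ≈M Δ n

∅C : Ctx
∅C _ = []

_+C_ : Ctx → Ctx → Ctx
(Γ +C Δ) n = Γ n ++ Δ n

singC : ℕ → Ty → Ctx
singC n A m = if m ≡ᵇ n then [ A ] else []

tailC : Ctx → Ctx
tailC Γ n = Γ (suc n)

ΣC : List Ctx → Ctx
ΣC []       = ∅C
ΣC (Γ ∷ Γs) = Γ +C ΣC Γs

SeqCtx : Ctx → Set
SeqCtx Γ = ∀ n → SeqM (Γ n) × All SeqTy (Γ n)

mutual
  data _⊢_∶_ : Ctx → Tm → Ty → Set where
    tvar : ∀ {Γ n A} → Γ ≈C singC n A → SeqCtx Γ → SeqTy A →
           Γ ⊢ var n A ∶ A
    tlam : ∀ {Γ Δ ℓ t B} → Δ ⊢ t ∶ B → Γ ≈C tailC Δ →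
           SeqCtx Γ → SeqTy (arr (Δ 0) ℓ B) →
           Γ ⊢ lam ℓ t ∶ arr (Δ 0) ℓ B
    tapp : ∀ {Γ Γ₀ Γs t ss M ℓ A Bs} → Γ₀ ⊢ t ∶ arr M ℓ A →
           Γs ⊢* ss ∶ Bs → M ≈M Bs → Γ ≈C (Γ₀ +C ΣC Γs) →
           SeqCtx Γ → SeqTy A →
           Γ ⊢ app t ss ∶ A

  data _⊢*_∶_ : List Ctx → List Tm → List Ty → Set where
    []  : [] ⊢* [] ∶ []
    _∷_ : ∀ {Γ Γs s ss B Bs} → Γ ⊢ s ∶ B → Γs ⊢* ss ∶ Bs →
          (Γ ∷ Γs) ⊢* (s ∷ ss) ∶ (B ∷ Bs)

mutual
  lamLabels : Tm → List Label
  lamLabels (var _ _)  = []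
  lamLabels (lam ℓ t)  = ℓ ∷ lamLabels t
  lamLabels (app t ts) = lamLabels t ++ lamLabelss ts

  lamLabelss : List Tm → List Label
  lamLabelss []       = []
  lamLabelss (t ∷ ts) = lamLabels t ++ lamLabelss ts

Correct : Tm → Set
Correct t = Σ Ctx λ Γ → Σ Ty λ A → (Γ ⊢ t ∶ A) × Unique (lamLabels t)

Der# : Set
Der# = List MTm

data DerFrom# : Tm → Der# → Set where
  []  : ∀ {t} → DerFrom# t []
  _∷_ : ∀ {t a ρ} → (erase# a ≡ t) × Correct t × (valid# a ≡ true) →
        DerFrom# (dev# a) ρ → DerFrom# t (a ∷ ρ)

resSD# : MTm → Der# → MTm
resSD# a []      = a
resSD# a (b ∷ σ) = resSD# (res# a b) σ

resDS# : Der# → MTm → Der#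
resDS# []      a = []
resDS# (b ∷ σ) a = res# b a ∷ resDS# σ (res# a b)

resD# : Der# → Der# → Der#
resD# []      σ = []
resD# (a ∷ ρ) σ = resSD# a σ ∷ resD# ρ (resDS# σ a)

IsEmpty# : Der# → Set
IsEmpty# ρ = All (λ a → hasMark# a ≡ false) ρ

_⊑#_ : Der# → Der# → Set
ρ ⊑# σ = IsEmpty# (resD# ρ σ)

_≡#_ : Der# → Der# → Set
ρ ≡# σ = (ρ ⊑# σ) × (σ ⊑# ρ)

⊥# : Der#
⊥# = []

_⊔#_ : Der# → Der# → Der#
ρ ⊔# σ = ρ ++ resD# σ ρ

data _⋉_ : Tm → Λ → Set where
  var : ∀ {n A} → var n A ⋉ var n
  lam : ∀ {ℓ t' t} → t' ⋉ t → lam ℓ t' ⋉ lam t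
  app : ∀ {t' ss' t s} → t' ⋉ t → All (_⋉ s) ss' → app t' ss' ⋉ app t s

-- transfer the set of β-redexes a (of t) to the set of all λ#-redexes of
-- t' (t' ⋉ t) that refine them
mutual
  tr : MΛ → Tm → MTm
  tr (mvar _)     (var n A)  = var n A
  tr (mlam a)     (lam ℓ t') = lam ℓ (tr a t')
  tr (mapp m a b) (app t' ss') = app m (tr a t') (trs b ss')
  tr _            t'         = unmark t'

  trs : MΛ → List Tm → List MTm
  trs b []        = []
  trs b (s' ∷ ss') = tr b s' ∷ trs b ss'

-- ρ/t'
simD : DerΛ → Tm → Der#
simD []      t' = []
simD (a ∷ ρ) t' = tr a t' ∷ simD ρ (dev# (tr a t'))

simT : Tm → DerΛ → Tm
simT t' []      = t'
simT t' (a ∷ ρ) = simT (dev# (tr a t')) ρ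

-- Morphism of upper semilattices 𝔻_λ(t) → 𝔻_#(t'), given on
-- representatives (derivations), with equality in 𝔻_#(t') being ≡#.

record IsUSLMorphism (t : Λ) (t' : Tm) (f : DerΛ → Der#) : Set where
  field
    maps-into : ∀ ρ → DerFrom t ρ → DerFrom# t' (f ρ)
    monotone  : ∀ ρ σ → DerFrom t ρ → DerFrom t σ → ρ ⊑λ σ → f ρ ⊑# f σ
    bottom    : f ⊥λ ≡# ⊥#
    joins     : ∀ ρ σ → DerFrom t ρ → DerFrom t σ → f (ρ ⊔λ σ) ≡# (f ρ ⊔# f σ)

-- Simulation sends a multistep a of t to tr a t', the set of all λ#-redexes of t' refining
-- those of a, and ρ/t' is the sequence of their complete developments.  The core fact is that
-- transfer commutes with residuals: tr (a/b) (t'/b) = (tr a t')/(tr b t').  It rests on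
-- transfer commuting with substitution, and on complete developments of λ#-terms being typable
-- (through a typing lemma for the linear, type-directed substitution) without duplicating
-- lambdas, so that correctness and refinement survive every step.  Together with the cube
-- lemma for λ# this yields (ρ/σ)/(t'/σ) = (ρ/t')/(σ/t') by induction on derivations.
-- Monotonicity follows since empty multisteps transfer to empty ones, and the join ρ(σ/ρ) is
-- sent to (ρ/t')((σ/t')/(ρ/t')), which is the join of ρ/t' and σ/t'.

module Submission where

open import Defs
open import Data.Nat using (ℕ; zero; suc; pred; _≡ᵇ_; _<ᵇ_; _+_; _≤_; z≤n; s≤s)
open import Data.Bool using (Bool; true; false; if_then_else_; _∧_; _∨_)
open import Data.List using (List; []; _∷_; _++_; [_]; map; concatMap)
open import Data.List.Relation.Unary.All as All using (All; []; _∷_)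
open import Data.List.Relation.Unary.Any as AnyM using (Any; here; there)
open import Data.List.Relation.Unary.AllPairs using ([]; _∷_)
open import Data.List.Relation.Unary.Unique.Propositional using (Unique)
open import Data.List.Relation.Binary.Pointwise using (Pointwise; []; _∷_)
import Data.List.Relation.Binary.Pointwise as Pointwise
open import Data.List.Relation.Unary.All.Properties using (++⁻ˡ; ++⁻ʳ)
open import Data.List.Relation.Binary.Permutation.Propositional using (_↭_; refl; prep; swap; trans; ↭-sym; ↭-reflexive)
open import Data.List.Relation.Binary.Permutation.Propositional.Properties using (All-resp-↭; shift; shifts; drop-mid; ∈-resp-↭; ++⁺; ++⁺ˡ; ++⁺ʳ; map⁺; ↭-empty-inv; ↭-singleton-inv)
import Data.List.Relation.Binary.Permutation.Propositional.Properties as ↭P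
open import Data.List.Membership.Propositional using (_∈_)
open import Data.List.Membership.Propositional.Properties using (∈-∃++)
open import Data.Product using (Σ; _×_; _,_; proj₁; proj₂)
open import Data.Unit using (⊤; tt)
open import Data.Empty using (⊥; ⊥-elim)
open import Relation.Binary.PropositionalEquality as Eq using (_≡_; _≢_; refl; sym; cong; cong₂; subst)
open Eq.≡-Reasoning
import Data.List.Properties as LP

∧-trueˡ : ∀ {a b} → (a ∧ b) ≡ true → a ≡ true
∧-trueˡ {true} e = refl

∧-trueʳ : ∀ {a b} → (a ∧ b) ≡ true → b ≡ true
∧-trueʳ {true} e = e

∧-true⁺ : ∀ {a b} → a ≡ true → b ≡ true → (a ∧ b) ≡ true
∧-true⁺ refl refl = refl

∨-falseˡ : ∀ {x y} → (x ∨ y) ≡ false → x ≡ false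
∨-falseˡ {false} e = refl

∨-falseʳ : ∀ {x y} → (x ∨ y) ≡ false → y ≡ false
∨-falseʳ {false} e = e
∨-falseʳ {true} ()

∨-false⁺ : ∀ {x y} → x ≡ false → y ≡ false → (x ∨ y) ≡ false
∨-false⁺ refl refl = refl

≡ᵇ-sym : ∀ m n → (m ≡ᵇ n) ≡ (n ≡ᵇ m)
≡ᵇ-sym zero zero = refl
≡ᵇ-sym zero (suc n) = refl
≡ᵇ-sym (suc m) zero = refl
≡ᵇ-sym (suc m) (suc n) = ≡ᵇ-sym m n

≡ᵇ-true⇒≡ : ∀ n k → (n ≡ᵇ k) ≡ true → n ≡ k
≡ᵇ-true⇒≡ zero zero e = refl
≡ᵇ-true⇒≡ (suc n) (suc k) e = cong suc (≡ᵇ-true⇒≡ n k e)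

≡ᵇ-refl : ∀ k → (k ≡ᵇ k) ≡ true
≡ᵇ-refl zero = refl
≡ᵇ-refl (suc k) = ≡ᵇ-refl k

≢⇒≡ᵇ-false : ∀ m n → m ≢ n → (m ≡ᵇ n) ≡ false
≢⇒≡ᵇ-false zero zero ne = ⊥-elim (ne refl)
≢⇒≡ᵇ-false zero (suc n) ne = refl
≢⇒≡ᵇ-false (suc m) zero ne = refl
≢⇒≡ᵇ-false (suc m) (suc n) ne = ≢⇒≡ᵇ-false m n (λ e → ne (cong suc e))

≡⇒≡ᵇ-true : ∀ m n → m ≡ n → (m ≡ᵇ n) ≡ true
≡⇒≡ᵇ-true m .m refl = ≡ᵇ-refl m

if-var : ∀ (b : Bool) x y A → _≡_ {A = MTm} (if b then var x A else var y A) (var (if b then x else y) A)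
if-var true x y A = refl
if-var false x y A = refl

SeqTy-cod : ∀ {M ℓ A} → SeqTy (arr M ℓ A) → SeqTy A
SeqTy-cod (arr _ _ x) = x

SeqTy-dom : ∀ {M ℓ A} → SeqTy (arr M ℓ A) → SeqM M
SeqTy-dom (arr x _ _) = x

-- Multisets of types up to ≈T

module _ {A B : Set} {R : A → B → Set} where
  Pointwise-resp-↭ˡ : ∀ {xs ys xs'} → Pointwise R xs ys → xs ↭ xs' → Σ (List B) λ ys' → Pointwise R xs' ys' × ys ↭ ys'
  Pointwise-resp-↭ˡ pw refl = _ , pw , refl
  Pointwise-resp-↭ˡ (r ∷ pw) (prep x p) with Pointwise-resp-↭ˡ pw p
  ... | ys' , pw' , q = _ , r ∷ pw' , prep _ q
  Pointwise-resp-↭ˡ (r ∷ s ∷ pw) (swap x y p) with Pointwise-resp-↭ˡ pw p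
  ... | ys' , pw' , q = _ , s ∷ r ∷ pw' , swap _ _ q
  Pointwise-resp-↭ˡ pw (trans p q) with Pointwise-resp-↭ˡ pw p
  ... | ys' , pw' , q1 with Pointwise-resp-↭ˡ pw' q
  ... | ys'' , pw'' , q2 = ys'' , pw'' , trans q1 q2

Unique-resp-↭ : ∀ {xs ys : List ℕ} → Unique xs → xs ↭ ys → Unique ys
Unique-resp-↭ u refl = u
Unique-resp-↭ (a ∷ u) (prep x p) = All-resp-↭ p a ∷ Unique-resp-↭ u p
Unique-resp-↭ ((xy ∷ ax) ∷ (ay ∷ u)) (swap x y p) =
  ((λ e → xy (sym e)) ∷ All-resp-↭ p ay) ∷ (All-resp-↭ p ax ∷ Unique-resp-↭ u p)
Unique-resp-↭ u (trans p q) = Unique-resp-↭ (Unique-resp-↭ u p) q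

Unique-++⁻ˡ : ∀ (xs : List ℕ) {ys} → Unique (xs ++ ys) → Unique xs
Unique-++⁻ˡ [] u = []
Unique-++⁻ˡ (x ∷ xs) (a ∷ u) = allpre xs a ∷ Unique-++⁻ˡ xs u
  where
  allpre : ∀ {P : ℕ → Set} (xs : List ℕ) {ys} → All P (xs ++ ys) → All P xs
  allpre [] _ = []
  allpre (x ∷ xs) (p ∷ ps) = p ∷ allpre xs ps

-- Every proof of M ≈M N factors into a pointwise ≈T step followed by a permutation;
-- symmetry and transitivity of ≈T and ≈M are proved through this normal form.
PointwisePerm : List Ty → List Ty → Set
PointwisePerm M N = Σ (List Ty) λ P → Pointwise _≈T_ M P × P ↭ N

≈M⇒PointwisePerm : ∀ {M N} → M ≈M N → PointwisePerm M N
≈M⇒PointwisePerm [] = [] , [] , refl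
≈M⇒PointwisePerm (cons {A} {M} {N₁} {B} {N₂} ab m) with ≈M⇒PointwisePerm m
... | P , pw , p = B ∷ P , ab ∷ pw , trans (prep B p) (↭-sym (shift B N₁ N₂))

PointwisePerm⇒≈M : ∀ {M P N} → Pointwise _≈T_ M P → P ↭ N → M ≈M N
PointwisePerm⇒≈M {[]} {[]} [] p rewrite ↭P.↭-empty-inv (↭-sym p) = []
PointwisePerm⇒≈M {A ∷ M} {B ∷ P} {N} (ab ∷ pw) p with ∈-∃++ (∈-resp-↭ p (here refl))
... | N₁ , N₂ , refl = cons ab (PointwisePerm⇒≈M pw (drop-mid [] N₁ p))

mutual
  ≈T-refl : (A : Ty) → A ≈T A
  ≈T-refl (base α ℓ) = base
  ≈T-refl (arr M ℓ A) = arr (≈M-refl M) (≈T-refl A)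

  ≈M-refl : (M : List Ty) → M ≈M M
  ≈M-refl [] = []
  ≈M-refl (A ∷ M) = cons {N₁ = []} (≈T-refl A) (≈M-refl M)

≈PW-refl : (M : List Ty) → Pointwise _≈T_ M M
≈PW-refl [] = []
≈PW-refl (A ∷ M) = ≈T-refl A ∷ ≈PW-refl M

mutual
  ≈T-sym : (A : Ty) {B : Ty} → A ≈T B → B ≈T A
  ≈T-sym (base α ℓ) base = base
  ≈T-sym (arr M ℓ A) (arr m a) = arr (≈M-sym M m) (≈T-sym A a)

  ≈M-sym : (M : List Ty) {N : List Ty} → M ≈M N → N ≈M M
  ≈M-sym M m with ≈M⇒PointwisePerm m
  ... | P , pw , p with Pointwise-resp-↭ˡ (≈PW-sym M pw) p
  ... | Q , pw' , q = PointwisePerm⇒≈M pw' (↭-sym q)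

  ≈PW-sym : (M : List Ty) {P : List Ty} → Pointwise _≈T_ M P → Pointwise _≈T_ P M
  ≈PW-sym [] [] = []
  ≈PW-sym (A ∷ M) (r ∷ pw) = ≈T-sym A r ∷ ≈PW-sym M pw

mutual
  ≈T-trans : (A : Ty) {B C : Ty} → A ≈T B → B ≈T C → A ≈T C
  ≈T-trans (base α ℓ) base base = base
  ≈T-trans (arr M ℓ A) (arr m a) (arr m' a') = arr (≈M-trans M m m') (≈T-trans A a a')

  ≈M-trans : (M : List Ty) {N O : List Ty} → M ≈M N → N ≈M O → M ≈M O
  ≈M-trans M m m' with ≈M⇒PointwisePerm m | ≈M⇒PointwisePerm m'
  ... | P , pw , p | Q , pw2 , q with Pointwise-resp-↭ˡ pw2 (↭-sym p)
  ... | Q' , pw3 , q' = PointwisePerm⇒≈M (≈PW-trans M pw pw3) (trans (↭-sym q') q)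

  ≈PW-trans : (M : List Ty) {P Q : List Ty} → Pointwise _≈T_ M P → Pointwise _≈T_ P Q → Pointwise _≈T_ M Q
  ≈PW-trans [] [] [] = []
  ≈PW-trans (A ∷ M) (r ∷ pw) (s ∷ pw2) = ≈T-trans A r s ∷ ≈PW-trans M pw pw2

≈M-++ : ∀ {M M' N N'} → M ≈M M' → N ≈M N' → (M ++ N) ≈M (M' ++ N')
≈M-++ m n with ≈M⇒PointwisePerm m | ≈M⇒PointwisePerm n
... | P , pw , p | Q , pw2 , q = PointwisePerm⇒≈M (Pointwise.++⁺ pw pw2) (++⁺ p q)

↭⇒≈M : ∀ {M N} → M ↭ N → M ≈M N
↭⇒≈M {M} p = PointwisePerm⇒≈M (≈PW-refl M) p

≈M-++-comm : ∀ M N → (M ++ N) ≈M (N ++ M)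
≈M-++-comm M N = ↭⇒≈M (↭P.++-comm M N)

≈M-[]⁻ : ∀ {M} → M ≈M [] → M ≡ []
≈M-[]⁻ m with ≈M⇒PointwisePerm m
... | P , pw , p with ↭-empty-inv p
≈M-[]⁻ m | .[] , [] , p | refl = refl

≈M-[-]⁻ : ∀ {M A} → M ≈M [ A ] → Σ Ty λ C → M ≡ [ C ] × C ≈T A
≈M-[-]⁻ m with ≈M⇒PointwisePerm m
... | P , pw , p with ↭-singleton-inv p
≈M-[-]⁻ m | .(_ ∷ []) , (r ∷ []) , p | refl = _ , refl , r

≈PW⇒≈M : ∀ {M P} → Pointwise _≈T_ M P → M ≈M P
≈PW⇒≈M pw = PointwisePerm⇒≈M pw refl

≈M-trans-≈PW : ∀ {M Bs Bs'} → M ≈M Bs → Pointwise _≈T_ Bs' Bs → M ≈M Bs'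
≈M-trans-≈PW {M} {Bs' = Bs'} m pw = ≈M-trans M m (≈PW⇒≈M (≈PW-sym Bs' pw))

≈M⇒AllAny : ∀ {M N} → M ≈M N → All (λ C → Any (C ≈T_) N) M
≈M⇒AllAny {M} {N} m with ≈M⇒PointwisePerm m
... | P , pw , p = go pw (λ x∈ → ∈-resp-↭ p x∈)
  where
  go : ∀ {M' P'} → Pointwise _≈T_ M' P' → (∀ {x} → x ∈ P' → x ∈ N) → All (λ C → Any (C ≈T_) N) M'
  go [] f = []
  go (r ∷ pw) f = AnyM.map (λ e → subst (_ ≈T_) e r) (f (here refl)) ∷ go pw (λ x∈ → f (there x∈))

ext-≈T : ∀ {A B} → A ≈T B → ext A ≡ ext B
ext-≈T base = refl
ext-≈T (arr _ _) = refl

map-ext-≈PW : ∀ {M P} → Pointwise _≈T_ M P → map ext M ≡ map ext P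
map-ext-≈PW [] = refl
map-ext-≈PW (r ∷ pw) = cong₂ _∷_ (ext-≈T r) (map-ext-≈PW pw)

SeqM-≈M : ∀ {M N} → M ≈M N → SeqM M → SeqM N
SeqM-≈M m s with ≈M⇒PointwisePerm m
... | P , pw , p = Unique-resp-↭ (subst Unique (map-ext-≈PW pw) s) (map⁺ ext p)

mutual
  SeqTy-≈T : (A : Ty) {B : Ty} → A ≈T B → SeqTy A → SeqTy B
  SeqTy-≈T (base α ℓ) base s = s
  SeqTy-≈T (arr M ℓ A) (arr m a) (arr sm am sa) = arr (SeqM-≈M m sm) (AllSeqTy-≈M M m am) (SeqTy-≈T A a sa)

  AllSeqTy-≈M : (M : List Ty) {N : List Ty} → M ≈M N → All SeqTy M → All SeqTy N
  AllSeqTy-≈M M m am with ≈M⇒PointwisePerm m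
  ... | P , pw , p = All-resp-↭ p (AllSeqTy-≈PW M pw am)

  AllSeqTy-≈PW : (M : List Ty) {P : List Ty} → Pointwise _≈T_ M P → All SeqTy M → All SeqTy P
  AllSeqTy-≈PW [] [] [] = []
  AllSeqTy-≈PW (A ∷ M) (r ∷ pw) (s ∷ ss) = SeqTy-≈T A r s ∷ AllSeqTy-≈PW M pw ss

≈C-refl : ∀ {Γ} → Γ ≈C Γ
≈C-refl {Γ} n = ≈M-refl (Γ n)

≈C-sym : ∀ {Γ Δ} → Γ ≈C Δ → Δ ≈C Γ
≈C-sym {Γ} e n = ≈M-sym (Γ n) (e n)

≈C-trans : ∀ {Γ Δ Θ} → Γ ≈C Δ → Δ ≈C Θ → Γ ≈C Θ
≈C-trans {Γ} e f n = ≈M-trans (Γ n) (e n) (f n)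

+C-cong : ∀ {Γ Γ' Δ Δ'} → Γ ≈C Γ' → Δ ≈C Δ' → (Γ +C Δ) ≈C (Γ' +C Δ')
+C-cong e f n = ≈M-++ (e n) (f n)

+C-comm : ∀ Γ Δ → (Γ +C Δ) ≈C (Δ +C Γ)
+C-comm Γ Δ n = ≈M-++-comm (Γ n) (Δ n)

+C-assoc : ∀ Γ Δ Θ → ((Γ +C Δ) +C Θ) ≈C (Γ +C (Δ +C Θ))
+C-assoc Γ Δ Θ n rewrite LP.++-assoc (Γ n) (Δ n) (Θ n) = ≈M-refl _

+C-idʳ : ∀ Γ → (Γ +C ∅C) ≈C Γ
+C-idʳ Γ n rewrite LP.++-identityʳ (Γ n) = ≈M-refl _

+C-idˡ : ∀ Γ → (∅C +C Γ) ≈C Γ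
+C-idˡ Γ n = ≈M-refl _

SeqCtx-≈C : ∀ {Γ Δ} → Γ ≈C Δ → SeqCtx Γ → SeqCtx Δ
SeqCtx-≈C {Γ} e s n = SeqM-≈M (e n) (proj₁ (s n)) , AllSeqTy-≈M (Γ n) (e n) (proj₂ (s n))

SeqCtx-+ˡ : ∀ {Γ Δ} → SeqCtx (Γ +C Δ) → SeqCtx Γ
SeqCtx-+ˡ {Γ} {Δ} s n =
  Unique-++⁻ˡ (map ext (Γ n)) (subst Unique (LP.map-++ ext (Γ n) (Δ n)) (proj₁ (s n))) ,
  ++⁻ˡ (Γ n) (proj₂ (s n))

SeqCtx-+ʳ : ∀ {Γ Δ} → SeqCtx (Γ +C Δ) → SeqCtx Δ
SeqCtx-+ʳ {Γ} {Δ} s = SeqCtx-+ˡ {Δ} {Γ} (SeqCtx-≈C (+C-comm Γ Δ) s)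

⊢-SeqCtx : ∀ {Γ t A} → Γ ⊢ t ∶ A → SeqCtx Γ
⊢-SeqCtx (tvar _ s _) = s
⊢-SeqCtx (tlam _ _ s _) = s
⊢-SeqCtx (tapp _ _ _ _ s _) = s

⊢-SeqTy : ∀ {Γ t A} → Γ ⊢ t ∶ A → SeqTy A
⊢-SeqTy (tvar _ _ s) = s
⊢-SeqTy (tlam _ _ _ s) = s
⊢-SeqTy (tapp _ _ _ _ _ s) = s

⊢-≈C : ∀ {Γ Γ' t A} → Γ ⊢ t ∶ A → Γ ≈C Γ' → Γ' ⊢ t ∶ A
⊢-≈C d@(tvar e s a) f = tvar (≈C-trans (≈C-sym f) e) (SeqCtx-≈C f s) a
⊢-≈C (tlam d e s a) f = tlam d (≈C-trans (≈C-sym f) e) (SeqCtx-≈C f s) a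
⊢-≈C (tapp d ds m e s a) f = tapp d ds m (≈C-trans (≈C-sym f) e) (SeqCtx-≈C f s) a

occ-var : ∀ k n A → occ k (var n A) ≡ singC n A k
occ-var k n A with n ≡ᵇ k | ≡ᵇ-sym n k
... | true | e rewrite sym e = refl
... | false | e rewrite sym e = refl

mutual
  occ-≈M : ∀ {Γ A} (a : MTm) k → Γ ⊢ erase# a ∶ A → occ k a ≈M Γ k
  occ-≈M {Γ} (var n B) k (tvar e s _) rewrite occ-var k n B = ≈M-sym (Γ k) (e k)
  occ-≈M {Γ} (lam ℓ a) k (tlam d e s _) = ≈M-trans (occ (suc k) a) (occ-≈M a (suc k) d) (≈M-sym (Γ k) (e k))
  occ-≈M {Γ} (app m a as) k (tapp d ds _ e _ _) = ≈M-trans (occ k a ++ occs k as) (≈M-++ (occ-≈M a k d) (occs-≈M as k ds)) (≈M-sym (Γ k) (e k))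

  occs-≈M : ∀ {Γs Bs} (as : List MTm) k → Γs ⊢* erases# as ∶ Bs → occs k as ≈M ΣC Γs k
  occs-≈M [] k [] = []
  occs-≈M (a ∷ as) k (d ∷ ds) = ≈M-++ (occ-≈M a k d) (occs-≈M as k ds)

typeOf-≈T : ∀ {Γ A} (a : MTm) → Γ ⊢ erase# a ∶ A → typeOf a ≈T A
typeOf-≈T (var n B) (tvar _ _ _) = ≈T-refl B
typeOf-≈T (lam ℓ a) (tlam d _ _ _) = arr (occ-≈M a 0 d) (typeOf-≈T a d)
typeOf-≈T (app m a as) (tapp d _ _ _ _ _) with typeOf a | typeOf-≈T a d
... | arr M ℓ B | arr _ b = b

ext-typeOf-≈T : ∀ {Γ Δ A B} (x y : MTm) → Γ ⊢ erase# x ∶ A → Δ ⊢ erase# y ∶ B → A ≈T B → ext (typeOf x) ≡ ext (typeOf y)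
ext-typeOf-≈T x y dx dy e = Eq.trans (ext-≈T (typeOf-≈T x dx)) (Eq.trans (ext-≈T e) (sym (ext-≈T (typeOf-≈T y dy))))

insertC : ℕ → Ctx → Ctx
insertC zero Γ zero = []
insertC zero Γ (suc n) = Γ n
insertC (suc c) Γ zero = Γ zero
insertC (suc c) Γ (suc n) = insertC c (tailC Γ) n

liftIdx : ℕ → ℕ → ℕ
liftIdx c n = if n <ᵇ c then n else suc n

insertC-ext : ∀ c {Γ Δ} → (∀ m → Γ m ≡ Δ m) → ∀ k → insertC c Γ k ≡ insertC c Δ k
insertC-ext zero e zero = refl
insertC-ext zero e (suc k) = e k
insertC-ext (suc c) e zero = e zero
insertC-ext (suc c) e (suc k) = insertC-ext c (λ m → e (suc m)) k

insertC-∅ : ∀ c k → insertC c ∅C k ≡ []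
insertC-∅ zero zero = refl
insertC-∅ zero (suc k) = refl
insertC-∅ (suc c) zero = refl
insertC-∅ (suc c) (suc k) = insertC-∅ c k

insertC-+ : ∀ c Γ Δ k → insertC c (Γ +C Δ) k ≡ (insertC c Γ +C insertC c Δ) k
insertC-+ zero Γ Δ zero = refl
insertC-+ zero Γ Δ (suc k) = refl
insertC-+ (suc c) Γ Δ zero = refl
insertC-+ (suc c) Γ Δ (suc k) = insertC-+ c (tailC Γ) (tailC Δ) k

insertC-singC : ∀ c n A k → insertC c (singC n A) k ≡ singC (liftIdx c n) A k
insertC-singC zero n A zero = refl
insertC-singC zero n A (suc k) = refl
insertC-singC (suc c) zero A zero = refl
insertC-singC (suc c) (suc n) A zero with n <ᵇ c
... | true = refl
... | false = refl
insertC-singC (suc c) zero A (suc k) = insertC-∅ c k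
insertC-singC (suc c) (suc n) A (suc k) with n <ᵇ c | insertC-singC c n A k
... | true | e = e
... | false | e = e

≡⇒≈C : ∀ {Γ Δ} → (∀ k → Γ k ≡ Δ k) → Γ ≈C Δ
≡⇒≈C {Γ} e k rewrite e k = ≈M-refl _

insertC-≈C : ∀ c {Γ Δ} → Γ ≈C Δ → insertC c Γ ≈C insertC c Δ
insertC-≈C zero e zero = []
insertC-≈C zero e (suc k) = e k
insertC-≈C (suc c) e zero = e zero
insertC-≈C (suc c) e (suc k) = insertC-≈C c (λ m → e (suc m)) k

insertC-SeqCtx : ∀ c {Γ} → SeqCtx Γ → SeqCtx (insertC c Γ)
insertC-SeqCtx zero s zero = [] , []
insertC-SeqCtx zero s (suc k) = s k
insertC-SeqCtx (suc c) s zero = s zero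
insertC-SeqCtx (suc c) s (suc k) = insertC-SeqCtx c (λ m → s (suc m)) k

insertC-ΣC : ∀ c Γs k → insertC c (ΣC Γs) k ≡ ΣC (map (insertC c) Γs) k
insertC-ΣC c [] k = insertC-∅ c k
insertC-ΣC c (Γ ∷ Γs) k = Eq.trans (insertC-+ c Γ (ΣC Γs) k) (cong (insertC c Γ k ++_) (insertC-ΣC c Γs k))

occC : MTm → Ctx
occC a k = occ k a

occsC : List MTm → Ctx
occsC as k = occs k as

mutual
  occ-lift : ∀ c a k → occ k (lift# c a) ≡ insertC c (occC a) k
  occ-lift c (var n A) k = Eq.trans (occ-var k (liftIdx c n) A)
     (Eq.trans (sym (insertC-singC c n A k)) (insertC-ext c (λ m → sym (occ-var m n A)) k))
  occ-lift c (lam ℓ a) k = occ-lift (suc c) a (suc k)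
  occ-lift c (app m a as) k = Eq.trans (cong₂ _++_ (occ-lift c a k) (occs-lift c as k)) (sym (insertC-+ c (occC a) (occsC as) k))

  occs-lift : ∀ c as k → occs k (lifts# c as) ≡ insertC c (occsC as) k
  occs-lift c [] k = sym (insertC-∅ c k)
  occs-lift c (a ∷ as) k = Eq.trans (cong₂ _++_ (occ-lift c a k) (occs-lift c as k)) (sym (insertC-+ c (occC a) (occsC as) k))

typeOf-lift : ∀ c a → typeOf (lift# c a) ≡ typeOf a
typeOf-lift c (var n A) = refl
typeOf-lift c (lam ℓ a) = cong₂ (λ M B → arr M ℓ B) (occ-lift (suc c) a 0) (typeOf-lift (suc c) a)
typeOf-lift c (app m a as) = cong cod (typeOf-lift c a)

mutual
  ⊢-lift# : ∀ c {Γ A} (a : MTm) → Γ ⊢ erase# a ∶ A → insertC c Γ ⊢ erase# (lift# c a) ∶ A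
  ⊢-lift# c (var n B) (tvar e s sa) =
    tvar (≈C-trans (insertC-≈C c e) (≡⇒≈C (insertC-singC c n B))) (insertC-SeqCtx c s) sa
  ⊢-lift# c (lam ℓ a) (tlam {Δ = Δ} d e s sa) =
    tlam (⊢-lift# (suc c) a d) (insertC-≈C c e) (insertC-SeqCtx c s) sa
  ⊢-lift# c (app m a as) (tapp {Γs = Γs} d ds mm e s sa) =
    tapp (⊢-lift# c a d) (⊢*-lifts# c as ds) mm
      (≈C-trans (insertC-≈C c e) (≡⇒≈C (λ k → Eq.trans (insertC-+ c _ (ΣC Γs) k) (cong (_ ++_) (insertC-ΣC c Γs k)))))
      (insertC-SeqCtx c s) sa

  ⊢*-lifts# : ∀ c {Γs Bs} (as : List MTm) → Γs ⊢* erases# as ∶ Bs → map (insertC c) Γs ⊢* erases# (lifts# c as) ∶ Bs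
  ⊢*-lifts# c [] [] = []
  ⊢*-lifts# c (a ∷ as) (d ∷ ds) = ⊢-lift# c a d ∷ ⊢*-lifts# c as ds

-- Typing of the linear substitution

dropC : ℕ → Ctx → Ctx
dropC zero Γ n = Γ (suc n)
dropC (suc k) Γ zero = Γ zero
dropC (suc k) Γ (suc n) = dropC k (tailC Γ) n

dropC-∅ : ∀ k n → dropC k ∅C n ≡ []
dropC-∅ zero n = refl
dropC-∅ (suc k) zero = refl
dropC-∅ (suc k) (suc n) = dropC-∅ k n

dropC-+ : ∀ k Γ Δ n → dropC k (Γ +C Δ) n ≡ (dropC k Γ +C dropC k Δ) n
dropC-+ zero Γ Δ n = refl
dropC-+ (suc k) Γ Δ zero = refl
dropC-+ (suc k) Γ Δ (suc n) = dropC-+ k (tailC Γ) (tailC Δ) n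

dropC-Σ : ∀ k Γs n → dropC k (ΣC Γs) n ≡ ΣC (map (dropC k) Γs) n
dropC-Σ k [] n = dropC-∅ k n
dropC-Σ k (Γ ∷ Γs) n = Eq.trans (dropC-+ k Γ (ΣC Γs) n) (cong (dropC k Γ n ++_) (dropC-Σ k Γs n))

dropC-≈C : ∀ k {Γ Δ} → Γ ≈C Δ → dropC k Γ ≈C dropC k Δ
dropC-≈C zero e n = e (suc n)
dropC-≈C (suc k) e zero = e zero
dropC-≈C (suc k) e (suc n) = dropC-≈C k (λ m → e (suc m)) n

dropC-singC-self : ∀ k A n → dropC k (singC k A) n ≡ []
dropC-singC-self zero A n = refl
dropC-singC-self (suc k) A zero = refl
dropC-singC-self (suc k) A (suc n) = dropC-singC-self k A n

dropIdx : ℕ → ℕ → ℕ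
dropIdx k n = if k <ᵇ n then pred n else n

dropC-singC : ∀ k n A → (n ≡ᵇ k) ≡ false → ∀ m → dropC k (singC n A) m ≡ singC (dropIdx k n) A m
dropC-singC zero zero A () m
dropC-singC zero (suc n) A e m = refl
dropC-singC (suc k) zero A e zero = refl
dropC-singC (suc k) zero A e (suc m) = dropC-∅ k m
dropC-singC (suc k) (suc zero) A e zero = refl
dropC-singC (suc k) (suc (suc n)) A e zero with k <ᵇ suc n
... | true = refl
... | false = refl
dropC-singC (suc k) (suc zero) A e (suc m) = dropC-singC k zero A e m
dropC-singC (suc k) (suc (suc n)) A e (suc m) with k <ᵇ suc n | dropC-singC k (suc n) A e m
... | true | r = r
... | false | r = r

ΣC-++ : ∀ Γs Δs n → ΣC (Γs ++ Δs) n ≡ (ΣC Γs +C ΣC Δs) n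
ΣC-++ [] Δs n = refl
ΣC-++ (Γ ∷ Γs) Δs n = Eq.trans (cong (Γ n ++_) (ΣC-++ Γs Δs n)) (sym (LP.++-assoc (Γ n) _ _))

+C-interchange : ∀ a b c d → ((a +C b) +C (c +C d)) ≈C ((a +C c) +C (b +C d))
+C-interchange a b c d =
  ≈C-trans (+C-assoc a b (c +C d))
  (≈C-trans (+C-cong (≈C-refl {a}) (≈C-sym (+C-assoc b c d)))
  (≈C-trans (+C-cong (≈C-refl {a}) (+C-cong (+C-comm b c) (≈C-refl {d})))
  (≈C-trans (+C-cong (≈C-refl {a}) (+C-assoc c b d))
  (≈C-sym (+C-assoc a c (b +C d))))))

ΣC-↭ : ∀ {Γs Δs} → Γs ↭ Δs → ΣC Γs ≈C ΣC Δs
ΣC-↭ {Γs} refl = ≈C-refl {ΣC Γs}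
ΣC-↭ (prep Γ p) = +C-cong (≈C-refl {Γ}) (ΣC-↭ p)
ΣC-↭ {Γ ∷ Δ ∷ xs} {_ ∷ _ ∷ ys} (swap _ _ p) =
  ≈C-trans (≈C-sym (+C-assoc Γ Δ (ΣC xs)))
  (≈C-trans (+C-cong (+C-comm Γ Δ) (ΣC-↭ p)) (+C-assoc Δ Γ (ΣC ys)))
ΣC-↭ (trans p q) = ≈C-trans (ΣC-↭ p) (ΣC-↭ q)

ΣC-map-+C : ∀ {X : Set} (f g : X → Ctx) (xs : List X) →
  (ΣC (map f xs) +C ΣC (map g xs)) ≈C ΣC (map (λ x → f x +C g x) xs)
ΣC-map-+C f g [] = λ n → []
ΣC-map-+C f g (x ∷ xs) = ≈C-trans (+C-interchange (f x) (ΣC (map f xs)) (g x) (ΣC (map g xs)))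
  (+C-cong (≈C-refl {f x +C g x}) (ΣC-map-+C f g xs))

data TypedArgs : List MTm → Set where
  []   : TypedArgs []
  cons : ∀ {u us} (Γ : Ctx) (B : Ty) → Γ ⊢ erase# u ∶ B → TypedArgs us → TypedArgs (u ∷ us)

data Picked : Set where
  noneP : Picked
  someP : (u : MTm) (Γ : Ctx) (B : Ty) → Γ ⊢ erase# u ∶ B → Picked

pickTyped : ∀ {us} → Ty → TypedArgs us → Picked
pickTyped A [] = noneP
pickTyped A (cons {u} Γ B d T) = if ext (typeOf u) ≡ᵇ ext A then someP u Γ B d else pickTyped A T

untyped : Picked → Pick
untyped noneP = none
untyped (someP u _ _ _) = some u

pick-untyped : ∀ {us} A (T : TypedArgs us) → pick A us ≡ untyped (pickTyped A T)
pick-untyped A [] = refl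
pick-untyped A (cons {u} Γ B d T) with ext (typeOf u) ≡ᵇ ext A
... | true = refl
... | false = pick-untyped A T

pickTyped-ext : ∀ {us} {A A'} → ext A ≡ ext A' → (T : TypedArgs us) → pickTyped A T ≡ pickTyped A' T
pickTyped-ext e [] = refl
pickTyped-ext {A = A} {A'} e (cons {u} Γ B d T) rewrite e with ext (typeOf u) ≡ᵇ ext A'
... | true = refl
... | false = pickTyped-ext e T

pickedCtx : Picked → Ctx
pickedCtx noneP = ∅C
pickedCtx (someP _ Γ _ _) = Γ

SuppliesPicked : Ty → Picked → Set
SuppliesPicked A noneP = ⊥
SuppliesPicked A (someP u Γ B d) = B ≈T A

-- pick chooses an argument by external label only; Supplies T A asks that the chosen
-- argument exists and has a type ≈T A.
Supplies : ∀ {us} → TypedArgs us → Ty → Set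
Supplies T A = SuppliesPicked A (pickTyped A T)

pickΓ : ∀ {us} → TypedArgs us → Ty → Ctx
pickΓ T A = pickedCtx (pickTyped A T)

argsCtx : ∀ {us} → TypedArgs us → List Ty → Ctx
argsCtx T M = ΣC (map (pickΓ T) M)

Supplies-≈T : ∀ {us} (T : TypedArgs us) {A A'} → A ≈T A' → Supplies T A → Supplies T A'
Supplies-≈T T {A} {A'} e g rewrite sym (pickTyped-ext {A = A} {A'} (ext-≈T e) T) with pickTyped A T
... | someP u Γ B d = ≈T-trans B g e

pickΓ-ext : ∀ {us} (T : TypedArgs us) {A A'} → ext A ≡ ext A' → pickΓ T A ≡ pickΓ T A'
pickΓ-ext T {A} {A'} e = cong pickedCtx (pickTyped-ext {A = A} {A'} e T)

map-pickΓ-≈PW : ∀ {us} (T : TypedArgs us) {M P} → Pointwise _≈T_ M P → map (pickΓ T) M ≡ map (pickΓ T) P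
map-pickΓ-≈PW T [] = refl
map-pickΓ-≈PW T (r ∷ pw) = cong₂ _∷_ (pickΓ-ext T (ext-≈T r)) (map-pickΓ-≈PW T pw)

argsCtx-≈M : ∀ {us} (T : TypedArgs us) {M N} → M ≈M N → argsCtx T M ≈C argsCtx T N
argsCtx-≈M T m with ≈M⇒PointwisePerm m
... | P , pw , p rewrite map-pickΓ-≈PW T pw = ΣC-↭ (↭P.map⁺ (pickΓ T) p)

argsCtx-++ : ∀ {us} (T : TypedArgs us) M N → argsCtx T (M ++ N) ≈C (argsCtx T M +C argsCtx T N)
argsCtx-++ T M N rewrite LP.map-++ (pickΓ T) M N = ≡⇒≈C (ΣC-++ (map (pickΓ T) M) (map (pickΓ T) N))

Supplies-≈PW : ∀ {us} (T : TypedArgs us) {M P} → Pointwise _≈T_ M P → All (Supplies T) P → All (Supplies T) M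
Supplies-≈PW T [] [] = []
Supplies-≈PW T (r ∷ pw) (g ∷ gs) = Supplies-≈T T (≈T-sym _ r) g ∷ Supplies-≈PW T pw gs

Supplies-≈M : ∀ {us} (T : TypedArgs us) {M N} → M ≈M N → All (Supplies T) N → All (Supplies T) M
Supplies-≈M T m gs with ≈M⇒PointwisePerm m
... | P , pw , p = Supplies-≈PW T pw (All-resp-↭ (↭-sym p) gs)

All-ΣC : ∀ {us} (T : TypedArgs us) k Γs → All (Supplies T) (ΣC Γs k) → All (λ Γ → All (Supplies T) (Γ k)) Γs
All-ΣC T k [] a = []
All-ΣC T k (Γ ∷ Γs) a = ++⁻ˡ (Γ k) a ∷ All-ΣC T k Γs (++⁻ʳ (Γ k) a)

liftArgs : ∀ {us} → TypedArgs us → TypedArgs (lifts# 0 us)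
liftArgs [] = []
liftArgs (cons {u} Γ B d T) = cons (insertC 0 Γ) B (⊢-lift# 0 u d) (liftArgs T)

data LiftedPick : Picked → Picked → Set where
  none : LiftedPick noneP noneP
  some : ∀ {u Γ B d u' d'} → LiftedPick (someP u Γ B d) (someP u' (insertC 0 Γ) B d')

pickTyped-liftArgs : ∀ {us} A (T : TypedArgs us) → LiftedPick (pickTyped A T) (pickTyped A (liftArgs T))
pickTyped-liftArgs A [] = none
pickTyped-liftArgs A (cons {u} Γ B d T) rewrite typeOf-lift 0 u with ext (typeOf u) ≡ᵇ ext A
... | true = some
... | false = pickTyped-liftArgs A T

Supplies-liftArgs : ∀ {us} (T : TypedArgs us) A → Supplies T A → Supplies (liftArgs T) A
Supplies-liftArgs T A g with pickTyped A T | pickTyped A (liftArgs T) | pickTyped-liftArgs A T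
... | someP _ _ _ _ | someP _ _ _ _ | some = g

pickΓ-liftArgs : ∀ {us} (T : TypedArgs us) A n → pickΓ (liftArgs T) A n ≡ insertC 0 (pickΓ T A) n
pickΓ-liftArgs T A n with pickTyped A T | pickTyped A (liftArgs T) | pickTyped-liftArgs A T
... | noneP | noneP | none = Eq.sym (insertC-∅ 0 n)
... | someP _ _ _ _ | someP _ _ _ _ | some = refl

argsCtx-liftArgs-suc : ∀ {us} (T : TypedArgs us) M n → argsCtx (liftArgs T) M (suc n) ≡ argsCtx T M n
argsCtx-liftArgs-suc T [] n = refl
argsCtx-liftArgs-suc T (A ∷ M) n = cong₂ _++_ (pickΓ-liftArgs T A (suc n)) (argsCtx-liftArgs-suc T M n)

argsCtx-liftArgs-zero : ∀ {us} (T : TypedArgs us) M → argsCtx (liftArgs T) M 0 ≡ []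
argsCtx-liftArgs-zero T [] = refl
argsCtx-liftArgs-zero T (A ∷ M) = cong₂ _++_ (pickΓ-liftArgs T A 0) (argsCtx-liftArgs-zero T M)

-- The context of sub# k us w for w typed in Γ: index k is removed, and each type of its
-- occurrences contributes the context of the argument supplied for it.
subCtx : ∀ {us} → ℕ → TypedArgs us → Ctx → Ctx
subCtx k T Γ = dropC k Γ +C argsCtx T (Γ k)

argsCtx-ΣC : ∀ {us} (T : TypedArgs us) k Γs → argsCtx T (ΣC Γs k) ≈C ΣC (map (λ Γ → argsCtx T (Γ k)) Γs)
argsCtx-ΣC T k [] = λ n → []
argsCtx-ΣC T k (Γ ∷ Γs) = ≈C-trans (argsCtx-++ T (Γ k) (ΣC Γs k)) (+C-cong (≈C-refl {argsCtx T (Γ k)}) (argsCtx-ΣC T k Γs))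

subCtx-app : ∀ {us} k (T : TypedArgs us) {Δ} Γ₀ Γs → Δ ≈C (Γ₀ +C ΣC Γs) →
  subCtx k T Δ ≈C (subCtx k T Γ₀ +C ΣC (map (subCtx k T) Γs))
subCtx-app k T {Δ} Γ₀ Γs e = ≈C-trans (+C-cong {dropC k Δ} {dropC k Γ₀ +C ΣC (map (dropC k) Γs)} dropped supplied) regrouped
  where
  dropped : dropC k Δ ≈C (dropC k Γ₀ +C ΣC (map (dropC k) Γs))
  dropped = ≈C-trans (dropC-≈C k e) (≡⇒≈C (λ n → Eq.trans (dropC-+ k Γ₀ (ΣC Γs) n) (cong (dropC k Γ₀ n ++_) (dropC-Σ k Γs n))))
  supplied : argsCtx T (Δ k) ≈C (argsCtx T (Γ₀ k) +C ΣC (map (λ Γ → argsCtx T (Γ k)) Γs))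
  supplied =
    ≈C-trans (argsCtx-≈M T (e k))
      (≈C-trans (argsCtx-++ T (Γ₀ k) (ΣC Γs k)) (+C-cong {argsCtx T (Γ₀ k)} (≈C-refl {argsCtx T (Γ₀ k)}) (argsCtx-ΣC T k Γs)))
  regrouped : ((dropC k Γ₀ +C ΣC (map (dropC k) Γs)) +C (argsCtx T (Γ₀ k) +C ΣC (map (λ Γ → argsCtx T (Γ k)) Γs)))
              ≈C (subCtx k T Γ₀ +C ΣC (map (subCtx k T) Γs))
  regrouped = ≈C-trans (+C-interchange (dropC k Γ₀) (ΣC (map (dropC k) Γs)) (argsCtx T (Γ₀ k)) (ΣC (map (λ Γ → argsCtx T (Γ k)) Γs)))
              (+C-cong {subCtx k T Γ₀} (≈C-refl {subCtx k T Γ₀}) (ΣC-map-+C (dropC k) (λ Γ → argsCtx T (Γ k)) Γs))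

SeqCtx-subCtx-app : ∀ {us} k (T : TypedArgs us) {Δ} Γ₀ Γs → Δ ≈C (Γ₀ +C ΣC Γs) → SeqCtx (subCtx k T Δ) →
                    SeqCtx (subCtx k T Γ₀) × SeqCtx (ΣC (map (subCtx k T) Γs))
SeqCtx-subCtx-app k T Γ₀ Γs e sq = SeqCtx-+ˡ {subCtx k T Γ₀} sq' , SeqCtx-+ʳ {subCtx k T Γ₀} sq'
  where sq' = SeqCtx-≈C (subCtx-app k T Γ₀ Γs e) sq

Supplies-fun : ∀ {us} k (T : TypedArgs us) {Δ} Γ₀ Γs → Δ ≈C (Γ₀ +C ΣC Γs) → All (Supplies T) (Δ k) → All (Supplies T) (Γ₀ k)
Supplies-fun k T {Δ} Γ₀ Γs e g = ++⁻ˡ (Γ₀ k) (Supplies-≈M T (≈M-sym (Δ k) (e k)) g)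

Supplies-args : ∀ {us} k (T : TypedArgs us) {Δ} Γ₀ Γs → Δ ≈C (Γ₀ +C ΣC Γs) → All (Supplies T) (Δ k) → All (λ Γ → All (Supplies T) (Γ k)) Γs
Supplies-args k T {Δ} Γ₀ Γs e g = All-ΣC T k Γs (++⁻ʳ (Γ₀ k) (Supplies-≈M T (≈M-sym (Δ k) (e k)) g))

subCtx-lam-tail : ∀ {us} k (T : TypedArgs us) {Γ₀} Δb → Γ₀ ≈C tailC Δb → tailC (subCtx (suc k) (liftArgs T) Δb) ≈C subCtx k T Γ₀
subCtx-lam-tail k T {Γ₀} Δb e =
  ≈C-trans (≡⇒≈C (λ n → cong (dropC k (tailC Δb) n ++_) (argsCtx-liftArgs-suc T (Δb (suc k)) n)))
           (+C-cong (dropC-≈C k (≈C-sym e)) (argsCtx-≈M T (≈M-sym (Γ₀ k) (e k))))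

subCtx-lam-zero : ∀ {us} k (T : TypedArgs us) Δb → Δb 0 ≈M subCtx (suc k) (liftArgs T) Δb 0
subCtx-lam-zero k T Δb rewrite argsCtx-liftArgs-zero T (Δb (suc k)) | LP.++-identityʳ (Δb 0) = ≈M-refl (Δb 0)

Supplies-lam : ∀ {us} k (T : TypedArgs us) {Γ₀ Δb} → Γ₀ ≈C tailC Δb → SeqCtx Δb → All (Supplies T) (Γ₀ k) → SeqCtx (subCtx k T Γ₀) →
        All (Supplies (liftArgs T)) (Δb (suc k)) × SeqCtx (subCtx (suc k) (liftArgs T) Δb)
Supplies-lam k T {Γ₀} {Δb} e sΔ g sq = g' , sqb
  where
  g' : All (Supplies (liftArgs T)) (Δb (suc k))
  g' = Supplies-≈M (liftArgs T) (≈M-sym (Γ₀ k) (e k)) (All.map (λ {A} → Supplies-liftArgs T A) g)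
  m0 = subCtx-lam-zero k T Δb
  sqb : SeqCtx (subCtx (suc k) (liftArgs T) Δb)
  sqb zero = SeqM-≈M m0 (proj₁ (sΔ 0)) , AllSeqTy-≈M (Δb 0) m0 (proj₂ (sΔ 0))
  sqb (suc n) = SeqCtx-≈C (≈C-sym (subCtx-lam-tail k T Δb e)) sq n

sub#-typed-app : ∀ {us} k (T : TypedArgs us) m a as Γ₀ Γs M Bs {ℓ A Δ} → M ≈M Bs → Δ ≈C (Γ₀ +C ΣC Γs) → SeqCtx (subCtx k T Δ) →
  (Σ Ty λ B' → B' ≈T arr M ℓ A × subCtx k T Γ₀ ⊢ erase# (sub# k us a) ∶ B') →
  (Σ (List Ty) λ Bs' → Pointwise _≈T_ Bs' Bs × map (subCtx k T) Γs ⊢* erases# (subs# k us as) ∶ Bs') →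
  Σ Ty λ B' → B' ≈T A × subCtx k T Δ ⊢ erase# (sub# k us (app m a as)) ∶ B'
sub#-typed-app k T m a as Γ₀ Γs M Bs mm e sq (arr M' _ A' , arr mM aA , d') (Bs' , pw , ds') =
  A' , aA , tapp d' ds' (≈M-trans M' mM (≈M-trans-≈PW mm pw)) (subCtx-app k T Γ₀ Γs e) sq (SeqTy-cod (⊢-SeqTy d'))

mutual
  sub#-typed : ∀ k {Δ B us} (w : MTm) → Δ ⊢ erase# w ∶ B → (T : TypedArgs us) → All (Supplies T) (Δ k) →
           SeqCtx (subCtx k T Δ) → Σ Ty λ B' → B' ≈T B × subCtx k T Δ ⊢ erase# (sub# k us w) ∶ B'
  sub#-typed k {Δ} {us = us} (var n A) (tvar e s sa) T g sq with n ≡ᵇ k in eq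
  ... | true with ≡ᵇ-true⇒≡ n k eq
  ... | refl with Δ k | e k | g
  ... | Δk | ek | gk rewrite ≡ᵇ-refl k with ≈M-[-]⁻ ek
  ... | C , refl , cA with gk
  ... | gC ∷ [] rewrite pick-untyped A T with pickTyped A T | Supplies-≈T T cA gC | pickTyped-ext {A = C} {A} (ext-≈T cA) T
  ... | someP u Γu Bu du | bA | pe = Bu , bA , ⊢-≈C du eqv
    where
    eqv : Γu ≈C (dropC n Δ +C (pickΓ T C +C ∅C))
    eqv = ≈C-sym (≈C-trans (+C-cong {dropC n Δ} (≈C-trans (dropC-≈C n e) (≡⇒≈C (dropC-singC-self n A)))
             (≈C-trans (+C-idʳ (pickΓ T C)) (≡⇒≈C (λ m → cong (λ p → pickedCtx p m) pe)))) (+C-idˡ Γu))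
  sub#-typed k {Δ} {us = us} (var n A) (tvar e s sa) T g sq | false =
    A , ≈T-refl A , subst (λ z → subCtx k T Δ ⊢ z ∶ A) (sym (cong erase# (if-var (k <ᵇ n) (pred n) n A))) (tvar eqv sq sa)
    where
    ek' : Δ k ≈M []
    ek' = subst (λ b → Δ k ≈M (if b then [ A ] else [])) (Eq.trans (≡ᵇ-sym k n) eq) (e k)
    nil : Δ k ≡ []
    nil = ≈M-[]⁻ ek'
    eqv : subCtx k T Δ ≈C singC (dropIdx k n) A
    eqv = ≈C-trans (+C-cong (≈C-refl {dropC k Δ}) (≡⇒≈C (λ m → cong (λ M → argsCtx T M m) nil)))
          (≈C-trans (+C-idʳ (dropC k Δ)) (≈C-trans (dropC-≈C k e) (≡⇒≈C (dropC-singC k n A eq))))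
  sub#-typed k {Δ} (lam ℓ a) (tlam {Δ = Δb} d e s sa) T g sq with Supplies-lam k T e (⊢-SeqCtx d) g sq
  ... | g' , sqb with sub#-typed (suc k) a d (liftArgs T) g' sqb
  ... | B₀' , eb , d' = arr (subCtx (suc k) (liftArgs T) Δb 0) ℓ B₀' , arr (≈M-sym (Δb 0) (subCtx-lam-zero k T Δb)) eb ,
        tlam d' (≈C-sym (subCtx-lam-tail k T Δb e)) sq (arr (proj₁ (sqb 0)) (proj₂ (sqb 0)) (⊢-SeqTy d'))
  sub#-typed k (app m a as) (tapp {Γ₀ = Γ₀} {Γs = Γs} {M = M} {Bs = Bs} d ds mm e _ _) T g sq =
    sub#-typed-app k T m a as Γ₀ Γs M Bs mm e sq
      (sub#-typed k a d T (Supplies-fun k T Γ₀ Γs e g) (proj₁ (SeqCtx-subCtx-app k T Γ₀ Γs e sq)))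
      (subs#-typed k as ds T (Supplies-args k T Γ₀ Γs e g) (proj₂ (SeqCtx-subCtx-app k T Γ₀ Γs e sq)))

  subs#-typed : ∀ k {Γs Bs us} (as : List MTm) → Γs ⊢* erases# as ∶ Bs → (T : TypedArgs us) →
           All (λ Γ → All (Supplies T) (Γ k)) Γs → SeqCtx (ΣC (map (subCtx k T) Γs)) →
           Σ (List Ty) λ Bs' → Pointwise _≈T_ Bs' Bs × map (subCtx k T) Γs ⊢* erases# (subs# k us as) ∶ Bs'
  subs#-typed k [] [] T [] sqs = [] , [] , []
  subs#-typed k {Γ ∷ Γs} (a ∷ as) (d ∷ ds) T (g ∷ gs) sqs
    with sub#-typed k a d T g (SeqCtx-+ˡ {subCtx k T Γ} sqs)
       | subs#-typed k as ds T gs (SeqCtx-+ʳ {subCtx k T Γ} sqs)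
  ... | B' , eB , d' | Bs' , pw , ds' = B' ∷ Bs' , eB ∷ pw , d' ∷ ds'

-- Complete developments preserve typing

-- The non-redex clause of res# only fires once the head of the first argument is known;
-- this lemma states it for every head.
res#-app-false : ∀ m a as b bs → res# (app m a as) (app false b bs) ≡ app m (res# a b) (ress# as bs)
res#-app-false m (var x x₁) as b bs = refl
res#-app-false m (lam x a) as (var x₁ x₂) bs = refl
res#-app-false m (lam x a) as (lam x₁ b) bs = refl
res#-app-false m (lam x a) as (app x₁ b x₂) bs = refl
res#-app-false m (app x a x₁) as b bs = refl

typedArgs : ∀ {Γs us Bs} → Γs ⊢* erases# us ∶ Bs → TypedArgs us
typedArgs {us = []} [] = []
typedArgs {Γ ∷ Γs} {us = u ∷ us} {B ∷ Bs} (d ∷ ds) = cons Γ B d (typedArgs ds)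

ext-∉ : ∀ B {C Bs} → Any (C ≈T_) Bs → All (ext B ≢_) (map ext Bs) → ext B ≢ ext C
ext-∉ B (here cb) (n ∷ _) e = n (Eq.trans e (ext-≈T cb))
ext-∉ B (there a) (_ ∷ ns) = ext-∉ B a ns

Supplies-∈ : ∀ {Γs us Bs} (ds : Γs ⊢* erases# us ∶ Bs) → SeqM Bs → ∀ C → Any (C ≈T_) Bs → Supplies (typedArgs ds) C
Supplies-∈ {us = u ∷ us} {B ∷ Bs} (d ∷ ds) sq C (here cb)
  rewrite ext-≈T (typeOf-≈T u d) | ≡⇒≡ᵇ-true (ext B) (ext C) (sym (ext-≈T cb)) = ≈T-sym C cb
Supplies-∈ {us = u ∷ us} {B ∷ Bs} (d ∷ ds) (nb ∷ sq) C (there a)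
  rewrite ext-≈T (typeOf-≈T u d) | ≢⇒≡ᵇ-false (ext B) (ext C) (ext-∉ B a nb) = Supplies-∈ ds sq C a

pickΓ-here : ∀ {u us Γ B} {d : Γ ⊢ erase# u ∶ B} (T' : TypedArgs us) C → (ext (typeOf u) ≡ᵇ ext C) ≡ true → pickΓ (cons Γ B d T') C ≡ Γ
pickΓ-here T' C e rewrite e = refl

pickΓ-there : ∀ {u us Γ B} {d : Γ ⊢ erase# u ∶ B} (T' : TypedArgs us) C → (ext (typeOf u) ≡ᵇ ext C) ≡ false → pickΓ (cons Γ B d T') C ≡ pickΓ T' C
pickΓ-there T' C e rewrite e = refl

pickΓ-head : ∀ {u us Γ B} {d : Γ ⊢ erase# u ∶ B} (T' : TypedArgs us) → ext (typeOf u) ≡ ext B → pickΓ (cons Γ B d T') B ≡ Γ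
pickΓ-head {B = B} {d} T' eq = pickΓ-here {d = d} T' B (Eq.trans (cong (_≡ᵇ ext B) eq) (≡ᵇ-refl (ext B)))

map-pickΓ-there : ∀ {u us Γ B} {d : Γ ⊢ erase# u ∶ B} (T' : TypedArgs us) → ext (typeOf u) ≡ ext B → ∀ Cs → All (ext B ≢_) (map ext Cs) →
        map (pickΓ (cons Γ B d T')) Cs ≡ map (pickΓ T') Cs
map-pickΓ-there T' eq [] _ = refl
map-pickΓ-there {B = B} {d} T' eq (C ∷ Cs) (n ∷ ns) =
  cong₂ _∷_ (pickΓ-there {d = d} T' C (Eq.trans (cong (_≡ᵇ ext C) eq) (≢⇒≡ᵇ-false (ext B) (ext C) n))) (map-pickΓ-there {d = d} T' eq Cs ns)

map-pickΓ-self : ∀ {Γs us Bs} (ds : Γs ⊢* erases# us ∶ Bs) → SeqM Bs → map (pickΓ (typedArgs ds)) Bs ≡ Γs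
map-pickΓ-self {us = []} [] sq = refl
map-pickΓ-self {Γ ∷ Γs} {u ∷ us} {B ∷ Bs} (d ∷ ds) (nb ∷ sq) =
  cong₂ _∷_ (pickΓ-head {d = d} (typedArgs ds) (ext-≈T (typeOf-≈T u d)))
      (Eq.trans (map-pickΓ-there {d = d} (typedArgs ds) (ext-≈T (typeOf-≈T u d)) Bs nb) (map-pickΓ-self ds sq))

redexArgs-supply : ∀ {Γs us Bs ℓ B₀} (Δb : Ctx) (ds : Γs ⊢* erases# us ∶ Bs) → SeqTy (arr (Δb 0) ℓ B₀) → Δb 0 ≈M Bs →
                 All (Supplies (typedArgs ds)) (Δb 0)
redexArgs-supply Δb ds sa m = All.map (λ {C} → Supplies-∈ ds (SeqM-≈M {Δb 0} m (SeqTy-dom sa)) C) (≈M⇒AllAny m)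

redexArgs-ctx : ∀ {Γ Γ₀ Γs us Bs ℓ B₀} (Δb : Ctx) (ds : Γs ⊢* erases# us ∶ Bs) → SeqTy (arr (Δb 0) ℓ B₀) → Δb 0 ≈M Bs →
            Γ₀ ≈C tailC Δb → Γ ≈C (Γ₀ +C ΣC Γs) → subCtx 0 (typedArgs ds) Δb ≈C Γ
redexArgs-ctx Δb ds sa m e₁ e =
  ≈C-trans (+C-cong {tailC Δb} (≈C-sym e₁)
    (≈C-trans (argsCtx-≈M (typedArgs ds) m) (≡⇒≈C (λ n → cong (λ Γs → ΣC Γs n) (map-pickΓ-self ds (SeqM-≈M {Δb 0} m (SeqTy-dom sa)))))))
  (≈C-sym e)

dev#-typed-lam : ∀ {Γ Δ ℓ B} (a : MTm) → Γ ≈C tailC Δ → SeqCtx Γ → Δ ⊢ erase# a ∶ B →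
  (Σ Ty λ B' → B' ≈T B × Δ ⊢ erase# (res# a a) ∶ B') →
  Σ Ty λ A' → A' ≈T arr (Δ 0) ℓ B × Γ ⊢ erase# (res# (lam ℓ a) (lam ℓ a)) ∶ A'
dev#-typed-lam {Δ = Δ} {ℓ} a e s d (B' , eb , d') =
  arr (Δ 0) ℓ B' , arr (≈M-refl _) eb , tlam d' e s (arr (proj₁ (⊢-SeqCtx d 0)) (proj₂ (⊢-SeqCtx d 0)) (⊢-SeqTy d'))

dev#-typed-app : ∀ {Γ Γ₀ Γs M ℓ A Bs} m (a : MTm) as → M ≈M Bs → Γ ≈C (Γ₀ +C ΣC Γs) → SeqCtx Γ →
  (Σ Ty λ B' → B' ≈T arr M ℓ A × Γ₀ ⊢ erase# (res# a a) ∶ B') →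
  (Σ (List Ty) λ Bs' → Pointwise _≈T_ Bs' Bs × Γs ⊢* erases# (ress# as as) ∶ Bs') →
  Σ Ty λ A' → A' ≈T A × Γ ⊢ erase# (app m (res# a a) (ress# as as)) ∶ A'
dev#-typed-app {M = M} m a as mm e s (arr M' _ A' , arr mM aA , d') (Bs' , pw , ds') =
  A' , aA , tapp d' ds' (≈M-trans M' mM (≈M-trans-≈PW mm pw)) e s (SeqTy-cod (⊢-SeqTy d'))

dev#-typed-redex : ∀ {Γ Γ₀ Γs Δb B₀ Bs ℓ} (a1 : MTm) as → Γ₀ ≈C tailC Δb → SeqTy (arr (Δb 0) ℓ B₀) →
  Δb 0 ≈M Bs → Γ ≈C (Γ₀ +C ΣC Γs) → SeqCtx Γ →
  (Σ Ty λ B' → B' ≈T B₀ × Δb ⊢ erase# (res# a1 a1) ∶ B') →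
  (Σ (List Ty) λ Bs' → Pointwise _≈T_ Bs' Bs × Γs ⊢* erases# (ress# as as) ∶ Bs') →
  Σ Ty λ A' → A' ≈T B₀ × Γ ⊢ erase# (sub# 0 (ress# as as) (res# a1 a1)) ∶ A'
dev#-typed-redex {Δb = Δb} a1 as e1 sa1 mm e s (B₀' , eb , d1') (Bs' , pw , ds') =
  let B' , eB , dd = sub#-typed 0 (res# a1 a1) d1' (typedArgs ds') (redexArgs-supply Δb ds' sa1 mB) (SeqCtx-≈C (≈C-sym eqΘ) s)
  in B' , ≈T-trans B' eB eb , ⊢-≈C dd eqΘ
  where
  mB = ≈M-trans-≈PW mm pw
  eqΘ = redexArgs-ctx Δb ds' sa1 mB e1 e

mutual
  dev#-typed : ∀ {Γ A} (a : MTm) → valid# a ≡ true → Γ ⊢ erase# a ∶ A → Σ Ty λ A' → A' ≈T A × Γ ⊢ erase# (res# a a) ∶ A'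
  dev#-typed (var n B) v d@(tvar _ _ _) = B , ≈T-refl B , d
  dev#-typed (lam ℓ a) v (tlam d e s sa) = dev#-typed-lam a e s d (dev#-typed a v d)
  dev#-typed (app false a as) v (tapp d ds mm e s sa) rewrite res#-app-false false a as a as =
    dev#-typed-app false a as mm e s (dev#-typed a (∧-trueˡ v) d) (devs#-typed as (∧-trueʳ v) ds)
  dev#-typed (app true (var _ _) as) () d
  dev#-typed (app true (app _ _ _) as) () d
  dev#-typed (app true (lam ℓ a1) as) v (tapp (tlam d1 e1 s1 sa1) ds mm e s sa) =
    dev#-typed-redex a1 as e1 sa1 mm e s (dev#-typed a1 (∧-trueˡ v) d1) (devs#-typed as (∧-trueʳ v) ds)

  devs#-typed : ∀ {Γs Bs} (as : List MTm) → valids# as ≡ true → Γs ⊢* erases# as ∶ Bs →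
          Σ (List Ty) λ Bs' → Pointwise _≈T_ Bs' Bs × Γs ⊢* erases# (ress# as as) ∶ Bs'
  devs#-typed [] v [] = [] , [] , []
  devs#-typed (a ∷ as) v (d ∷ ds) =
    let B' , eb , d' = dev#-typed a (∧-trueˡ v) d
        Bs' , pw , ds' = devs#-typed as (∧-trueʳ v) ds
    in B' ∷ Bs' , eb ∷ pw , d' ∷ ds'

labels# : MTm → List Label
labels# a = lamLabels (erase# a)

labelss# : List MTm → List Label
labelss# as = lamLabelss (erases# as)

concatMap-++ : ∀ {X Y : Set} (f : X → List Y) xs ys → concatMap f (xs ++ ys) ≡ concatMap f xs ++ concatMap f ys
concatMap-++ f [] ys = refl
concatMap-++ f (x ∷ xs) ys = Eq.trans (cong (f x ++_) (concatMap-++ f xs ys)) (sym (LP.++-assoc (f x) _ _))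

concatMap-↭ : ∀ {X Y : Set} (f : X → List Y) {xs ys} → xs ↭ ys → concatMap f xs ↭ concatMap f ys
concatMap-↭ f refl = refl
concatMap-↭ f (prep x p) = ++⁺ˡ (f x) (concatMap-↭ f p)
concatMap-↭ f {x ∷ y ∷ xs} {_ ∷ _ ∷ ys} (swap _ _ p) =
  trans (↭-reflexive (sym (LP.++-assoc (f x) (f y) (concatMap f xs))))
  (trans (++⁺ (↭P.++-comm (f x) (f y)) (concatMap-↭ f p))
  (↭-reflexive (LP.++-assoc (f y) (f x) (concatMap f ys))))
concatMap-↭ f (trans p q) = trans (concatMap-↭ f p) (concatMap-↭ f q)

++-interchange-↭ : ∀ {X : Set} (a b c d : List X) → (a ++ b) ++ (c ++ d) ↭ (a ++ c) ++ (b ++ d)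
++-interchange-↭ a b c d = trans (↭-reflexive (LP.++-assoc a b (c ++ d)))
  (trans (++⁺ˡ a (shifts b c)) (↭-reflexive (sym (LP.++-assoc a c (b ++ d)))))

pickLabels : Pick → List Label
pickLabels none = []
pickLabels (some u) = labels# u

pickedLabels : List MTm → Ty → List Label
pickedLabels us A = pickLabels (pick A us)

pick-ext : ∀ {A A'} → ext A ≡ ext A' → ∀ us → pick A us ≡ pick A' us
pick-ext e [] = refl
pick-ext {A} {A'} e (u ∷ us) rewrite e = cong (if ext (typeOf u) ≡ᵇ ext A' then some u else_) (pick-ext e us)

mutual
  labels#-lift# : ∀ c a → labels# (lift# c a) ≡ labels# a
  labels#-lift# c (var n A) = refl
  labels#-lift# c (lam ℓ a) = cong (ℓ ∷_) (labels#-lift# (suc c) a)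
  labels#-lift# c (app m a as) = cong₂ _++_ (labels#-lift# c a) (labelss#-lifts# c as)

  labelss#-lifts# : ∀ c as → labelss# (lifts# c as) ≡ labelss# as
  labelss#-lifts# c [] = refl
  labelss#-lifts# c (a ∷ as) = cong₂ _++_ (labels#-lift# c a) (labelss#-lifts# c as)

pickedLabels-lifts# : ∀ us A → pickedLabels (lifts# 0 us) A ≡ pickedLabels us A
pickedLabels-lifts# [] A = refl
pickedLabels-lifts# (u ∷ us) A rewrite typeOf-lift 0 u with ext (typeOf u) ≡ᵇ ext A
... | true = labels#-lift# 0 u
... | false = pickedLabels-lifts# us A

labels#-fromPick : ∀ p n A → labels# (fromPick p (var n A)) ≡ pickLabels p
labels#-fromPick none n A = refl
labels#-fromPick (some u) n A = refl

labels#-if-var : ∀ (b : Bool) x y A → labels# (if b then var x A else var y A) ≡ []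
labels#-if-var true x y A = refl
labels#-if-var false x y A = refl

mutual
  labels#-sub# : ∀ k us w → labels# (sub# k us w) ↭ labels# w ++ concatMap (pickedLabels us) (occ k w)
  labels#-sub# k us (var n A) with n ≡ᵇ k
  ... | true = ↭-reflexive (Eq.trans (labels#-fromPick (pick A us) n A) (sym (LP.++-identityʳ _)))
  ... | false = ↭-reflexive (labels#-if-var (k <ᵇ n) (pred n) n A)
  labels#-sub# k us (lam ℓ a) = prep ℓ (trans (labels#-sub# (suc k) (lifts# 0 us) a)
    (↭-reflexive (cong (labels# a ++_) (LP.concatMap-cong (pickedLabels-lifts# us) (occ (suc k) a)))))
  labels#-sub# k us (app m a as) = trans (++⁺ (labels#-sub# k us a) (labelss#-subs# k us as))
    (trans (++-interchange-↭ (labels# a) _ (labelss# as) _) (↭-reflexive (cong ((labels# a ++ labelss# as) ++_) (sym (concatMap-++ (pickedLabels us) (occ k a) (occs k as))))))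

  labelss#-subs# : ∀ k us ws → labelss# (subs# k us ws) ↭ labelss# ws ++ concatMap (pickedLabels us) (occs k ws)
  labelss#-subs# k us [] = refl
  labelss#-subs# k us (a ∷ as) = trans (++⁺ (labels#-sub# k us a) (labelss#-subs# k us as))
    (trans (++-interchange-↭ (labels# a) _ (labelss# as) _) (↭-reflexive (cong ((labels# a ++ labelss# as) ++_) (sym (concatMap-++ (pickedLabels us) (occ k a) (occs k as))))))

-- The linear substitution uses each argument at most once, so the lambda labels of a
-- development form a SubBag of the original ones and stay pairwise distinct.
SubBag : List Label → List Label → Set
SubBag xs ys = Σ (List Label) λ X → ys ↭ xs ++ X

SubBag-↭ : ∀ {xs ys} → xs ↭ ys → SubBag xs ys
SubBag-↭ {xs} p = [] , trans (↭-sym p) (↭-reflexive (sym (LP.++-identityʳ xs)))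

SubBag-++ : ∀ {xs ys xs' ys'} → SubBag xs ys → SubBag xs' ys' → SubBag (xs ++ xs') (ys ++ ys')
SubBag-++ {xs} {ys} {xs'} (X , p) (X' , p') = X ++ X' , trans (++⁺ p p') (++-interchange-↭ xs X xs' X')

SubBag-∷ʳ : ∀ {xs ys} ℓ → SubBag xs ys → SubBag xs (ℓ ∷ ys)
SubBag-∷ʳ {xs} ℓ (X , p) = ℓ ∷ X , trans (prep ℓ p) (↭-sym (shift ℓ xs X))

SubBag-∷ : ∀ {xs ys} ℓ → SubBag xs ys → SubBag (ℓ ∷ xs) (ℓ ∷ ys)
SubBag-∷ ℓ (X , p) = X , prep ℓ p

SubBag-trans : ∀ {xs ys zs} → SubBag xs ys → SubBag ys zs → SubBag xs zs
SubBag-trans {xs} (X , p) (Y , q) = X ++ Y , trans q (trans (++⁺ʳ Y p) (↭-reflexive (LP.++-assoc xs X Y)))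

SubBag-Unique : ∀ {xs ys} → SubBag xs ys → Unique ys → Unique xs
SubBag-Unique {xs} (X , p) u = Unique-++⁻ˡ xs (Unique-resp-↭ u p)

pickedLabels-here : ∀ u us C → (ext (typeOf u) ≡ᵇ ext C) ≡ true → pickedLabels (u ∷ us) C ≡ labels# u
pickedLabels-here u us C e rewrite e = refl

pickedLabels-there : ∀ u us C → (ext (typeOf u) ≡ᵇ ext C) ≡ false → pickedLabels (u ∷ us) C ≡ pickedLabels us C
pickedLabels-there u us C e rewrite e = refl

concatMap-pickedLabels-there : ∀ u us B → ext (typeOf u) ≡ ext B → ∀ Cs → All (ext B ≢_) (map ext Cs) →
  concatMap (pickedLabels (u ∷ us)) Cs ≡ concatMap (pickedLabels us) Cs
concatMap-pickedLabels-there u us B eq [] _ = refl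
concatMap-pickedLabels-there u us B eq (C ∷ Cs) (n ∷ ns) =
  cong₂ _++_ (pickedLabels-there u us C (Eq.trans (cong (_≡ᵇ ext C) eq) (≢⇒≡ᵇ-false (ext B) (ext C) n)))
      (concatMap-pickedLabels-there u us B eq Cs ns)

concatMap-pickedLabels-self : ∀ {Γs us Bs} → Γs ⊢* erases# us ∶ Bs → SeqM Bs → concatMap (pickedLabels us) Bs ≡ labelss# us
concatMap-pickedLabels-self {us = []} [] sq = refl
concatMap-pickedLabels-self {us = u ∷ us} {B ∷ Bs} (d ∷ ds) (nb ∷ sq) =
  cong₂ _++_ (pickedLabels-here u us B (Eq.trans (cong (_≡ᵇ ext B) (ext-≈T (typeOf-≈T u d))) (≡ᵇ-refl (ext B))))
             (Eq.trans (concatMap-pickedLabels-there u us B (ext-≈T (typeOf-≈T u d)) Bs nb) (concatMap-pickedLabels-self ds sq))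

concatMap-pickedLabels-≈PW : ∀ us {O P} → Pointwise _≈T_ O P → concatMap (pickedLabels us) O ≡ concatMap (pickedLabels us) P
concatMap-pickedLabels-≈PW us [] = refl
concatMap-pickedLabels-≈PW us (r ∷ pw) = cong₂ _++_ (cong pickLabels (pick-ext (ext-≈T r) us)) (concatMap-pickedLabels-≈PW us pw)

concatMap-pickedLabels-≈M : ∀ {Γs us Bs} → Γs ⊢* erases# us ∶ Bs → SeqM Bs → ∀ {O} → O ≈M Bs → concatMap (pickedLabels us) O ↭ labelss# us
concatMap-pickedLabels-≈M {us = us} ds sq m with ≈M⇒PointwisePerm m
... | P , pw , p = trans (↭-reflexive (concatMap-pickedLabels-≈PW us pw)) (trans (concatMap-↭ (pickedLabels us) p) (↭-reflexive (concatMap-pickedLabels-self ds sq)))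

labels#-dev#-redex : ∀ {Γs Δb B₀ Bs ℓ} (a1 : MTm) as → SeqTy (arr (Δb 0) ℓ B₀) → Δb 0 ≈M Bs →
  (Σ Ty λ B' → B' ≈T B₀ × Δb ⊢ erase# (res# a1 a1) ∶ B') →
  (Σ (List Ty) λ Bs' → Pointwise _≈T_ Bs' Bs × Γs ⊢* erases# (ress# as as) ∶ Bs') →
  SubBag (labels# (res# a1 a1)) (labels# a1) → SubBag (labelss# (ress# as as)) (labelss# as) →
  SubBag (labels# (sub# 0 (ress# as as) (res# a1 a1))) (ℓ ∷ (labels# a1 ++ labelss# as))
labels#-dev#-redex {Δb = Δb} {ℓ = ℓ} a1 as sa1 mm (B₀' , eb , d1') (Bs' , pw , ds') sb1 sbs =
  SubBag-trans (SubBag-↭ (trans (labels#-sub# 0 (ress# as as) (res# a1 a1)) (++⁺ˡ (labels# (res# a1 a1)) (concatMap-pickedLabels-≈M ds' sBs' mO))))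
           (SubBag-∷ʳ ℓ (SubBag-++ sb1 sbs))
  where
  mB = ≈M-trans-≈PW mm pw
  sBs' = SeqM-≈M {Δb 0} mB (SeqTy-dom sa1)
  mO = ≈M-trans _ (occ-≈M (res# a1 a1) 0 d1') mB

mutual
  labels#-dev# : ∀ {Γ A} (a : MTm) → valid# a ≡ true → Γ ⊢ erase# a ∶ A → SubBag (labels# (res# a a)) (labels# a)
  labels#-dev# (var n B) v d = SubBag-↭ refl
  labels#-dev# (lam ℓ a) v (tlam d e s sa) = SubBag-∷ ℓ (labels#-dev# a v d)
  labels#-dev# (app false a as) v (tapp d ds mm e s sa) rewrite res#-app-false false a as a as =
    SubBag-++ (labels#-dev# a (∧-trueˡ v) d) (labelss#-devs# as (∧-trueʳ v) ds)
  labels#-dev# (app true (var _ _) as) () d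
  labels#-dev# (app true (app _ _ _) as) () d
  labels#-dev# (app true (lam ℓ a1) as) v (tapp (tlam d1 e1 s1 sa1) ds mm e s sa) =
    labels#-dev#-redex a1 as sa1 mm (dev#-typed a1 (∧-trueˡ v) d1) (devs#-typed as (∧-trueʳ v) ds)
        (labels#-dev# a1 (∧-trueˡ v) d1) (labelss#-devs# as (∧-trueʳ v) ds)

  labelss#-devs# : ∀ {Γs Bs} (as : List MTm) → valids# as ≡ true → Γs ⊢* erases# as ∶ Bs → SubBag (labelss# (ress# as as)) (labelss# as)
  labelss#-devs# [] v [] = SubBag-↭ refl
  labelss#-devs# (a ∷ as) v (d ∷ ds) = SubBag-++ (labels#-dev# a (∧-trueˡ v) d) (labelss#-devs# as (∧-trueʳ v) ds)

dev#-correct : ∀ (a : MTm) → valid# a ≡ true → Correct (erase# a) → Correct (dev# a)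
dev#-correct a v (Γ , A , d , u) with dev#-typed a v d
... | A' , _ , d' = Γ , A' , d' , SubBag-Unique (labels#-dev# a v d) u

res-app-false : ∀ m a b a' b' → res (mapp m a b) (mapp false a' b') ≡ mapp m (res a a') (res b b')
res-app-false m (mvar x) b a' b' = refl
res-app-false m (mlam a) b (mvar x) b' = refl
res-app-false m (mlam a) b (mlam a') b' = refl
res-app-false m (mlam a) b (mapp x a' a'') b' = refl
res-app-false m (mapp x a a₁) b a' b' = refl

valid-lift : ∀ c a → valid a ≡ true → valid (lift c a) ≡ true
valid-lift c (mvar n) v = refl
valid-lift c (mlam a) v = valid-lift (suc c) a v
valid-lift c (mapp false a b) v = ∧-true⁺ (valid-lift c a (∧-trueˡ v)) (valid-lift c b (∧-trueʳ v))
valid-lift c (mapp true (mlam a) b) v = ∧-true⁺ (valid-lift (suc c) a (∧-trueˡ v)) (valid-lift c b (∧-trueʳ v))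
valid-lift c (mapp true (mvar _) b) ()
valid-lift c (mapp true (mapp _ _ _) b) ()

valid-if : ∀ (b : Bool) {x y} → valid x ≡ true → valid y ≡ true → valid (if b then x else y) ≡ true
valid-if true p q = p
valid-if false p q = q

valid-sub : ∀ k u w → valid u ≡ true → valid w ≡ true → valid (sub k u w) ≡ true
valid-sub k u (mvar n) vu vw = valid-if (n ≡ᵇ k) vu (valid-if (k <ᵇ n) refl refl)
valid-sub k u (mlam w) vu vw = valid-sub (suc k) (lift 0 u) w (valid-lift 0 u vu) vw
valid-sub k u (mapp false a b) vu vw = ∧-true⁺ (valid-sub k u a vu (∧-trueˡ vw)) (valid-sub k u b vu (∧-trueʳ vw))
valid-sub k u (mapp true (mlam a) b) vu vw =
  ∧-true⁺ (valid-sub (suc k) (lift 0 u) a (valid-lift 0 u vu) (∧-trueˡ vw)) (valid-sub k u b vu (∧-trueʳ vw))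
valid-sub k u (mapp true (mvar _) b) vu ()
valid-sub k u (mapp true (mapp _ _ _) b) vu ()

valid-res : ∀ a b → valid a ≡ true → valid b ≡ true → valid (res a b) ≡ true
valid-res (mvar n) (mvar _) va vb = refl
valid-res (mvar n) (mlam b) va vb = refl
valid-res (mvar n) (mapp _ _ _) va vb = refl
valid-res (mlam a) (mvar _) va vb = va
valid-res (mlam a) (mlam b) va vb = valid-res a b va vb
valid-res (mlam a) (mapp _ _ _) va vb = va
valid-res (mapp m (mvar _) a₂) (mvar _) va vb = va
valid-res (mapp m (mvar _) a₂) (mlam _) va vb = va
valid-res (mapp m (mlam _) a₂) (mvar _) va vb = va
valid-res (mapp m (mlam _) a₂) (mlam _) va vb = va
valid-res (mapp m (mapp _ _ _) a₂) (mvar _) va vb = va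
valid-res (mapp m (mapp _ _ _) a₂) (mlam _) va vb = va
valid-res (mapp m a₁ a₂) (mapp false b₁ b₂) va vb rewrite res-app-false m a₁ a₂ b₁ b₂ = by-head m a₁ b₁ va vb
  where
  by-head : ∀ m a₁ b₁ → valid (mapp m a₁ a₂) ≡ true → valid (mapp false b₁ b₂) ≡ true → valid (mapp m (res a₁ b₁) (res a₂ b₂)) ≡ true
  by-head false a₁ b₁ va vb = ∧-true⁺ (valid-res a₁ b₁ (∧-trueˡ va) (∧-trueˡ vb)) (valid-res a₂ b₂ (∧-trueʳ va) (∧-trueʳ vb))
  by-head true (mlam a) (mvar _) va vb = ∧-true⁺ (∧-trueˡ va) (valid-res a₂ b₂ (∧-trueʳ va) (∧-trueʳ vb))
  by-head true (mlam a) (mlam b) va vb = ∧-true⁺ (valid-res a b (∧-trueˡ va) (∧-trueˡ vb)) (valid-res a₂ b₂ (∧-trueʳ va) (∧-trueʳ vb))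
  by-head true (mlam a) (mapp _ _ _) va vb = ∧-true⁺ (∧-trueˡ va) (valid-res a₂ b₂ (∧-trueʳ va) (∧-trueʳ vb))
  by-head true (mvar _) _ () vb
  by-head true (mapp _ _ _) _ () vb
valid-res (mapp false (mlam a₁) a₂) (mapp true (mlam b₁) b₂) va vb =
  valid-sub 0 (res a₂ b₂) (res a₁ b₁) (valid-res a₂ b₂ (∧-trueʳ va) (∧-trueʳ vb)) (valid-res a₁ b₁ (∧-trueˡ va) (∧-trueˡ vb))
valid-res (mapp true (mlam a₁) a₂) (mapp true (mlam b₁) b₂) va vb =
  valid-sub 0 (res a₂ b₂) (res a₁ b₁) (valid-res a₂ b₂ (∧-trueʳ va) (∧-trueʳ vb)) (valid-res a₁ b₁ (∧-trueˡ va) (∧-trueˡ vb))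
valid-res (mapp false (mvar _) a₂) (mapp true (mlam b₁) b₂) va vb =
  ∧-true⁺ (∧-trueˡ va) (valid-res a₂ b₂ (∧-trueʳ va) (∧-trueʳ vb))
valid-res (mapp false (mapp m' x y) a₂) (mapp true (mlam b₁) b₂) va vb =
  ∧-true⁺ (valid-res (mapp m' x y) (mlam b₁) (∧-trueˡ va) (∧-trueˡ vb)) (valid-res a₂ b₂ (∧-trueʳ va) (∧-trueʳ vb))
valid-res (mapp true (mvar _) a₂) (mapp true (mlam b₁) b₂) () vb
valid-res (mapp true (mapp _ _ _) a₂) (mapp true (mlam b₁) b₂) () vb
valid-res (mapp m a₁ a₂) (mapp true (mvar _) b₂) va ()
valid-res (mapp m a₁ a₂) (mapp true (mapp _ _ _) b₂) va ()

-- Transfer of redex sets to a refinement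

mutual
  erase#-unmark : ∀ t → erase# (unmark t) ≡ t
  erase#-unmark (var n A) = refl
  erase#-unmark (lam ℓ t) = cong (lam ℓ) (erase#-unmark t)
  erase#-unmark (app t ts) = cong₂ app (erase#-unmark t) (erases#-unmarks ts)

  erases#-unmarks : ∀ ts → erases# (unmarks ts) ≡ ts
  erases#-unmarks [] = refl
  erases#-unmarks (t ∷ ts) = cong₂ _∷_ (erase#-unmark t) (erases#-unmarks ts)

mutual
  erase#-tr : ∀ a t → erase# (tr a t) ≡ t
  erase#-tr (mvar _) (var n A) = refl
  erase#-tr (mvar _) (lam ℓ t) = erase#-unmark _
  erase#-tr (mvar _) (app t ts) = erase#-unmark (app t ts)
  erase#-tr (mlam a) (var n A) = refl
  erase#-tr (mlam a) (lam ℓ t) = cong (lam ℓ) (erase#-tr a t)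
  erase#-tr (mlam a) (app t ts) = erase#-unmark (app t ts)
  erase#-tr (mapp m a b) (var n A) = refl
  erase#-tr (mapp m a b) (lam ℓ t) = erase#-unmark (lam ℓ t)
  erase#-tr (mapp m a b) (app t ts) = cong₂ app (erase#-tr a t) (erases#-trs b ts)

  erases#-trs : ∀ b ts → erases# (trs b ts) ≡ ts
  erases#-trs b [] = refl
  erases#-trs b (t ∷ ts) = cong₂ _∷_ (erase#-tr b t) (erases#-trs b ts)

clearMarks : MTm → MTm
clearMarks x = unmark (erase# x)

mutual
  occ-clearMarks : ∀ k x → occ k x ≡ occ k (clearMarks x)
  occ-clearMarks k (var n A) = refl
  occ-clearMarks k (lam ℓ x) = occ-clearMarks (suc k) x
  occ-clearMarks k (app m x xs) = cong₂ _++_ (occ-clearMarks k x) (occs-clearMarks k xs)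

  occs-clearMarks : ∀ k xs → occs k xs ≡ occs k (unmarks (erases# xs))
  occs-clearMarks k [] = refl
  occs-clearMarks k (x ∷ xs) = cong₂ _++_ (occ-clearMarks k x) (occs-clearMarks k xs)

typeOf-clearMarks : ∀ x → typeOf x ≡ typeOf (clearMarks x)
typeOf-clearMarks (var n A) = refl
typeOf-clearMarks (lam ℓ x) = cong₂ (λ M B → arr M ℓ B) (occ-clearMarks 0 x) (typeOf-clearMarks x)
typeOf-clearMarks (app m x xs) = cong cod (typeOf-clearMarks x)

typeOf-tr : ∀ v u → typeOf (tr v (erase# u)) ≡ typeOf u
typeOf-tr v u = Eq.trans (typeOf-clearMarks (tr v (erase# u)))
  (Eq.trans (cong (λ t → typeOf (unmark t)) (erase#-tr v (erase# u))) (sym (typeOf-clearMarks u)))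

mutual
  clearMarks-lift# : ∀ c x → clearMarks (lift# c x) ≡ lift# c (clearMarks x)
  clearMarks-lift# c (var n A) = refl
  clearMarks-lift# c (lam ℓ x) = cong (lam ℓ) (clearMarks-lift# (suc c) x)
  clearMarks-lift# c (app m x xs) = cong₂ (app false) (clearMarks-lift# c x) (clearMarkss-lifts# c xs)

  clearMarkss-lifts# : ∀ c xs → unmarks (erases# (lifts# c xs)) ≡ lifts# c (unmarks (erases# xs))
  clearMarkss-lifts# c [] = refl
  clearMarkss-lifts# c (x ∷ xs) = cong₂ _∷_ (clearMarks-lift# c x) (clearMarkss-lifts# c xs)

mutual
  tr-lift : ∀ c v x → tr (lift c v) (erase# (lift# c x)) ≡ lift# c (tr v (erase# x))
  tr-lift c (mvar _) (var n A) = refl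
  tr-lift c (mvar _) (lam ℓ x) = clearMarks-lift# c (lam ℓ x)
  tr-lift c (mvar _) (app m x xs) = clearMarks-lift# c (app m x xs)
  tr-lift c (mlam v) (var n A) = refl
  tr-lift c (mlam v) (lam ℓ x) = cong (lam ℓ) (tr-lift (suc c) v x)
  tr-lift c (mlam v) (app m x xs) = clearMarks-lift# c (app m x xs)
  tr-lift c (mapp m v w) (var n A) = refl
  tr-lift c (mapp m v w) (lam ℓ x) = clearMarks-lift# c (lam ℓ x)
  tr-lift c (mapp m v w) (app m' x xs) = cong₂ (app m) (tr-lift c v x) (trs-lift c w xs)

  trs-lift : ∀ c w xs → trs (lift c w) (erases# (lifts# c xs)) ≡ lifts# c (trs w (erases# xs))
  trs-lift c w [] = refl
  trs-lift c w (x ∷ xs) = cong₂ _∷_ (tr-lift c w x) (trs-lift c w xs)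

tr-var : ∀ v n A → tr v (var n A) ≡ var n A
tr-var (mvar _) n A = refl
tr-var (mlam v) n A = refl
tr-var (mapp m v w) n A = refl

mapPick : (MTm → MTm) → Pick → Pick
mapPick f none = none
mapPick f (some u) = some (f u)

pick-tr : ∀ v A Us → pick A (trs v (erases# Us)) ≡ mapPick (λ u → tr v (erase# u)) (pick A Us)
pick-tr v A [] = refl
pick-tr v A (u ∷ Us) rewrite typeOf-tr v u with ext (typeOf u) ≡ᵇ ext A
... | true = refl
... | false = pick-tr v A Us

tr-fromPick : ∀ v p n A → tr v (erase# (fromPick p (var n A))) ≡ fromPick (mapPick (λ u → tr v (erase# u)) p) (var n A)
tr-fromPick v none n A = tr-var v n A
tr-fromPick v (some u) n A = refl

tr-if-var : ∀ (b : Bool) (x y : ℕ) A → tr (if b then mvar x else mvar y) (erase# (if b then var x A else var y A)) ≡ (if b then var x A else var y A)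
tr-if-var true x y A = refl
tr-if-var false x y A = refl

mutual
  tr-sub : ∀ k v w (W : MTm) Us → erase# W ⋉ erase w →
          tr (sub k v w) (erase# (sub# k Us W)) ≡ sub# k (trs v (erases# Us)) (tr w (erase# W))
  tr-sub k v (mvar n) (var .n A) Us var with n ≡ᵇ k
  ... | true = Eq.trans (tr-fromPick v (pick A Us) n A) (cong (λ p → fromPick p (var n A)) (sym (pick-tr v A Us)))
  ... | false = tr-if-var (k <ᵇ n) (pred n) n A
  tr-sub k v (mlam w) (lam ℓ W) Us (lam r) =
    cong (lam ℓ) (Eq.trans (tr-sub (suc k) (lift 0 v) w W (lifts# 0 Us) r)
      (cong (λ z → sub# (suc k) z (tr w (erase# W))) (trs-lift 0 v Us)))
  tr-sub k v (mapp m w₁ w₂) (app m' W Ws) Us (app r rs) =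
    cong₂ (app m) (tr-sub k v w₁ W Us r) (trs-subs k v w₂ Ws Us rs)

  trs-subs : ∀ k v w (Ws : List MTm) Us → All (_⋉ erase w) (erases# Ws) →
           trs (sub k v w) (erases# (subs# k Us Ws)) ≡ subs# k (trs v (erases# Us)) (trs w (erases# Ws))
  trs-subs k v w [] Us [] = refl
  trs-subs k v w (W ∷ Ws) Us (r ∷ rs) = cong₂ _∷_ (tr-sub k v w W Us r) (trs-subs k v w Ws Us rs)

IsSome : Pick → Set
IsSome none = ⊥
IsSome (some _) = ⊤

-- Every occurrence of index k in W finds an argument, so sub# k Us W never falls back
-- on the variable itself.
Covers : ℕ → List MTm → MTm → Set
Covers k Us W = All (λ A → IsSome (pick A Us)) (occ k W)

pick-lifts# : ∀ c A us → pick A (lifts# c us) ≡ mapPick (lift# c) (pick A us)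
pick-lifts# c A [] = refl
pick-lifts# c A (u ∷ us) rewrite typeOf-lift c u with ext (typeOf u) ≡ᵇ ext A
... | true = refl
... | false = pick-lifts# c A us

IsSome-mapPick : ∀ f p → IsSome p → IsSome (mapPick f p)
IsSome-mapPick f (some u) _ = tt

IsSome-mapPick⁻ : ∀ f p → IsSome (mapPick f p) → IsSome p
IsSome-mapPick⁻ f (some u) _ = tt

IsSome-lifts# : ∀ c A us → IsSome (pick A us) → IsSome (pick A (lifts# c us))
IsSome-lifts# c A us o = subst IsSome (sym (pick-lifts# c A us)) (IsSome-mapPick (lift# c) (pick A us) o)

IsSome-unlifts# : ∀ c A us → IsSome (pick A (lifts# c us)) → IsSome (pick A us)
IsSome-unlifts# c A us o = IsSome-mapPick⁻ (lift# c) (pick A us) (subst IsSome (pick-lifts# c A us) o)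

mutual
  ⋉-lift# : ∀ c (u : MTm) v → erase# u ⋉ erase v → erase# (lift# c u) ⋉ erase (lift c v)
  ⋉-lift# c (var n A) (mvar .n) var = var
  ⋉-lift# c (lam ℓ u) (mlam v) (lam r) = lam (⋉-lift# (suc c) u v r)
  ⋉-lift# c (app m u us) (mapp m' v w) (app r rs) = app (⋉-lift# c u v r) (⋉-lifts# c us w rs)

  ⋉-lifts# : ∀ c (us : List MTm) w → All (_⋉ erase w) (erases# us) → All (_⋉ erase (lift c w)) (erases# (lifts# c us))
  ⋉-lifts# c [] w [] = []
  ⋉-lifts# c (u ∷ us) w (r ∷ rs) = ⋉-lift# c u w r ∷ ⋉-lifts# c us w rs

All-⋉-lifts# : ∀ c Us v → All (λ u → erase# u ⋉ erase v) Us → All (λ u → erase# u ⋉ erase (lift c v)) (lifts# c Us)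
All-⋉-lifts# c [] v [] = []
All-⋉-lifts# c (u ∷ Us) v (r ∷ rs) = ⋉-lift# c u v r ∷ All-⋉-lifts# c Us v rs

Covers-lam : ∀ k Us W → Covers k Us (lam 0 W) → Covers (suc k) (lifts# 0 Us) W
Covers-lam k Us W p = All.map (λ {A} → IsSome-lifts# 0 A Us) p

pick-All : ∀ {P : MTm → Set} A Us u → All P Us → pick A Us ≡ some u → P u
pick-All A [] u [] ()
pick-All A (u' ∷ Us) u (p ∷ ps) e with ext (typeOf u') ≡ᵇ ext A
pick-All A (u' ∷ Us) .u' (p ∷ ps) refl | true = p
... | false = pick-All A Us u ps e

⋉-if-var : ∀ (b : Bool) (x y : ℕ) A → erase# (if b then var x A else var y A) ⋉ erase (if b then mvar x else mvar y)
⋉-if-var true x y A = var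
⋉-if-var false x y A = var

mutual
  ⋉-sub : ∀ k v w (W : MTm) Us → erase# W ⋉ erase w → All (λ u → erase# u ⋉ erase v) Us → Covers k Us W →
           erase# (sub# k Us W) ⋉ erase (sub k v w)
  ⋉-sub k v (mvar n) (var .n A) Us var rs ps with n ≡ᵇ k
  ⋉-sub k v (mvar n) (var .n A) Us var rs (o ∷ []) | true with pick A Us in eq
  ... | some u = pick-All A Us u rs eq
  ⋉-sub k v (mvar n) (var .n A) Us var rs ps | false = ⋉-if-var (k <ᵇ n) (pred n) n A
  ⋉-sub k v (mlam w) (lam ℓ W) Us (lam r) rs ps =
    lam (⋉-sub (suc k) (lift 0 v) w W (lifts# 0 Us) r (All-⋉-lifts# 0 Us v rs) (Covers-lam k Us W ps))
  ⋉-sub k v (mapp m w₁ w₂) (app m' W Ws) Us (app r rs') rs ps =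
    app (⋉-sub k v w₁ W Us r rs (++⁻ˡ (occ k W) ps)) (⋉-subs k v w₂ Ws Us rs' rs (++⁻ʳ (occ k W) ps))

  ⋉-subs : ∀ k v w (Ws : List MTm) Us → All (_⋉ erase w) (erases# Ws) → All (λ u → erase# u ⋉ erase v) Us →
            All (λ A → IsSome (pick A Us)) (occs k Ws) → All (_⋉ erase (sub k v w)) (erases# (subs# k Us Ws))
  ⋉-subs k v w [] Us [] rs ps = []
  ⋉-subs k v w (W ∷ Ws) Us (r ∷ rs') rs ps =
    ⋉-sub k v w W Us r rs (++⁻ˡ (occ k W) ps) ∷ ⋉-subs k v w Ws Us rs' rs (++⁻ʳ (occ k W) ps)

mutual
  valid#-tr : ∀ c t → valid c ≡ true → t ⋉ erase c → valid# (tr c t) ≡ true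
  valid#-tr (mvar _) (var n A) v var = refl
  valid#-tr (mlam c) (lam ℓ t) v (lam r) = valid#-tr c t v r
  valid#-tr (mapp false c₁ c₂) (app t ts) v (app r rs) = ∧-true⁺ (valid#-tr c₁ t (∧-trueˡ v) r) (valids#-trs c₂ ts (∧-trueʳ v) rs)
  valid#-tr (mapp true (mlam c₁) c₂) (app (lam ℓ t) ts) v (app (lam r) rs) =
    ∧-true⁺ (valid#-tr c₁ t (∧-trueˡ v) r) (valids#-trs c₂ ts (∧-trueʳ v) rs)
  valid#-tr (mapp true (mvar _) c₂) (app t ts) () r
  valid#-tr (mapp true (mapp _ _ _) c₂) (app t ts) () r

  valids#-trs : ∀ c ts → valid c ≡ true → All (_⋉ erase c) ts → valids# (trs c ts) ≡ true
  valids#-trs c [] v [] = refl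
  valids#-trs c (t ∷ ts) v (r ∷ rs) = ∧-true⁺ (valid#-tr c t v r) (valids#-trs c ts v rs)

Supplies⇒IsSome : ∀ {us} (T : TypedArgs us) C → Supplies T C → IsSome (pick C us)
Supplies⇒IsSome {us} T C g rewrite pick-untyped C T with pickTyped C T
... | someP _ _ _ _ = tt

Covers-typed : ∀ {Δ B Γs us Bs'} (W : MTm) → Δ ⊢ erase# W ∶ B → (ds : Γs ⊢* erases# us ∶ Bs') → SeqM Bs' →
             Δ 0 ≈M Bs' → Covers 0 us W
Covers-typed W d ds sq m =
  All.map (λ {C} a → Supplies⇒IsSome (typedArgs ds) C (Supplies-∈ ds sq C a)) (≈M⇒AllAny (≈M-trans _ (occ-≈M W 0 d) m))

Covers-dev#-redex : ∀ {Δb B₀ Γs Bs ℓ} (z : MTm) zs → Δb ⊢ erase# z ∶ B₀ → Γs ⊢* erases# zs ∶ Bs → SeqTy (arr (Δb 0) ℓ B₀) → Δb 0 ≈M Bs →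
  valid# z ≡ true → valids# zs ≡ true → Covers 0 (ress# zs zs) (res# z z)
Covers-dev#-redex {Δb} z zs dz dzs sa mm vz vzs =
  let _ , _ , dW = dev#-typed z vz dz
      Bs' , pw , ds' = devs#-typed zs vzs dzs
      mB = ≈M-trans-≈PW mm pw
  in Covers-typed (res# z z) dW ds' (SeqM-≈M {Δb 0} mB (SeqTy-dom sa)) mB

All-erases# : ∀ {P : Tm → Set} (us : List MTm) → All P (erases# us) → All (λ u → P (erase# u)) us
All-erases# [] [] = []
All-erases# (u ∷ us) (p ∷ ps) = p ∷ All-erases# us ps

⊢-tr : ∀ {Γ T} c t → Γ ⊢ t ∶ T → Γ ⊢ erase# (tr c t) ∶ T
⊢-tr {Γ} {T} c t d = subst (λ x → Γ ⊢ x ∶ T) (sym (erase#-tr c t)) d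

⊢*-trs : ∀ {Γs Ts} c ts → Γs ⊢* ts ∶ Ts → Γs ⊢* erases# (trs c ts) ∶ Ts
⊢*-trs {Γs} {Ts} c ts d = subst (λ x → Γs ⊢* x ∶ Ts) (sym (erases#-trs c ts)) d

mutual
  ⋉-res : ∀ {Γ T} a b t → Γ ⊢ t ∶ T → t ⋉ erase a → t ⋉ erase b → valid b ≡ true →
         erase# (res# (tr b t) (tr b t)) ⋉ erase (res a b)
  ⋉-res (mvar _) (mvar _) (var n A) d var var v = var
  ⋉-res (mlam a) (mlam b) (lam ℓ t) (tlam d _ _ _) (lam ra) (lam r) v = lam (⋉-res a b t d ra r v)
  ⋉-res (mapp m a₁ a₂) (mapp false b₁ b₂) (app t ts) (tapp d ds _ _ _ _) (app ra ras) (app r rs) v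
    rewrite res#-app-false false (tr b₁ t) (trs b₂ ts) (tr b₁ t) (trs b₂ ts) | res-app-false m a₁ a₂ b₁ b₂ =
    app (⋉-res a₁ b₁ t d ra r (∧-trueˡ v)) (⋉-ress a₂ b₂ ts ds ras rs (∧-trueʳ v))
  ⋉-res (mapp m (mlam a₁) a₂) (mapp true (mlam c₁) b₂) (app (lam ℓ u₁) ss) (tapp (tlam d₁ _ _ sa₁) ds mm _ _ _)
      (app (lam ra₁) ras) (app (lam r₁) rs) v =
    ⋉-sub 0 (res a₂ b₂) (res a₁ c₁) _ _ (⋉-res a₁ c₁ u₁ d₁ ra₁ r₁ (∧-trueˡ v)) (All-erases# _ (⋉-ress a₂ b₂ ss ds ras rs (∧-trueʳ v)))
      (Covers-dev#-redex (tr c₁ u₁) (trs b₂ ss) (⊢-tr c₁ u₁ d₁) (⊢*-trs b₂ ss ds) sa₁ mm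
        (valid#-tr c₁ u₁ (∧-trueˡ v) r₁) (valids#-trs b₂ ss (∧-trueʳ v) rs))
  ⋉-res (mapp m (mvar _) a₂) (mapp true (mlam c₁) b₂) (app (lam ℓ u₁) ss) d (app () ras) (app (lam r₁) rs) v
  ⋉-res (mapp m (mapp _ _ _) a₂) (mapp true (mlam c₁) b₂) (app (lam ℓ u₁) ss) d (app () ras) (app (lam r₁) rs) v
  ⋉-res a (mapp true (mvar _) b₂) (app t ts) d ra r ()
  ⋉-res a (mapp true (mapp _ _ _) b₂) (app t ts) d ra r ()

  ⋉-ress : ∀ {Γs Ts} a b ts → Γs ⊢* ts ∶ Ts → All (_⋉ erase a) ts → All (_⋉ erase b) ts → valid b ≡ true →
          All (_⋉ erase (res a b)) (erases# (ress# (trs b ts) (trs b ts)))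
  ⋉-ress a b [] [] [] [] v = []
  ⋉-ress a b (t ∷ ts) (d ∷ ds) (ra ∷ ras) (r ∷ rs) v = ⋉-res a b t d ra r v ∷ ⋉-ress a b ts ds ras rs v

mutual
  tr-res : ∀ {Γ T} a b t → Γ ⊢ t ∶ T → t ⋉ erase a → t ⋉ erase b → valid b ≡ true →
        tr (res a b) (dev# (tr b t)) ≡ res# (tr a t) (tr b t)
  tr-res (mvar _) (mvar _) (var n A) d var var v = refl
  tr-res (mlam a) (mlam b) (lam ℓ t) (tlam d _ _ _) (lam ra) (lam r) v = cong (lam ℓ) (tr-res a b t d ra r v)
  tr-res (mapp m a₁ a₂) (mapp false b₁ b₂) (app t ts) (tapp d ds _ _ _ _) (app ra ras) (app r rs) v
    rewrite res#-app-false false (tr b₁ t) (trs b₂ ts) (tr b₁ t) (trs b₂ ts) | res-app-false m a₁ a₂ b₁ b₂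
          | res#-app-false m (tr a₁ t) (trs a₂ ts) (tr b₁ t) (trs b₂ ts) =
    cong₂ (app m) (tr-res a₁ b₁ t d ra r (∧-trueˡ v)) (trs-ress a₂ b₂ ts ds ras rs (∧-trueʳ v))
  tr-res (mapp m (mlam a₁) a₂) (mapp true (mlam c₁) b₂) (app (lam ℓ u₁) ss) (tapp (tlam d₁ _ _ _) ds _ _ _ _) (app (lam ra₁) ras)
      (app (lam r₁) rs) v =
    Eq.trans (tr-sub 0 (res a₂ b₂) (res a₁ c₁) (res# (tr c₁ u₁) (tr c₁ u₁)) (ress# (trs b₂ ss) (trs b₂ ss))
               (⋉-res a₁ c₁ u₁ d₁ ra₁ r₁ (∧-trueˡ v)))
             (cong₂ (sub# 0) (trs-ress a₂ b₂ ss ds ras rs (∧-trueʳ v)) (tr-res a₁ c₁ u₁ d₁ ra₁ r₁ (∧-trueˡ v)))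
  tr-res (mapp m (mvar _) a₂) (mapp true (mlam c₁) b₂) (app (lam ℓ u₁) ss) d (app () ras) (app (lam r₁) rs) v
  tr-res (mapp m (mapp _ _ _) a₂) (mapp true (mlam c₁) b₂) (app (lam ℓ u₁) ss) d (app () ras) (app (lam r₁) rs) v
  tr-res a (mapp true (mvar _) b₂) (app t ts) d ra r ()
  tr-res a (mapp true (mapp _ _ _) b₂) (app t ts) d ra r ()

  trs-ress : ∀ {Γs Ts} a b ts → Γs ⊢* ts ∶ Ts → All (_⋉ erase a) ts → All (_⋉ erase b) ts → valid b ≡ true →
         trs (res a b) (erases# (ress# (trs b ts) (trs b ts))) ≡ ress# (trs a ts) (trs b ts)
  trs-ress a b [] [] [] [] v = refl
  trs-ress a b (t ∷ ts) (d ∷ ds) (ra ∷ ras) (r ∷ rs) v = cong₂ _∷_ (tr-res a b t d ra r v) (trs-ress a b ts ds ras rs v)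

-- Structural forms of the index arithmetic of lift# and sub#, so that the commutation
-- lemmas below go by induction on the indices.
liftIdx′ : ℕ → ℕ → ℕ
liftIdx′ zero n = suc n
liftIdx′ (suc c) zero = zero
liftIdx′ (suc c) (suc n) = suc (liftIdx′ c n)

if-suc : ∀ (b : Bool) x y → (if b then suc x else suc y) ≡ suc (if b then x else y)
if-suc true x y = refl
if-suc false x y = refl

liftIdx≡liftIdx′ : ∀ c n → (if n <ᵇ c then n else suc n) ≡ liftIdx′ c n
liftIdx≡liftIdx′ zero n = refl
liftIdx≡liftIdx′ (suc c) zero = refl
liftIdx≡liftIdx′ (suc c) (suc n) = Eq.trans (if-suc (n <ᵇ c) n (suc n)) (cong suc (liftIdx≡liftIdx′ c n))

lift#-var : ∀ c n A → lift# c (var n A) ≡ var (liftIdx′ c n) A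
lift#-var c n A = cong (λ m → var m A) (liftIdx≡liftIdx′ c n)

data VarCase : Set where
  hit  : VarCase
  miss : ℕ → VarCase

sucVarCase : VarCase → VarCase
sucVarCase hit = hit
sucVarCase (miss m) = miss (suc m)

varCase : ℕ → ℕ → VarCase
varCase zero zero = hit
varCase zero (suc n) = miss n
varCase (suc k) zero = miss zero
varCase (suc k) (suc n) = sucVarCase (varCase k n)

applyVarCase : VarCase → MTm → Ty → MTm
applyVarCase hit x A = x
applyVarCase (miss m) x A = var m A

varCase-hit : ∀ k n → (n ≡ᵇ k) ≡ true → varCase k n ≡ hit
varCase-hit zero zero e = refl
varCase-hit (suc k) (suc n) e rewrite varCase-hit k n e = refl

sucVarCase-hit : ∀ x → sucVarCase x ≡ hit → x ≡ hit
sucVarCase-hit hit e = refl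
sucVarCase-hit (miss m) ()

varCase-hit⇒ : ∀ k n → varCase k n ≡ hit → (n ≡ᵇ k) ≡ true
varCase-hit⇒ zero zero e = refl
varCase-hit⇒ zero (suc n) ()
varCase-hit⇒ (suc k) zero ()
varCase-hit⇒ (suc k) (suc n) e = varCase-hit⇒ k n (sucVarCase-hit (varCase k n) e)

varCase-miss : ∀ k n → (n ≡ᵇ k) ≡ false → varCase k n ≡ miss (if k <ᵇ n then pred n else n)
varCase-miss zero zero ()
varCase-miss zero (suc n) e = refl
varCase-miss (suc k) zero e = refl
varCase-miss (suc k) (suc zero) e rewrite varCase-miss k zero e = refl
varCase-miss (suc k) (suc (suc n)) e rewrite varCase-miss k (suc n) e with k <ᵇ suc n
... | true = refl
... | false = refl

sub#-var : ∀ k us n A → sub# k us (var n A) ≡ applyVarCase (varCase k n) (fromPick (pick A us) (var n A)) A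
sub#-var k us n A with n ≡ᵇ k in e
... | true rewrite varCase-hit k n e = refl
... | false rewrite varCase-miss k n e = if-var (k <ᵇ n) (pred n) n A

liftIdx′-liftIdx′ : ∀ d c n → d ≤ c → liftIdx′ (suc c) (liftIdx′ d n) ≡ liftIdx′ d (liftIdx′ c n)
liftIdx′-liftIdx′ zero c n h = refl
liftIdx′-liftIdx′ (suc d) (suc c) zero (s≤s h) = refl
liftIdx′-liftIdx′ (suc d) (suc c) (suc n) (s≤s h) = cong suc (liftIdx′-liftIdx′ d c n h)

mutual
  lift#-lift# : ∀ d c x → d ≤ c → lift# (suc c) (lift# d x) ≡ lift# d (lift# c x)
  lift#-lift# d c (var n A) h =
    Eq.trans (cong (lift# (suc c)) (lift#-var d n A)) (Eq.trans (lift#-var (suc c) (liftIdx′ d n) A)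
      (Eq.trans (cong (λ m → var m A) (liftIdx′-liftIdx′ d c n h))
        (Eq.trans (sym (lift#-var d (liftIdx′ c n) A)) (cong (lift# d) (sym (lift#-var c n A))))))
  lift#-lift# d c (lam ℓ x) h = cong (lam ℓ) (lift#-lift# (suc d) (suc c) x (s≤s h))
  lift#-lift# d c (app m x xs) h = cong₂ (app m) (lift#-lift# d c x h) (lifts#-lifts# d c xs h)

  lifts#-lifts# : ∀ d c xs → d ≤ c → lifts# (suc c) (lifts# d xs) ≡ lifts# d (lifts# c xs)
  lifts#-lifts# d c [] h = refl
  lifts#-lifts# d c (x ∷ xs) h = cong₂ _∷_ (lift#-lift# d c x h) (lifts#-lifts# d c xs h)

varCase-liftIdx′ : ∀ j n → varCase j (liftIdx′ j n) ≡ miss n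
varCase-liftIdx′ zero n = refl
varCase-liftIdx′ (suc j) zero = refl
varCase-liftIdx′ (suc j) (suc n) rewrite varCase-liftIdx′ j n = refl

mutual
  sub#-lift# : ∀ j W x → sub# j W (lift# j x) ≡ x
  sub#-lift# j W (var n A) = Eq.trans (cong (sub# j W) (lift#-var j n A))
    (Eq.trans (sub#-var j W (liftIdx′ j n) A) (cong (λ X → applyVarCase X (fromPick (pick A W) (var (liftIdx′ j n) A)) A) (varCase-liftIdx′ j n)))
  sub#-lift# j W (lam ℓ x) = cong (lam ℓ) (sub#-lift# (suc j) (lifts# 0 W) x)
  sub#-lift# j W (app m x xs) = cong₂ (app m) (sub#-lift# j W x) (subs#-lifts# j W xs)

  subs#-lifts# : ∀ j W xs → subs# j W (lifts# j xs) ≡ xs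
  subs#-lifts# j W [] = refl
  subs#-lifts# j W (x ∷ xs) = cong₂ _∷_ (sub#-lift# j W x) (subs#-lifts# j W xs)

liftVarCase : ℕ → VarCase → VarCase
liftVarCase c hit = hit
liftVarCase c (miss m) = miss (liftIdx′ c m)

sucVarCase-liftVarCase : ∀ c x → sucVarCase (liftVarCase c x) ≡ liftVarCase (suc c) (sucVarCase x)
sucVarCase-liftVarCase c hit = refl
sucVarCase-liftVarCase c (miss m) = refl

sucVarCase≡liftVarCase : ∀ x → sucVarCase x ≡ liftVarCase 0 x
sucVarCase≡liftVarCase hit = refl
sucVarCase≡liftVarCase (miss m) = refl

varCase-liftIdx′-≤ : ∀ c k n → c ≤ k → varCase (suc k) (liftIdx′ c n) ≡ liftVarCase c (varCase k n)
varCase-liftIdx′-≤ zero k n h = sucVarCase≡liftVarCase (varCase k n)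
varCase-liftIdx′-≤ (suc c) (suc k) zero (s≤s h) = refl
varCase-liftIdx′-≤ (suc c) (suc k) (suc n) (s≤s h) rewrite varCase-liftIdx′-≤ c k n h = sucVarCase-liftVarCase c (varCase k n)

varCase-liftIdx′-≥ : ∀ k c n → k ≤ c → varCase k (liftIdx′ (suc c) n) ≡ liftVarCase c (varCase k n)
varCase-liftIdx′-≥ zero c zero h = refl
varCase-liftIdx′-≥ zero c (suc n) h = refl
varCase-liftIdx′-≥ (suc k) (suc c) zero (s≤s h) = refl
varCase-liftIdx′-≥ (suc k) (suc c) (suc n) (s≤s h) rewrite varCase-liftIdx′-≥ k c n h = sucVarCase-liftVarCase c (varCase k n)

lift#-fromPick : ∀ c p n A → lift# c (fromPick p (var n A)) ≡ fromPick (mapPick (lift# c) p) (var (liftIdx′ c n) A)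
lift#-fromPick c none n A = lift#-var c n A
lift#-fromPick c (some u) n A = refl

lift#-applyVarCase : ∀ c X F A → lift# c (applyVarCase X F A) ≡ applyVarCase (liftVarCase c X) (lift# c F) A
lift#-applyVarCase c hit F A = refl
lift#-applyVarCase c (miss m) F A = lift#-var c m A

mutual
  lift#-sub#-≤ : ∀ c k us w → c ≤ k → lift# c (sub# k us w) ≡ sub# (suc k) (lifts# c us) (lift# c w)
  lift#-sub#-≤ c k us (var n A) h =
    Eq.trans (cong (lift# c) (sub#-var k us n A))
    (Eq.trans (lift#-applyVarCase c (varCase k n) (fromPick (pick A us) (var n A)) A)
    (Eq.trans (cong (λ F → applyVarCase (liftVarCase c (varCase k n)) F A) (lift#-fromPick c (pick A us) n A))
    (sym (Eq.trans (cong (sub# (suc k) (lifts# c us)) (lift#-var c n A))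
         (Eq.trans (sub#-var (suc k) (lifts# c us) (liftIdx′ c n) A)
           (cong₂ (λ X p → applyVarCase X (fromPick p (var (liftIdx′ c n) A)) A) (varCase-liftIdx′-≤ c k n h) (pick-lifts# c A us)))))))
  lift#-sub#-≤ c k us (lam ℓ w) h =
    cong (lam ℓ) (Eq.trans (lift#-sub#-≤ (suc c) (suc k) (lifts# 0 us) w (s≤s h))
      (cong (λ z → sub# (suc (suc k)) z (lift# (suc c) w)) (lifts#-lifts# 0 c us z≤n)))
  lift#-sub#-≤ c k us (app m w ws) h = cong₂ (app m) (lift#-sub#-≤ c k us w h) (lifts#-subs#-≤ c k us ws h)

  lifts#-subs#-≤ : ∀ c k us ws → c ≤ k → lifts# c (subs# k us ws) ≡ subs# (suc k) (lifts# c us) (lifts# c ws)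
  lifts#-subs#-≤ c k us [] h = refl
  lifts#-subs#-≤ c k us (w ∷ ws) h = cong₂ _∷_ (lift#-sub#-≤ c k us w h) (lifts#-subs#-≤ c k us ws h)

mutual
  lift#-sub#-≥ : ∀ c k us w → k ≤ c → Covers k us w → lift# c (sub# k us w) ≡ sub# k (lifts# c us) (lift# (suc c) w)
  lift#-sub#-≥ c k us (var n A) h ps =
    Eq.trans (cong (lift# c) (sub#-var k us n A))
    (Eq.trans (lift#-applyVarCase c (varCase k n) (fromPick (pick A us) (var n A)) A)
    (Eq.trans (lift#-hit (varCase k n) (varCase-hit⇒ k n) (pick A us) (covered ps))
    (sym (Eq.trans (cong (sub# k (lifts# c us)) (lift#-var (suc c) n A))
         (Eq.trans (sub#-var k (lifts# c us) (liftIdx′ (suc c) n) A)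
           (cong₂ (λ X p → applyVarCase X (fromPick p (var (liftIdx′ (suc c) n) A)) A) (varCase-liftIdx′-≥ k c n h) (pick-lifts# c A us)))))))
    where
    covered : Covers k us (var n A) → (n ≡ᵇ k) ≡ true → IsSome (pick A us)
    covered ps e with n ≡ᵇ k
    covered (o ∷ []) refl | true = o
    lift#-hit : ∀ X → (X ≡ hit → (n ≡ᵇ k) ≡ true) → ∀ p → ((n ≡ᵇ k) ≡ true → IsSome p) →
          applyVarCase (liftVarCase c X) (lift# c (fromPick p (var n A))) A
            ≡ applyVarCase (liftVarCase c X) (fromPick (mapPick (lift# c) p) (var (liftIdx′ (suc c) n) A)) A
    lift#-hit (miss m) hx p op = refl
    lift#-hit hit hx (some u) op = refl
    lift#-hit hit hx none op = ⊥-elim (op (hx refl))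
  lift#-sub#-≥ c k us (lam ℓ w) h ps =
    cong (lam ℓ) (Eq.trans (lift#-sub#-≥ (suc c) (suc k) (lifts# 0 us) w (s≤s h) (Covers-lam k us w ps))
      (cong (λ z → sub# (suc k) z (lift# (suc (suc c)) w)) (lifts#-lifts# 0 c us z≤n)))
  lift#-sub#-≥ c k us (app m w ws) h ps =
    cong₂ (app m) (lift#-sub#-≥ c k us w h (++⁻ˡ (occ k w) ps)) (lifts#-subs#-≥ c k us ws h (++⁻ʳ (occ k w) ps))

  lifts#-subs#-≥ : ∀ c k us ws → k ≤ c → All (λ A → IsSome (pick A us)) (occs k ws) →
    lifts# c (subs# k us ws) ≡ subs# k (lifts# c us) (lifts# (suc c) ws)
  lifts#-subs#-≥ c k us [] h ps = refl
  lifts#-subs#-≥ c k us (w ∷ ws) h ps = cong₂ _∷_ (lift#-sub#-≥ c k us w h (++⁻ˡ (occ k w) ps)) (lifts#-subs#-≥ c k us ws h (++⁻ʳ (occ k w) ps))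

liftsⁿ : ℕ → List MTm → List MTm
liftsⁿ zero us = us
liftsⁿ (suc j) us = lifts# 0 (liftsⁿ j us)

SubKeepsExt : ℕ → List MTm → List MTm → Set
SubKeepsExt k U V = All (λ v → ext (typeOf (sub# k U v)) ≡ ext (typeOf v)) V

pick-subs : ∀ k U A V → SubKeepsExt k U V → pick A (subs# k U V) ≡ mapPick (sub# k U) (pick A V)
pick-subs k U A [] [] = refl
pick-subs k U A (v ∷ V) (e ∷ es) rewrite e with ext (typeOf v) ≡ᵇ ext A
... | true = refl
... | false = pick-subs k U A V es

sub#-sub#-var : ∀ k U V n A → Covers 0 V (var n A) → SubKeepsExt k U V →
  sub# k U (sub# 0 V (var n A)) ≡ sub# 0 (subs# k U V) (sub# (suc k) (lifts# 0 U) (var n A))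
sub#-sub#-var k U V zero A (o ∷ []) es rewrite pick-subs k U A V es with pick A V
... | some v = refl
sub#-sub#-var k U V (suc n) A ps es
  rewrite sub#-var k U n A | sub#-var (suc k) (lifts# 0 U) (suc n) A | pick-lifts# 0 A U with varCase k n
... | miss m = refl
... | hit with pick A U
...   | none = refl
...   | some u = sym (sub#-lift# 0 (subs# k U V) u)

-- The substitution lemma sub#-sub# is proved under j binders, where both substitutions
-- are shifted j times.
module SubstitutionLemma (k : ℕ) (U V : List MTm) where
  W = subs# k U V

  lhs : ℕ → MTm → MTm
  lhs j z = sub# (j + k) (liftsⁿ j U) (sub# j (liftsⁿ j V) z)

  rhs : ℕ → MTm → MTm
  rhs j z = sub# j (liftsⁿ j W) (sub# (suc (j + k)) (liftsⁿ j (lifts# 0 U)) z)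

  lhs-suc : ∀ j n A → lhs (suc j) (var (suc n) A) ≡ lift# 0 (lhs j (var n A))
  lhs-suc j n A = sym (Eq.trans (lift#-sub#-≤ 0 (j + k) (liftsⁿ j U) (sub# j (liftsⁿ j V) (var n A)) z≤n)
                  (cong (sub# (suc (j + k)) (lifts# 0 (liftsⁿ j U))) (lift#-sub#-≤ 0 j (liftsⁿ j V) (var n A) z≤n)))

  rhs-suc : ∀ j n A → rhs (suc j) (var (suc n) A) ≡ lift# 0 (rhs j (var n A))
  rhs-suc j n A = sym (Eq.trans (lift#-sub#-≤ 0 j (liftsⁿ j W) (sub# (suc (j + k)) (liftsⁿ j (lifts# 0 U)) (var n A)) z≤n)
                  (cong (sub# (suc j) (lifts# 0 (liftsⁿ j W))) (lift#-sub#-≤ 0 (suc (j + k)) (liftsⁿ j (lifts# 0 U)) (var n A) z≤n)))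

  comp-var : ∀ j n A → Covers j (liftsⁿ j V) (var n A) → SubKeepsExt k U V → lhs j (var n A) ≡ rhs j (var n A)
  comp-var zero n A ps es = sub#-sub#-var k U V n A ps es
  comp-var (suc j) zero A ps es = refl
  comp-var (suc j) (suc n) A ps es =
    Eq.trans (lhs-suc j n A) (Eq.trans (cong (lift# 0) (comp-var j n A (Covers-unlift ps) es)) (sym (rhs-suc j n A)))
    where
    Covers-unlift : Covers (suc j) (liftsⁿ (suc j) V) (var (suc n) A) → Covers j (liftsⁿ j V) (var n A)
    Covers-unlift p with n ≡ᵇ j
    Covers-unlift (o ∷ []) | true = IsSome-unlifts# 0 A (liftsⁿ j V) o ∷ []
    Covers-unlift [] | false = []

  mutual
    comp : ∀ j z → Covers j (liftsⁿ j V) z → SubKeepsExt k U V → lhs j z ≡ rhs j z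
    comp j (var n A) ps es = comp-var j n A ps es
    comp j (lam ℓ z) ps es = cong (lam ℓ) (comp (suc j) z (Covers-lam j (liftsⁿ j V) z ps) es)
    comp j (app m z zs) ps es = cong₂ (app m) (comp j z (++⁻ˡ (occ j z) ps) es) (comps j zs (++⁻ʳ (occ j z) ps) es)

    comps : ∀ j zs → All (λ A → IsSome (pick A (liftsⁿ j V))) (occs j zs) → SubKeepsExt k U V →
            subs# (j + k) (liftsⁿ j U) (subs# j (liftsⁿ j V) zs) ≡ subs# j (liftsⁿ j W) (subs# (suc (j + k)) (liftsⁿ j (lifts# 0 U)) zs)
    comps j [] ps es = refl
    comps j (z ∷ zs) ps es = cong₂ _∷_ (comp j z (++⁻ˡ (occ j z) ps) es) (comps j zs (++⁻ʳ (occ j z) ps) es)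

sub#-sub# : ∀ k U V z → Covers 0 V z → SubKeepsExt k U V →
  sub# k U (sub# 0 V z) ≡ sub# 0 (subs# k U V) (sub# (suc k) (lifts# 0 U) z)
sub#-sub# k U V z ps es = SubstitutionLemma.comp k U V 0 z ps es

mutual
  data SameShape : MTm → MTm → Set where
    var : ∀ {n A} → SameShape (var n A) (var n A)
    lam : ∀ {ℓ a b} → SameShape a b → SameShape (lam ℓ a) (lam ℓ b)
    app : ∀ {m m' a b as bs} → SameShape a b → SameShapes as bs → SameShape (app m a as) (app m' b bs)

  data SameShapes : List MTm → List MTm → Set where
    []  : SameShapes [] []
    _∷_ : ∀ {a b as bs} → SameShape a b → SameShapes as bs → SameShapes (a ∷ as) (b ∷ bs)

mutual
  SameShape⇒erase#≡ : ∀ {a b} → SameShape a b → erase# a ≡ erase# b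
  SameShape⇒erase#≡ var = refl
  SameShape⇒erase#≡ (lam s) = cong (lam _) (SameShape⇒erase#≡ s)
  SameShape⇒erase#≡ (app s ss) = cong₂ app (SameShape⇒erase#≡ s) (SameShapes⇒erases#≡ ss)

  SameShapes⇒erases#≡ : ∀ {as bs} → SameShapes as bs → erases# as ≡ erases# bs
  SameShapes⇒erases#≡ [] = refl
  SameShapes⇒erases#≡ (s ∷ ss) = cong₂ _∷_ (SameShape⇒erase#≡ s) (SameShapes⇒erases#≡ ss)

mutual
  SameShape-sym : ∀ {a b} → SameShape a b → SameShape b a
  SameShape-sym var = var
  SameShape-sym (lam s) = lam (SameShape-sym s)
  SameShape-sym (app s ss) = app (SameShape-sym s) (SameShapes-sym ss)

  SameShapes-sym : ∀ {as bs} → SameShapes as bs → SameShapes bs as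
  SameShapes-sym [] = []
  SameShapes-sym (s ∷ ss) = SameShape-sym s ∷ SameShapes-sym ss

lam-label-injective : ∀ {s t : Tm} {ℓ ℓ'} → lam ℓ s ≡ lam ℓ' t → ℓ ≡ ℓ'
lam-label-injective refl = refl

mutual
  SameShape-tr : ∀ a b t → SameShape (tr a t) (tr b t)
  SameShape-tr a b t = erase#≡⇒SameShape (tr a t) (tr b t) (Eq.trans (erase#-tr a t) (sym (erase#-tr b t)))

  erase#≡⇒SameShape : ∀ x y → erase# x ≡ erase# y → SameShape x y
  erase#≡⇒SameShape (var n A) (var .n .A) refl = var
  erase#≡⇒SameShape (var n A) (lam _ _) ()
  erase#≡⇒SameShape (var n A) (app _ _ _) ()
  erase#≡⇒SameShape (lam ℓ x) (var _ _) ()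
  erase#≡⇒SameShape (lam ℓ x) (lam ℓ' y) e with lam-label-injective e
  ... | refl = lam (erase#≡⇒SameShape x y (lamI e))
    where lamI : ∀ {s t : Tm} {ℓ} → lam ℓ s ≡ lam ℓ t → s ≡ t
          lamI refl = refl
  erase#≡⇒SameShape (lam ℓ x) (app _ _ _) ()
  erase#≡⇒SameShape (app m x xs) (var _ _) ()
  erase#≡⇒SameShape (app m x xs) (lam _ _) ()
  erase#≡⇒SameShape (app m x xs) (app m' y ys) e = app (erase#≡⇒SameShape x y (i1 e)) (erases#≡⇒SameShapes xs ys (i2 e))
    where i1 : ∀ {s t : Tm} {ss ts} → app s ss ≡ app t ts → s ≡ t
          i1 refl = refl
          i2 : ∀ {s t : Tm} {ss ts} → app s ss ≡ app t ts → ss ≡ ts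
          i2 refl = refl

  erases#≡⇒SameShapes : ∀ xs ys → erases# xs ≡ erases# ys → SameShapes xs ys
  erases#≡⇒SameShapes [] [] e = []
  erases#≡⇒SameShapes [] (y ∷ ys) ()
  erases#≡⇒SameShapes (x ∷ xs) [] ()
  erases#≡⇒SameShapes (x ∷ xs) (y ∷ ys) e = erase#≡⇒SameShape x y (h e) ∷ erases#≡⇒SameShapes xs ys (t e)
    where h : ∀ {s t : Tm} {ss ts} → _≡_ {A = List Tm} (s ∷ ss) (t ∷ ts) → s ≡ t
          h refl = refl
          t : ∀ {s t : Tm} {ss ts} → _≡_ {A = List Tm} (s ∷ ss) (t ∷ ts) → ss ≡ ts
          t refl = refl

typeOf-SameShape : ∀ {a b} → SameShape a b → typeOf a ≡ typeOf b
typeOf-SameShape {a} {b} s =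
  Eq.trans (typeOf-clearMarks a) (Eq.trans (cong (λ t → typeOf (unmark t)) (SameShape⇒erase#≡ s)) (sym (typeOf-clearMarks b)))

mutual
  SameShape-lift# : ∀ c {a b} → SameShape a b → SameShape (lift# c a) (lift# c b)
  SameShape-lift# c var = var
  SameShape-lift# c (lam s) = lam (SameShape-lift# (suc c) s)
  SameShape-lift# c (app s ss) = app (SameShape-lift# c s) (SameShapes-lifts# c ss)

  SameShapes-lifts# : ∀ c {as bs} → SameShapes as bs → SameShapes (lifts# c as) (lifts# c bs)
  SameShapes-lifts# c [] = []
  SameShapes-lifts# c (s ∷ ss) = SameShape-lift# c s ∷ SameShapes-lifts# c ss

data SameShapePick : Pick → Pick → Set where
  none : SameShapePick none none
  some : ∀ {u v} → SameShape u v → SameShapePick (some u) (some v)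

pick-SameShape : ∀ A {us vs} → SameShapes us vs → SameShapePick (pick A us) (pick A vs)
pick-SameShape A [] = none
pick-SameShape A (_∷_ {a = u} {b = v} s ss) rewrite typeOf-SameShape s with ext (typeOf v) ≡ᵇ ext A
... | true = some s
... | false = pick-SameShape A ss

SameShape-applyVarCase : ∀ X {F G} A → SameShape F G → SameShape (applyVarCase X F A) (applyVarCase X G A)
SameShape-applyVarCase hit A s = s
SameShape-applyVarCase (miss m) A s = var

SameShape-fromPick : ∀ {p q} n A → SameShapePick p q → SameShape (fromPick p (var n A)) (fromPick q (var n A))
SameShape-fromPick n A none = var
SameShape-fromPick n A (some s) = s

mutual
  SameShape-sub# : ∀ k {us vs a b} → SameShapes us vs → SameShape a b → SameShape (sub# k us a) (sub# k vs b)
  SameShape-sub# k {us} {vs} ss (var {n} {A}) rewrite sub#-var k us n A | sub#-var k vs n A =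
    SameShape-applyVarCase (varCase k n) A (SameShape-fromPick n A (pick-SameShape A ss))
  SameShape-sub# k ss (lam s) = lam (SameShape-sub# (suc k) (SameShapes-lifts# 0 ss) s)
  SameShape-sub# k ss (app s s') = app (SameShape-sub# k ss s) (SameShapes-subs# k ss s')

  SameShapes-subs# : ∀ k {us vs as bs} → SameShapes us vs → SameShapes as bs → SameShapes (subs# k us as) (subs# k vs bs)
  SameShapes-subs# k ss [] = []
  SameShapes-subs# k ss (s ∷ s') = SameShape-sub# k ss s ∷ SameShapes-subs# k ss s'

mutual
  SameShape-res# : ∀ {x y} → SameShape x y → valid# y ≡ true → SameShape (res# x y) (res# y y)
  SameShape-res# var v = var
  SameShape-res# (lam s) v = lam (SameShape-res# s v)
  SameShape-res# {app m a as} {app false b bs} (app s ss) v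
    rewrite res#-app-false m a as b bs | res#-app-false false b bs b bs = app (SameShape-res# s (∧-trueˡ v)) (SameShapes-ress# ss (∧-trueʳ v))
  SameShape-res# {app m (lam _ a) as} {app true (lam _ b) bs} (app (lam s) ss) v =
    SameShape-sub# 0 (SameShapes-ress# ss (∧-trueʳ v)) (SameShape-res# s (∧-trueˡ v))
  SameShape-res# {app m (var _ _) as} {app true (var _ _) bs} (app var ss) ()
  SameShape-res# {app m (app _ _ _) as} {app true (app _ _ _) bs} (app (app _ _) ss) ()

  SameShapes-ress# : ∀ {xs ys} → SameShapes xs ys → valids# ys ≡ true → SameShapes (ress# xs ys) (ress# ys ys)
  SameShapes-ress# [] v = []
  SameShapes-ress# (s ∷ ss) v = SameShape-res# s (∧-trueˡ v) ∷ SameShapes-ress# ss (∧-trueʳ v)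

mutual
  valid#-lift : ∀ c a → valid# a ≡ true → valid# (lift# c a) ≡ true
  valid#-lift c (var n A) v = refl
  valid#-lift c (lam ℓ a) v = valid#-lift (suc c) a v
  valid#-lift c (app false a as) v = ∧-true⁺ (valid#-lift c a (∧-trueˡ v)) (valids#-lift c as (∧-trueʳ v))
  valid#-lift c (app true (lam ℓ a) as) v = ∧-true⁺ (valid#-lift (suc c) a (∧-trueˡ v)) (valids#-lift c as (∧-trueʳ v))
  valid#-lift c (app true (var _ _) as) ()
  valid#-lift c (app true (app _ _ _) as) ()

  valids#-lift : ∀ c as → valids# as ≡ true → valids# (lifts# c as) ≡ true
  valids#-lift c [] v = refl
  valids#-lift c (a ∷ as) v = ∧-true⁺ (valid#-lift c a (∧-trueˡ v)) (valids#-lift c as (∧-trueʳ v))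

AllValid# : List MTm → Set
AllValid# = All (λ u → valid# u ≡ true)

AllValid#-lifts# : ∀ c us → AllValid# us → AllValid# (lifts# c us)
AllValid#-lifts# c [] [] = []
AllValid#-lifts# c (u ∷ us) (v ∷ vs) = valid#-lift c u v ∷ AllValid#-lifts# c us vs

valid-fromPick : ∀ A us n → AllValid# us → valid# (fromPick (pick A us) (var n A)) ≡ true
valid-fromPick A [] n [] = refl
valid-fromPick A (u ∷ us) n (v ∷ vs) with ext (typeOf u) ≡ᵇ ext A
... | true = v
... | false = valid-fromPick A us n vs

valid-vsApp : ∀ X F A → valid# F ≡ true → valid# (applyVarCase X F A) ≡ true
valid-vsApp hit F A v = v
valid-vsApp (miss m) F A v = refl

mutual
  valid#-sub : ∀ k us w → AllValid# us → valid# w ≡ true → valid# (sub# k us w) ≡ true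
  valid#-sub k us (var n A) vus vw =
    subst (λ x → valid# x ≡ true) (sym (sub#-var k us n A)) (valid-vsApp (varCase k n) _ A (valid-fromPick A us n vus))
  valid#-sub k us (lam ℓ w) vus vw = valid#-sub (suc k) (lifts# 0 us) w (AllValid#-lifts# 0 us vus) vw
  valid#-sub k us (app false w ws) vus vw = ∧-true⁺ (valid#-sub k us w vus (∧-trueˡ vw)) (valids#-sub k us ws vus (∧-trueʳ vw))
  valid#-sub k us (app true (lam ℓ w) ws) vus vw =
    ∧-true⁺ (valid#-sub (suc k) (lifts# 0 us) w (AllValid#-lifts# 0 us vus) (∧-trueˡ vw)) (valids#-sub k us ws vus (∧-trueʳ vw))
  valid#-sub k us (app true (var _ _) ws) vus ()
  valid#-sub k us (app true (app _ _ _) ws) vus ()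

  valids#-sub : ∀ k us ws → AllValid# us → valids# ws ≡ true → valids# (subs# k us ws) ≡ true
  valids#-sub k us [] vus v = refl
  valids#-sub k us (w ∷ ws) vus v = ∧-true⁺ (valid#-sub k us w vus (∧-trueˡ v)) (valids#-sub k us ws vus (∧-trueʳ v))

valids#⇒AllValid# : ∀ as → valids# as ≡ true → AllValid# as
valids#⇒AllValid# [] v = []
valids#⇒AllValid# (a ∷ as) v = ∧-trueˡ v ∷ valids#⇒AllValid# as (∧-trueʳ v)

mutual
  valid#-res : ∀ {x y} → SameShape x y → valid# x ≡ true → valid# y ≡ true → valid# (res# x y) ≡ true
  valid#-res var vx vy = refl
  valid#-res (lam s) vx vy = valid#-res s vx vy
  valid#-res {app m a as} {app false b bs} (app s ss) vx vy rewrite res#-app-false m a as b bs = by-head m s vx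
    where
    by-head : ∀ m {a} → SameShape a b → valid# (app m a as) ≡ true → valid# (app m (res# a b) (ress# as bs)) ≡ true
    by-head false s vx = ∧-true⁺ (valid#-res s (∧-trueˡ vx) (∧-trueˡ vy)) (valids#-res ss (∧-trueʳ vx) (∧-trueʳ vy))
    by-head true (lam s) vx = ∧-true⁺ (valid#-res s (∧-trueˡ vx) (∧-trueˡ vy)) (valids#-res ss (∧-trueʳ vx) (∧-trueʳ vy))
    by-head true {var _ _} var ()
    by-head true {app _ _ _} (app _ _) ()
  valid#-res {app m (lam _ a) as} {app true (lam _ b) bs} (app (lam s) ss) vx vy =
    valid#-sub 0 (ress# as bs) (res# a b) (valids#⇒AllValid# (ress# as bs) (valids#-res ss (vr m vx) (∧-trueʳ vy)))
        (valid#-res s (vl m vx) (∧-trueˡ vy))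
    where
    vl : ∀ m → valid# (app m (lam _ a) as) ≡ true → valid# a ≡ true
    vl false v = ∧-trueˡ v
    vl true v = ∧-trueˡ v
    vr : ∀ m → valid# (app m (lam _ a) as) ≡ true → valids# as ≡ true
    vr false v = ∧-trueʳ v
    vr true v = ∧-trueʳ v
  valid#-res {app m (var _ _) as} {app true (var _ _) bs} (app var ss) vx ()
  valid#-res {app m (app _ _ _) as} {app true (app _ _ _) bs} (app (app _ _) ss) vx ()

  valids#-res : ∀ {xs ys} → SameShapes xs ys → valids# xs ≡ true → valids# ys ≡ true → valids# (ress# xs ys) ≡ true
  valids#-res [] vx vy = refl
  valids#-res (s ∷ ss) vx vy = ∧-true⁺ (valid#-res s (∧-trueˡ vx) (∧-trueˡ vy)) (valids#-res ss (∧-trueʳ vx) (∧-trueʳ vy))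

-- Developments commute with substitution; the cube lemma

DevKeepsExt : List MTm → Set
DevKeepsExt us = All (λ u → ext (typeOf (res# u u)) ≡ ext (typeOf u)) us

ext-dev# : ∀ {Γ B} u → Γ ⊢ erase# u ∶ B → valid# u ≡ true → ext (typeOf (res# u u)) ≡ ext (typeOf u)
ext-dev# u d v = let _ , eA , d' = dev#-typed u v d in ext-typeOf-≈T (res# u u) u d' d eA

devKeepsExt : ∀ {us} → TypedArgs us → AllValid# us → DevKeepsExt us
devKeepsExt [] [] = []
devKeepsExt (cons {u} Γ B d T) (v ∷ vs) = ext-dev# u d v ∷ devKeepsExt T vs

pick-devs# : ∀ A us → DevKeepsExt us → pick A (ress# us us) ≡ mapPick (λ u → res# u u) (pick A us)
pick-devs# A [] [] = refl
pick-devs# A (u ∷ us) (e ∷ es) rewrite e with ext (typeOf u) ≡ᵇ ext A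
... | true = refl
... | false = pick-devs# A us es

devArgs : ∀ {us} → TypedArgs us → AllValid# us → TypedArgs (ress# us us)
devArgs [] [] = []
devArgs (cons {u} Γ B d T) (v ∷ vs) = cons Γ (proj₁ (dev#-typed u v d)) (proj₂ (proj₂ (dev#-typed u v d))) (devArgs T vs)

data DevelopedPick : Picked → Picked → Set where
  none : DevelopedPick noneP noneP
  some : ∀ {u Γ B d u' B' d'} → B' ≈T B → DevelopedPick (someP u Γ B d) (someP u' Γ B' d')

pickTyped-devArgs : ∀ {us} C (T : TypedArgs us) (vs : AllValid# us) → DevelopedPick (pickTyped C T) (pickTyped C (devArgs T vs))
pickTyped-devArgs C [] [] = none
pickTyped-devArgs C (cons {u} Γ B d T) (v ∷ vs) rewrite ext-dev# u d v with ext (typeOf u) ≡ᵇ ext C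
... | true = some (proj₁ (proj₂ (dev#-typed u v d)))
... | false = pickTyped-devArgs C T vs

Supplies-devArgs : ∀ {us} (T : TypedArgs us) (vs : AllValid# us) C → Supplies T C → Supplies (devArgs T vs) C
Supplies-devArgs T vs C g with pickTyped C T | pickTyped C (devArgs T vs) | pickTyped-devArgs C T vs
... | someP _ _ B _ | someP _ _ B' _ | some e = ≈T-trans B' e g

pickΓ-devArgs : ∀ {us} (T : TypedArgs us) (vs : AllValid# us) C → pickΓ (devArgs T vs) C ≡ pickΓ T C
pickΓ-devArgs T vs C with pickTyped C T | pickTyped C (devArgs T vs) | pickTyped-devArgs C T vs
... | noneP | noneP | none = refl
... | someP _ _ _ _ | someP _ _ _ _ | some _ = refl

argsCtx-devArgs : ∀ {us} (T : TypedArgs us) (vs : AllValid# us) M → argsCtx (devArgs T vs) M ≡ argsCtx T M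
argsCtx-devArgs T vs [] = refl
argsCtx-devArgs T vs (C ∷ M) = cong₂ (λ Γ Δ → Γ +C Δ) (pickΓ-devArgs T vs C) (argsCtx-devArgs T vs M)

subCtx-devArgs : ∀ {us} k (T : TypedArgs us) (vs : AllValid# us) Γ → subCtx k (devArgs T vs) Γ ≡ subCtx k T Γ
subCtx-devArgs k T vs Γ = cong (λ S → dropC k Γ +C S) (argsCtx-devArgs T vs (Γ k))

mutual
  dev#-lift# : ∀ c {Γ A} v → Γ ⊢ erase# v ∶ A → valid# v ≡ true → res# (lift# c v) (lift# c v) ≡ lift# c (res# v v)
  dev#-lift# c (var n A) d vv = refl
  dev#-lift# c (lam ℓ v) (tlam d _ _ _) vv = cong (lam ℓ) (dev#-lift# (suc c) v d vv)
  dev#-lift# c (app false a as) (tapp d ds _ _ _ _) vv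
    rewrite res#-app-false false (lift# c a) (lifts# c as) (lift# c a) (lifts# c as) | res#-app-false false a as a as =
    cong₂ (app false) (dev#-lift# c a d (∧-trueˡ vv)) (devs#-lifts# c as ds (∧-trueʳ vv))
  dev#-lift# c (app true (lam ℓ z) zs) (tapp (tlam dz _ _ sa) dzs mm _ _ _) vv =
    Eq.trans (cong₂ (sub# 0) (devs#-lifts# c zs dzs (∧-trueʳ vv)) (dev#-lift# (suc c) z dz (∧-trueˡ vv)))
      (sym (lift#-sub#-≥ c 0 (ress# zs zs) (res# z z) z≤n (Covers-dev#-redex z zs dz dzs sa mm (∧-trueˡ vv) (∧-trueʳ vv))))
  dev#-lift# c (app true (var _ _) as) d ()
  dev#-lift# c (app true (app _ _ _) as) d ()

  devs#-lifts# : ∀ c {Γs Bs} vs → Γs ⊢* erases# vs ∶ Bs → valids# vs ≡ true → ress# (lifts# c vs) (lifts# c vs) ≡ lifts# c (ress# vs vs)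
  devs#-lifts# c [] [] v = refl
  devs#-lifts# c (u ∷ us) (d ∷ ds) v = cong₂ _∷_ (dev#-lift# c u d (∧-trueˡ v)) (devs#-lifts# c us ds (∧-trueʳ v))

devs#-lifts#-typed : ∀ c {us} → TypedArgs us → AllValid# us → ress# (lifts# c us) (lifts# c us) ≡ lifts# c (ress# us us)
devs#-lifts#-typed c [] [] = refl
devs#-lifts#-typed c (cons {u} Γ B d T) (v ∷ vs) = cong₂ _∷_ (dev#-lift# c u d v) (devs#-lifts#-typed c T vs)

dev#-applyVarCase : ∀ X F A → res# (applyVarCase X F A) (applyVarCase X F A) ≡ applyVarCase X (res# F F) A
dev#-applyVarCase hit F A = refl
dev#-applyVarCase (miss m) F A = refl

dev#-fromPick : ∀ p n A → res# (fromPick p (var n A)) (fromPick p (var n A)) ≡ fromPick (mapPick (λ u → res# u u) p) (var n A)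
dev#-fromPick none n A = refl
dev#-fromPick (some u) n A = refl

ext-sub#-dev# : ∀ k {us} (T : TypedArgs us) (vs : AllValid# us) {Γ B} z → Γ ⊢ erase# z ∶ B → valid# z ≡ true →
  All (Supplies T) (Γ k) → SeqCtx (subCtx k T Γ) →
          ext (typeOf (sub# k (ress# us us) (res# z z))) ≡ ext (typeOf (res# z z))
ext-sub#-dev# k {us} T vs {Γ} z d vz g sq =
  let _ , _ , d' = dev#-typed z vz d
      _ , e , d'' = sub#-typed k (res# z z) d' (devArgs T vs) (All.map (λ {C} → Supplies-devArgs T vs C) g)
                      (subst SeqCtx (sym (subCtx-devArgs k T vs Γ)) sq)
  in ext-typeOf-≈T (sub# k (ress# us us) (res# z z)) (res# z z) d'' d' e

subKeepsExt-devs# : ∀ k {us} (T : TypedArgs us) (vs : AllValid# us) {Γs Bs} zs → Γs ⊢* erases# zs ∶ Bs → valids# zs ≡ true →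
          All (λ Γ → All (Supplies T) (Γ k)) Γs → SeqCtx (ΣC (map (subCtx k T) Γs)) → SubKeepsExt k (ress# us us) (ress# zs zs)
subKeepsExt-devs# k T vs [] [] v [] sq = []
subKeepsExt-devs# k T vs {Γ ∷ Γs} (z ∷ zs) (d ∷ ds) v (g ∷ gs) sq =
  ext-sub#-dev# k T vs z d (∧-trueˡ v) g (SeqCtx-+ˡ {subCtx k T Γ} sq)
  ∷ subKeepsExt-devs# k T vs zs ds (∧-trueʳ v) gs (SeqCtx-+ʳ {subCtx k T Γ} sq)

mutual
  dev#-sub# : ∀ k {Δ B us} (w : MTm) → Δ ⊢ erase# w ∶ B → valid# w ≡ true → (T : TypedArgs us) → AllValid# us →
         All (Supplies T) (Δ k) → SeqCtx (subCtx k T Δ) → res# (sub# k us w) (sub# k us w) ≡ sub# k (ress# us us) (res# w w)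
  dev#-sub# k {us = us} (var n A) d vw T vs g sq = begin
      res# (sub# k us (var n A)) (sub# k us (var n A))
    ≡⟨ cong (λ x → res# x x) (sub#-var k us n A) ⟩
      res# (applyVarCase X (fromPick (pick A us) (var n A)) A) (applyVarCase X (fromPick (pick A us) (var n A)) A)
    ≡⟨ dev#-applyVarCase X (fromPick (pick A us) (var n A)) A ⟩
      applyVarCase X (res# (fromPick (pick A us) (var n A)) (fromPick (pick A us) (var n A))) A
    ≡⟨ cong (λ F → applyVarCase X F A) (dev#-fromPick (pick A us) n A) ⟩
      applyVarCase X (fromPick (mapPick (λ u → res# u u) (pick A us)) (var n A)) A
    ≡⟨ cong (λ p → applyVarCase X (fromPick p (var n A)) A) (pick-devs# A us (devKeepsExt T vs)) ⟨
      applyVarCase X (fromPick (pick A (ress# us us)) (var n A)) A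
    ≡⟨ sub#-var k (ress# us us) n A ⟨
      sub# k (ress# us us) (var n A)
    ∎
    where X = varCase k n
  dev#-sub# k {us = us} (lam ℓ w) (tlam d e s sa) vw T vs g sq =
    cong (lam ℓ) (Eq.trans (dev#-sub# (suc k) w d vw (liftArgs T) (AllValid#-lifts# 0 us vs) (proj₁ ok) (proj₂ ok))
      (cong (λ z → sub# (suc k) z (res# w w)) (devs#-lifts#-typed 0 T vs)))
    where ok = Supplies-lam k T e (⊢-SeqCtx d) g sq
  dev#-sub# k {us = us} (app false a as) (tapp {Γ₀ = Γ₀} {Γs = Γs} d ds mm e s sa) vw T vs g sq
    rewrite res#-app-false false (sub# k us a) (subs# k us as) (sub# k us a) (subs# k us as) | res#-app-false false a as a as =
    cong₂ (app false) (dev#-sub# k a d (∧-trueˡ vw) T vs (Supplies-fun k T Γ₀ Γs e g) (proj₁ (SeqCtx-subCtx-app k T Γ₀ Γs e sq)))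
                      (devs#-subs# k as ds (∧-trueʳ vw) T vs (Supplies-args k T Γ₀ Γs e g) (proj₂ (SeqCtx-subCtx-app k T Γ₀ Γs e sq)))
  dev#-sub# k {us = us} (app true (lam ℓ z) zs) (tapp {Γ₀ = Γ₀} {Γs = Γs} (tlam dz e1 s1 sa1) dzs mm e s sa) vw T vs g sq =
    begin
      sub# 0 (ress# (subs# k us zs) (subs# k us zs)) (res# (sub# (suc k) (lifts# 0 us) z) (sub# (suc k) (lifts# 0 us) z))
    ≡⟨ cong₂ (sub# 0) IHzs IHz ⟩
      sub# 0 (subs# k U' (ress# zs zs)) (sub# (suc k) (ress# (lifts# 0 us) (lifts# 0 us)) (res# z z))
    ≡⟨ cong (λ us' → sub# 0 (subs# k U' (ress# zs zs)) (sub# (suc k) us' (res# z z))) (devs#-lifts#-typed 0 T vs) ⟩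
      sub# 0 (subs# k U' (ress# zs zs)) (sub# (suc k) (lifts# 0 U') (res# z z))
    ≡⟨ sub#-sub# k U' (ress# zs zs) (res# z z) (Covers-dev#-redex z zs dz dzs sa1 mm (∧-trueˡ vw) (∧-trueʳ vw))
         (subKeepsExt-devs# k T vs zs dzs (∧-trueʳ vw) gs sqs) ⟨
      sub# k U' (sub# 0 (ress# zs zs) (res# z z))
    ∎
    where
    U' = ress# us us
    sq₀ = proj₁ (SeqCtx-subCtx-app k T Γ₀ Γs e sq)
    sqs = proj₂ (SeqCtx-subCtx-app k T Γ₀ Γs e sq)
    gs = Supplies-args k T Γ₀ Γs e g
    ok = Supplies-lam k T e1 (⊢-SeqCtx dz) (Supplies-fun k T Γ₀ Γs e g) sq₀
    IHz = dev#-sub# (suc k) z dz (∧-trueˡ vw) (liftArgs T) (AllValid#-lifts# 0 us vs) (proj₁ ok) (proj₂ ok)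
    IHzs = devs#-subs# k zs dzs (∧-trueʳ vw) T vs gs sqs
  dev#-sub# k (app true (var _ _) as) d () T vs g sq
  dev#-sub# k (app true (app _ _ _) as) d () T vs g sq

  devs#-subs# : ∀ k {Γs Bs us} (ws : List MTm) → Γs ⊢* erases# ws ∶ Bs → valids# ws ≡ true → (T : TypedArgs us) → AllValid# us →
          All (λ Γ → All (Supplies T) (Γ k)) Γs → SeqCtx (ΣC (map (subCtx k T) Γs)) →
          ress# (subs# k us ws) (subs# k us ws) ≡ subs# k (ress# us us) (ress# ws ws)
  devs#-subs# k [] [] v T vs gs sq = refl
  devs#-subs# k {Γ ∷ Γs} (w ∷ ws) (d ∷ ds) v T vs (g ∷ gs) sq =
    cong₂ _∷_ (dev#-sub# k w d (∧-trueˡ v) T vs g (SeqCtx-+ˡ {subCtx k T Γ} sq))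
              (devs#-subs# k ws ds (∧-trueʳ v) T vs gs (SeqCtx-+ʳ {subCtx k T Γ} sq))

dev#-sub#-redex : ∀ {Γ Γ₀ Γs Δb B₀ Bs ℓ} (x₁ y₁ : MTm) Xs Ys → Δb ⊢ erase# y₁ ∶ B₀ → Γs ⊢* erases# Ys ∶ Bs →
  SeqTy (arr (Δb 0) ℓ B₀) → Δb 0 ≈M Bs → Γ ≈C (Γ₀ +C ΣC Γs) → SeqCtx Γ → Γ₀ ≈C tailC Δb →
  SameShape x₁ y₁ → SameShapes Xs Ys → valid# x₁ ≡ true → valid# y₁ ≡ true → valids# Xs ≡ true → valids# Ys ≡ true →
  res# (sub# 0 (ress# Xs Ys) (res# x₁ y₁)) (sub# 0 (ress# Xs Ys) (res# x₁ y₁))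
    ≡ sub# 0 (ress# (ress# Xs Ys) (ress# Xs Ys)) (res# (res# x₁ y₁) (res# x₁ y₁))
dev#-sub#-redex {Δb = Δb} x₁ y₁ Xs Ys d₁ ds sa mm e s e₁ sx sxs vx vy vxs vys =
  let B₀' , _ , d₁' = dev#-typed y₁ vy d₁
      Bs' , pw , ds' = devs#-typed Ys vys ds
      dW = subst (λ t → Δb ⊢ t ∶ B₀') (sym (SameShape⇒erase#≡ (SameShape-res# sx vy))) d₁'
      dsV = subst (λ t → _ ⊢* t ∶ Bs') (sym (SameShapes⇒erases#≡ (SameShapes-ress# sxs vys))) ds'
      mB = ≈M-trans-≈PW mm pw
  in dev#-sub# 0 (res# x₁ y₁) dW (valid#-res sx vx vy) (typedArgs dsV) (valids#⇒AllValid# (ress# Xs Ys) (valids#-res sxs vxs vys))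
       (redexArgs-supply Δb dsV sa mB) (SeqCtx-≈C (≈C-sym (redexArgs-ctx Δb dsV sa mB e₁ e)) s)

-- Cube lemma for λ#: developing B/A after A and A/B after B give the same term.  In the
-- redex case dev#-sub# pushes both developments inside the substitution.
mutual
  cube# : ∀ {Γ T} A B → Γ ⊢ erase# A ∶ T → SameShape A B → valid# A ≡ true → valid# B ≡ true →
          res# (res# B A) (res# B A) ≡ res# (res# A B) (res# A B)
  cube# (var n C) (var .n .C) d var va vb = refl
  cube# (lam ℓ a) (lam .ℓ b) (tlam d _ _ _) (lam s) va vb = cong (lam ℓ) (cube# a b d s va vb)
  cube# (app false a₁ as) (app false b₁ bs) (tapp d ds _ _ _ _) (app s ss) va vb
    rewrite res#-app-false false b₁ bs a₁ as | res#-app-false false a₁ as b₁ bs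
          | res#-app-false false (res# b₁ a₁) (ress# bs as) (res# b₁ a₁) (ress# bs as)
          | res#-app-false false (res# a₁ b₁) (ress# as bs) (res# a₁ b₁) (ress# as bs) =
    cong₂ (app false) (cube# a₁ b₁ d s (∧-trueˡ va) (∧-trueˡ vb)) (cubes# as bs ds ss (∧-trueʳ va) (∧-trueʳ vb))
  cube# (app true (lam ℓ a₁) as) (app true (lam .ℓ b₁) bs) (tapp (tlam d₁ e₁ _ sa₁) ds mm e s _) (app (lam sx) sxs) va vb =
    Eq.trans (dev#-sub#-redex b₁ a₁ bs as d₁ ds sa₁ mm e s e₁ (SameShape-sym sx) (SameShapes-sym sxs)
               (∧-trueˡ vb) (∧-trueˡ va) (∧-trueʳ vb) (∧-trueʳ va))
    (Eq.trans (cong₂ (sub# 0) (cubes# as bs ds sxs (∧-trueʳ va) (∧-trueʳ vb)) (cube# a₁ b₁ d₁ sx (∧-trueˡ va) (∧-trueˡ vb)))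
    (sym (dev#-sub#-redex a₁ b₁ as bs (subst (λ t → _ ⊢ t ∶ _) (SameShape⇒erase#≡ sx) d₁) (subst (λ t → _ ⊢* t ∶ _) (SameShapes⇒erases#≡ sxs) ds)
           sa₁ mm e s e₁ sx sxs (∧-trueˡ va) (∧-trueˡ vb) (∧-trueʳ va) (∧-trueʳ vb))))
  cube# (app true (lam ℓ a₁) as) (app false (lam .ℓ b₁) bs) (tapp (tlam d₁ e₁ _ sa₁) ds mm e s _) (app (lam sx) sxs) va vb
    rewrite res#-app-false true (lam ℓ a₁) as (lam ℓ b₁) bs =
    Eq.trans (dev#-sub#-redex b₁ a₁ bs as d₁ ds sa₁ mm e s e₁ (SameShape-sym sx) (SameShapes-sym sxs)
               (∧-trueˡ vb) (∧-trueˡ va) (∧-trueʳ vb) (∧-trueʳ va))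
      (cong₂ (sub# 0) (cubes# as bs ds sxs (∧-trueʳ va) (∧-trueʳ vb)) (cube# a₁ b₁ d₁ sx (∧-trueˡ va) (∧-trueˡ vb)))
  cube# (app false (lam ℓ a₁) as) (app true (lam .ℓ b₁) bs) (tapp (tlam d₁ e₁ _ sa₁) ds mm e s _) (app (lam sx) sxs) va vb
    rewrite res#-app-false true (lam ℓ b₁) bs (lam ℓ a₁) as =
    Eq.trans (cong₂ (sub# 0) (cubes# as bs ds sxs (∧-trueʳ va) (∧-trueʳ vb)) (cube# a₁ b₁ d₁ sx (∧-trueˡ va) (∧-trueˡ vb)))
    (sym (dev#-sub#-redex a₁ b₁ as bs (subst (λ t → _ ⊢ t ∶ _) (SameShape⇒erase#≡ sx) d₁) (subst (λ t → _ ⊢* t ∶ _) (SameShapes⇒erases#≡ sxs) ds)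
           sa₁ mm e s e₁ sx sxs (∧-trueˡ va) (∧-trueˡ vb) (∧-trueʳ va) (∧-trueʳ vb)))
  cube# (app true (var _ _) as) B d s () vb
  cube# (app true (app _ _ _) as) B d s () vb
  cube# (app false a as) (app true (var _ _) bs) d s va ()
  cube# (app false a as) (app true (app _ _ _) bs) d s va ()
  cube# (app false (var _ _) as) (app true (lam _ _) bs) d (app () _) va vb
  cube# (app false (app _ _ _) as) (app true (lam _ _) bs) d (app () _) va vb

  cubes# : ∀ {Γs Ts} As Bs → Γs ⊢* erases# As ∶ Ts → SameShapes As Bs → valids# As ≡ true → valids# Bs ≡ true →
           ress# (ress# Bs As) (ress# Bs As) ≡ ress# (ress# As Bs) (ress# As Bs)
  cubes# [] [] [] [] va vb = refl
  cubes# (a ∷ as) (b ∷ bs) (d ∷ ds) (s ∷ ss) va vb =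
    cong₂ _∷_ (cube# a b d s (∧-trueˡ va) (∧-trueˡ vb)) (cubes# as bs ds ss (∧-trueʳ va) (∧-trueʳ vb))

cube-tr : ∀ {Γ T} a b t → Γ ⊢ t ∶ T → t ⋉ erase a → t ⋉ erase b → valid a ≡ true → valid b ≡ true →
        dev# (res# (tr b t) (tr a t)) ≡ dev# (res# (tr a t) (tr b t))
cube-tr a b t d ra rb va vb =
  cong erase# (cube# (tr a t) (tr b t) (⊢-tr a t d) (SameShape-tr a b t) (valid#-tr a t va ra) (valid#-tr b t vb rb))

Unmarked : MTm → Set
Unmarked x = hasMark# x ≡ false

mutual
  unmark-unmarked : ∀ t → hasMark# (unmark t) ≡ false
  unmark-unmarked (var n A) = refl
  unmark-unmarked (lam ℓ t) = unmark-unmarked t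
  unmark-unmarked (app t ts) = ∨-false⁺ (unmark-unmarked t) (unmarks-unmarked ts)

  unmarks-unmarked : ∀ ts → hasMarks# (unmarks ts) ≡ false
  unmarks-unmarked [] = refl
  unmarks-unmarked (t ∷ ts) = ∨-false⁺ (unmark-unmarked t) (unmarks-unmarked ts)

mutual
  tr-unmarked : ∀ c t → hasMark c ≡ false → hasMark# (tr c t) ≡ false
  tr-unmarked (mvar _) (var n A) h = refl
  tr-unmarked (mvar _) (lam ℓ t) h = unmark-unmarked t
  tr-unmarked (mvar _) (app t ts) h = unmark-unmarked (app t ts)
  tr-unmarked (mlam c) (var n A) h = refl
  tr-unmarked (mlam c) (lam ℓ t) h = tr-unmarked c t h
  tr-unmarked (mlam c) (app t ts) h = unmark-unmarked (app t ts)
  tr-unmarked (mapp m c d) (var n A) h = refl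
  tr-unmarked (mapp m c d) (lam ℓ t) h = unmark-unmarked t
  tr-unmarked (mapp false c d) (app t ts) h = ∨-false⁺ (tr-unmarked c t (∨-falseˡ h)) (trs-unmarked d ts (∨-falseʳ h))
  tr-unmarked (mapp true c d) (app t ts) ()

  trs-unmarked : ∀ d ts → hasMark d ≡ false → hasMarks# (trs d ts) ≡ false
  trs-unmarked d [] h = refl
  trs-unmarked d (t ∷ ts) h = ∨-false⁺ (tr-unmarked d t h) (trs-unmarked d ts h)

simD-IsEmpty : ∀ ζ s → IsEmpty ζ → IsEmpty# (simD ζ s)
simD-IsEmpty [] s [] = []
simD-IsEmpty (c ∷ ζ) s (h ∷ hs) = tr-unmarked c s h ∷ simD-IsEmpty ζ (dev# (tr c s)) hs

mutual
  hasMark#-lift# : ∀ c x → hasMark# (lift# c x) ≡ hasMark# x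
  hasMark#-lift# c (var n A) = refl
  hasMark#-lift# c (lam ℓ x) = hasMark#-lift# (suc c) x
  hasMark#-lift# c (app m x xs) = cong₂ (λ p q → m ∨ p ∨ q) (hasMark#-lift# c x) (hasMarks#-lifts# c xs)

  hasMarks#-lifts# : ∀ c xs → hasMarks# (lifts# c xs) ≡ hasMarks# xs
  hasMarks#-lifts# c [] = refl
  hasMarks#-lifts# c (x ∷ xs) = cong₂ _∨_ (hasMark#-lift# c x) (hasMarks#-lifts# c xs)

All-Unmarked-lifts# : ∀ c us → All Unmarked us → All Unmarked (lifts# c us)
All-Unmarked-lifts# c [] [] = []
All-Unmarked-lifts# c (u ∷ us) (h ∷ hs) = Eq.trans (hasMark#-lift# c u) h ∷ All-Unmarked-lifts# c us hs

fromPick-unmarked : ∀ A us n → All Unmarked us → Unmarked (fromPick (pick A us) (var n A))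
fromPick-unmarked A [] n [] = refl
fromPick-unmarked A (u ∷ us) n (h ∷ hs) with ext (typeOf u) ≡ᵇ ext A
... | true = h
... | false = fromPick-unmarked A us n hs

if-var-unmarked : ∀ (b : Bool) x y A → Unmarked (if b then var x A else var y A)
if-var-unmarked true x y A = refl
if-var-unmarked false x y A = refl

mutual
  sub#-unmarked : ∀ k us w → All Unmarked us → Unmarked w → Unmarked (sub# k us w)
  sub#-unmarked k us (var n A) hus hw with n ≡ᵇ k
  ... | true = fromPick-unmarked A us n hus
  ... | false = if-var-unmarked (k <ᵇ n) (pred n) n A
  sub#-unmarked k us (lam ℓ w) hus hw = sub#-unmarked (suc k) (lifts# 0 us) w (All-Unmarked-lifts# 0 us hus) hw
  sub#-unmarked k us (app false w ws) hus hw =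
    ∨-false⁺ (sub#-unmarked k us w hus (∨-falseˡ {hasMark# w} hw)) (subs#-unmarked k us ws hus (∨-falseʳ {hasMark# w} hw))
  sub#-unmarked k us (app true w ws) hus ()

  subs#-unmarked : ∀ k us ws → All Unmarked us → hasMarks# ws ≡ false → hasMarks# (subs# k us ws) ≡ false
  subs#-unmarked k us [] hus h = refl
  subs#-unmarked k us (w ∷ ws) hus h =
    ∨-false⁺ (sub#-unmarked k us w hus (∨-falseˡ {hasMark# w} h)) (subs#-unmarked k us ws hus (∨-falseʳ {hasMark# w} h))

hasMarks#⇒All-Unmarked : ∀ xs → hasMarks# xs ≡ false → All Unmarked xs
hasMarks#⇒All-Unmarked [] h = []
hasMarks#⇒All-Unmarked (x ∷ xs) h = ∨-falseˡ {hasMark# x} h ∷ hasMarks#⇒All-Unmarked xs (∨-falseʳ {hasMark# x} h)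

mutual
  res#-unmarked : ∀ e x → Unmarked e → Unmarked (res# e x)
  res#-unmarked (var n A) (var _ _) h = refl
  res#-unmarked (var n A) (lam _ _) h = h
  res#-unmarked (var n A) (app _ _ _) h = h
  res#-unmarked (lam ℓ e) (var _ _) h = h
  res#-unmarked (lam ℓ e) (lam _ x) h = res#-unmarked e x h
  res#-unmarked (lam ℓ e) (app _ _ _) h = h
  res#-unmarked (app m (var _ _) es) (var _ _) h = h
  res#-unmarked (app m (var _ _) es) (lam _ _) h = h
  res#-unmarked (app m (lam _ _) es) (var _ _) h = h
  res#-unmarked (app m (lam _ _) es) (lam _ _) h = h
  res#-unmarked (app m (app _ _ _) es) (var _ _) h = h
  res#-unmarked (app m (app _ _ _) es) (lam _ _) h = h
  res#-unmarked (app true e es) (app _ _ _) ()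
  res#-unmarked (app false (lam ℓ e) es) (app true (lam _ x) xs) h =
    sub#-unmarked 0 (ress# es xs) (res# e x)
        (hasMarks#⇒All-Unmarked (ress# es xs) (ress#-unmarked es xs (∨-falseʳ {hasMark# e} h)))
        (res#-unmarked e x (∨-falseˡ {hasMark# e} h))
  res#-unmarked (app false (var n A) es) (app mx x xs) h = ∨-false⁺ (res#-unmarked (var n A) x refl) (ress#-unmarked es xs h)
  res#-unmarked (app false (app m' y ys) es) (app mx x xs) h =
    ∨-false⁺ (res#-unmarked (app m' y ys) x (∨-falseˡ {hasMark# (app m' y ys)} h))
      (ress#-unmarked es xs (∨-falseʳ {hasMark# (app m' y ys)} h))
  res#-unmarked (app false (lam ℓ e) es) (app false x xs) h =
    ∨-false⁺ (res#-unmarked (lam ℓ e) x (∨-falseˡ {hasMark# e} h)) (ress#-unmarked es xs (∨-falseʳ {hasMark# e} h))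
  res#-unmarked (app false (lam ℓ e) es) (app true (var _ _) xs) h =
    ∨-false⁺ (∨-falseˡ {hasMark# e} h) (ress#-unmarked es xs (∨-falseʳ {hasMark# e} h))
  res#-unmarked (app false (lam ℓ e) es) (app true (app _ _ _) xs) h =
    ∨-false⁺ (∨-falseˡ {hasMark# e} h) (ress#-unmarked es xs (∨-falseʳ {hasMark# e} h))

  ress#-unmarked : ∀ es xs → hasMarks# es ≡ false → hasMarks# (ress# es xs) ≡ false
  ress#-unmarked [] xs h = refl
  ress#-unmarked (e ∷ es) [] h = h
  ress#-unmarked (e ∷ es) (x ∷ xs) h = ∨-false⁺ (res#-unmarked e x (∨-falseˡ {hasMark# e} h)) (ress#-unmarked es xs (∨-falseʳ {hasMark# e} h))

mutual
  res#-by-unmarked : ∀ x e → Unmarked e → res# x e ≡ x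
  res#-by-unmarked (var n A) (var _ _) h = refl
  res#-by-unmarked (var n A) (lam _ _) h = refl
  res#-by-unmarked (var n A) (app _ _ _) h = refl
  res#-by-unmarked (lam ℓ a) (var _ _) h = refl
  res#-by-unmarked (lam ℓ a) (lam _ b) h = cong (lam ℓ) (res#-by-unmarked a b h)
  res#-by-unmarked (lam ℓ a) (app _ _ _) h = refl
  res#-by-unmarked (app m (var _ _) as) (var _ _) h = refl
  res#-by-unmarked (app m (lam _ _) as) (var _ _) h = refl
  res#-by-unmarked (app m (app _ _ _) as) (var _ _) h = refl
  res#-by-unmarked (app m (var _ _) as) (lam _ _) h = refl
  res#-by-unmarked (app m (lam _ _) as) (lam _ _) h = refl
  res#-by-unmarked (app m (app _ _ _) as) (lam _ _) h = refl
  res#-by-unmarked (app m a as) (app true b bs) ()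
  res#-by-unmarked (app m a as) (app false b bs) h =
    Eq.trans (res#-app-false m a as b bs)
        (cong₂ (app m) (res#-by-unmarked a b (∨-falseˡ {hasMark# b} h)) (ress#-by-unmarked as bs (∨-falseʳ {hasMark# b} h)))

  ress#-by-unmarked : ∀ xs es → hasMarks# es ≡ false → ress# xs es ≡ xs
  ress#-by-unmarked [] es h = refl
  ress#-by-unmarked (x ∷ xs) [] h = refl
  ress#-by-unmarked (x ∷ xs) (e ∷ es) h =
    cong₂ _∷_ (res#-by-unmarked x e (∨-falseˡ {hasMark# e} h)) (ress#-by-unmarked xs es (∨-falseʳ {hasMark# e} h))

mutual
  res#-self-unmarked : ∀ a → valid# a ≡ true → Unmarked (res# a a)
  res#-self-unmarked (var n A) v = refl
  res#-self-unmarked (lam ℓ a) v = res#-self-unmarked a v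
  res#-self-unmarked (app false a as) v rewrite res#-app-false false a as a as = ∨-false⁺ (res#-self-unmarked a (∧-trueˡ v)) (ress#-self-unmarked as (∧-trueʳ v))
  res#-self-unmarked (app true (lam ℓ a) as) v =
    sub#-unmarked 0 (ress# as as) (res# a a) (hasMarks#⇒All-Unmarked (ress# as as) (ress#-self-unmarked as (∧-trueʳ v)))
      (res#-self-unmarked a (∧-trueˡ v))
  res#-self-unmarked (app true (var _ _) as) ()
  res#-self-unmarked (app true (app _ _ _) as) ()

  ress#-self-unmarked : ∀ as → valids# as ≡ true → hasMarks# (ress# as as) ≡ false
  ress#-self-unmarked [] v = refl
  ress#-self-unmarked (a ∷ as) v = ∨-false⁺ (res#-self-unmarked a (∧-trueˡ v)) (ress#-self-unmarked as (∧-trueʳ v))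

resSD#-unmarked : ∀ e ρ → Unmarked e → Unmarked (resSD# e ρ)
resSD#-unmarked e [] h = h
resSD#-unmarked e (b ∷ ρ) h = resSD#-unmarked (res# e b) ρ (res#-unmarked e b h)

resDS#-by-unmarked : ∀ ρ e → Unmarked e → resDS# ρ e ≡ ρ
resDS#-by-unmarked [] e h = refl
resDS#-by-unmarked (b ∷ ρ) e h = cong₂ _∷_ (res#-by-unmarked b e h) (resDS#-by-unmarked ρ (res# e b) (res#-unmarked e b h))

resD#-by-unmarked : ∀ ζ e τ → Unmarked e → resD# ζ (e ∷ τ) ≡ resD# ζ τ
resD#-by-unmarked [] e τ h = refl
resD#-by-unmarked (c ∷ ζ) e τ h rewrite res#-by-unmarked c e h =
  cong (resSD# c τ ∷_) (resD#-by-unmarked ζ (res# e c) (resDS# τ c) (res#-unmarked e c h))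

resD#-self-IsEmpty : ∀ X → All (λ a → valid# a ≡ true) X → IsEmpty# (resD# X X)
resD#-self-IsEmpty [] [] = []
resD#-self-IsEmpty (a ∷ ρ) (v ∷ vs) rewrite resDS#-by-unmarked ρ (res# a a) (res#-self-unmarked a v) | resD#-by-unmarked ρ (res# a a) ρ (res#-self-unmarked a v) =
  resSD#-unmarked (res# a a) ρ (res#-self-unmarked a v) ∷ resD#-self-IsEmpty ρ vs

DerFrom#-valid : ∀ {s X} → DerFrom# s X → All (λ a → valid# a ≡ true) X
DerFrom#-valid [] = []
DerFrom#-valid ((_ , _ , v) ∷ D) = v ∷ DerFrom#-valid D

-- Simulation of derivations

-- SimFrom s ρ: along ρ, simulated from s, every intermediate term is correct and refines
-- the term in which the next multistep of ρ is taken.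
data SimFrom : Tm → DerΛ → Set where
  []  : ∀ {s} → Correct s → SimFrom s []
  _∷_ : ∀ {s c ζ} → Correct s × valid c ≡ true × s ⋉ erase c → SimFrom (dev# (tr c s)) ζ → SimFrom s (c ∷ ζ)

SimFrom-correct : ∀ {s ζ} → SimFrom s ζ → Correct (simT s ζ)
SimFrom-correct ([] c) = c
SimFrom-correct (_ ∷ C) = SimFrom-correct C

dev#-tr-correct : ∀ {s c} → Correct s → valid c ≡ true → s ⋉ erase c → Correct (dev# (tr c s))
dev#-tr-correct {s} {c} cs v r = dev#-correct (tr c s) (valid#-tr c s v r) (subst Correct (sym (erase#-tr c s)) cs)

⋉-res-correct : ∀ {s} a b → Correct s → s ⋉ erase a → s ⋉ erase b → valid b ≡ true → dev# (tr b s) ⋉ erase (res a b)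
⋉-res-correct {s} a b (_ , _ , d , _) ra rb vb = ⋉-res a b s d ra rb vb

tr-res-correct : ∀ {s} a b → Correct s → s ⋉ erase a → s ⋉ erase b → valid b ≡ true → tr (res a b) (dev# (tr b s)) ≡ res# (tr a s) (tr b s)
tr-res-correct {s} a b (_ , _ , d , _) ra rb vb = tr-res a b s d ra rb vb

DerFrom⇒SimFrom : ∀ {t s ρ} → DerFrom t ρ → Correct s → s ⋉ t → SimFrom s ρ
DerFrom⇒SimFrom [] cs r = [] cs
DerFrom⇒SimFrom {s = s} (_∷_ {a = a} (e , v) D) cs r =
  (cs , v , r') ∷ DerFrom⇒SimFrom D (dev#-tr-correct cs v r') (⋉-res-correct a a cs r' r' v)
  where
  r' = subst (s ⋉_) (sym e) r

SimFrom⇒DerFrom# : ∀ {s ρ} → SimFrom s ρ → DerFrom# s (simD ρ s)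
SimFrom⇒DerFrom# ([] c) = []
SimFrom⇒DerFrom# {s} (_∷_ {c = c} (cs , v , r) C) = (erase#-tr c s , cs , valid#-tr c s v r) ∷ SimFrom⇒DerFrom# C

SimFrom-++ : ∀ {s ρ τ} → SimFrom s ρ → SimFrom (simT s ρ) τ → SimFrom s (ρ ++ τ)
SimFrom-++ ([] c) C' = C'
SimFrom-++ (x ∷ C) C' = x ∷ SimFrom-++ C C'

simD-++ : ∀ ρ τ s → simD (ρ ++ τ) s ≡ simD ρ s ++ simD τ (simT s ρ)
simD-++ [] τ s = refl
simD-++ (a ∷ ρ) τ s = cong (tr a s ∷_) (simD-++ ρ τ (dev# (tr a s)))

valid-resSD : ∀ {s σ} a → SimFrom s σ → valid a ≡ true → valid (resSD a σ) ≡ true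
valid-resSD a ([] _) v = v
valid-resSD a (_∷_ {c = b} (_ , vb , _) C) v = valid-resSD (res a b) C (valid-res a b v vb)

⋉-resSD : ∀ {s σ} a → SimFrom s σ → s ⋉ erase a → simT s σ ⋉ erase (resSD a σ)
⋉-resSD a ([] _) r = r
⋉-resSD a (_∷_ {c = b} (cs , vb , rb) C) r = ⋉-resSD (res a b) C (⋉-res-correct a b cs r rb vb)

cube-correct : ∀ {s} a b → Correct s → s ⋉ erase a → s ⋉ erase b → valid a ≡ true → valid b ≡ true →
        dev# (tr (res b a) (dev# (tr a s))) ≡ dev# (tr (res a b) (dev# (tr b s)))
cube-correct {s} a b (_ , _ , d , _) ra rb va vb = begin
    dev# (tr (res b a) (dev# (tr a s)))   ≡⟨ cong dev# (tr-res b a s d rb ra va) ⟩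
    dev# (res# (tr b s) (tr a s))         ≡⟨ cube-tr a b s d ra rb va vb ⟩
    dev# (res# (tr a s) (tr b s))         ≡⟨ cong dev# (tr-res a b s d ra rb vb) ⟨
    dev# (tr (res a b) (dev# (tr b s)))   ∎

tr-resSD : ∀ {s σ} a → SimFrom s σ → s ⋉ erase a → tr (resSD a σ) (simT s σ) ≡ resSD# (tr a s) (simD σ s)
tr-resSD a ([] _) r = refl
tr-resSD {s} a (_∷_ {c = b} {ζ = σ'} (cs , vb , rb) C) r =
  Eq.trans (tr-resSD (res a b) C (⋉-res-correct a b cs r rb vb))
           (cong (λ x → resSD# x (simD σ' (dev# (tr b s)))) (tr-res-correct a b cs r rb vb))

simD-resDS : ∀ {s σ} a → SimFrom s σ → Correct s → valid a ≡ true → s ⋉ erase a →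
  SimFrom (dev# (tr a s)) (resDS σ a) ×
  simD (resDS σ a) (dev# (tr a s)) ≡ resDS# (simD σ s) (tr a s) ×
  simT (dev# (tr a s)) (resDS σ a) ≡ dev# (tr (resSD a σ) (simT s σ))
simD-resDS a ([] _) cs va ra = [] (dev#-tr-correct cs va ra) , refl , refl
simD-resDS {s} a (_∷_ {c = b} {ζ = σ'} (_ , vb , rb) C) cs va ra = comp , eqD , eqT
  where
  s₁ = dev# (tr a s)
  s₂ = dev# (tr b s)
  ceq : dev# (tr (res b a) s₁) ≡ dev# (tr (res a b) s₂)
  ceq = cube-correct a b cs ra rb va vb
  IH = simD-resDS (res a b) C (dev#-tr-correct cs vb rb) (valid-res a b va vb) (⋉-res-correct a b cs ra rb vb)
  comp : SimFrom s₁ (res b a ∷ resDS σ' (res a b))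
  comp = (dev#-tr-correct cs va ra , valid-res b a vb va , ⋉-res-correct b a cs rb ra va)
         ∷ subst (λ x → SimFrom x (resDS σ' (res a b))) (sym ceq) (proj₁ IH)
  eqD : simD (res b a ∷ resDS σ' (res a b)) s₁ ≡ res# (tr b s) (tr a s) ∷ resDS# (simD σ' s₂) (res# (tr a s) (tr b s))
  eqD = cong₂ _∷_ (tr-res-correct b a cs rb ra va)
    (Eq.trans (cong (simD (resDS σ' (res a b))) ceq)
      (Eq.trans (proj₁ (proj₂ IH)) (cong (resDS# (simD σ' s₂)) (tr-res-correct a b cs ra rb vb))))
  eqT : simT (dev# (tr (res b a) s₁)) (resDS σ' (res a b)) ≡ dev# (tr (resSD (res a b) σ') (simT s₂ σ'))
  eqT = Eq.trans (cong (λ x → simT x (resDS σ' (res a b))) ceq) (proj₂ (proj₂ IH))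

simD-resD : ∀ {s ρ σ} → SimFrom s ρ → SimFrom s σ →
  SimFrom (simT s σ) (resD ρ σ) × simD (resD ρ σ) (simT s σ) ≡ resD# (simD ρ s) (simD σ s)
simD-resD ([] _) Cσ = [] (SimFrom-correct Cσ) , refl
simD-resD {s} {σ = σ} (_∷_ {c = a} {ζ = ρ'} (cs , va , ra) Cρ) Cσ = comp , eq
  where
  s₁ = dev# (tr a s)
  σ/a = simD-resDS a Cσ cs va ra
  σ₁ = resDS σ a
  IH = simD-resD Cρ (proj₁ σ/a)
  comp : SimFrom (simT s σ) (resSD a σ ∷ resD ρ' σ₁)
  comp = (SimFrom-correct Cσ , valid-resSD a Cσ va , ⋉-resSD a Cσ ra) ∷ subst (λ x → SimFrom x (resD ρ' σ₁)) (proj₂ (proj₂ σ/a)) (proj₁ IH)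
  eq : simD (resSD a σ ∷ resD ρ' σ₁) (simT s σ) ≡ resSD# (tr a s) (simD σ s) ∷ resD# (simD ρ' s₁) (resDS# (simD σ s) (tr a s))
  eq = cong₂ _∷_ (tr-resSD a Cσ ra)
    (Eq.trans (cong (simD (resD ρ' σ₁)) (sym (proj₂ (proj₂ σ/a))))
      (Eq.trans (proj₂ IH) (cong (resD# (simD ρ' s₁)) (proj₁ (proj₂ σ/a)))))

≡#-refl : ∀ {s X} → DerFrom# s X → X ≡# X
≡#-refl D = let e = resD#-self-IsEmpty _ (DerFrom#-valid D) in e , e

simD-monotone : ∀ {t t'} → Correct t' → t' ⋉ t →
  ∀ ρ σ → DerFrom t ρ → DerFrom t σ → ρ ⊑λ σ → simD ρ t' ⊑# simD σ t'
simD-monotone {t' = t'} c r ρ σ Dρ Dσ ρ⊑σ =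
  subst IsEmpty# (proj₂ (simD-resD (DerFrom⇒SimFrom Dρ c r) (DerFrom⇒SimFrom Dσ c r)))
    (simD-IsEmpty (resD ρ σ) (simT t' σ) ρ⊑σ)

simD-⊔ : ∀ {t t'} → Correct t' → t' ⋉ t →
  ∀ ρ σ → DerFrom t ρ → DerFrom t σ → simD (ρ ⊔λ σ) t' ≡# (simD ρ t' ⊔# simD σ t')
simD-⊔ {t' = t'} c r ρ σ Dρ Dσ =
  subst (simD (ρ ⊔λ σ) t' ≡#_) eq (≡#-refl (SimFrom⇒DerFrom# (SimFrom-++ Cρ (proj₁ σ/ρ))))
  where
  Cρ = DerFrom⇒SimFrom Dρ c r
  σ/ρ = simD-resD (DerFrom⇒SimFrom Dσ c r) Cρ
  eq : simD (ρ ++ resD σ ρ) t' ≡ simD ρ t' ++ resD# (simD σ t') (simD ρ t')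
  eq = begin
    simD (ρ ++ resD σ ρ) t'                      ≡⟨ simD-++ ρ (resD σ ρ) t' ⟩
    simD ρ t' ++ simD (resD σ ρ) (simT t' ρ)     ≡⟨ cong (simD ρ t' ++_) (proj₂ σ/ρ) ⟩
    simD ρ t' ++ resD# (simD σ t') (simD ρ t')   ∎

corollary2 : (t : Λ) (t' : Tm) → Correct t' → t' ⋉ t →
    IsUSLMorphism t t' (λ ρ → simD ρ t')
corollary2 t t' c r = record
  { maps-into = λ ρ D → SimFrom⇒DerFrom# (DerFrom⇒SimFrom D c r)
  ; monotone  = simD-monotone c r
  ; bottom    = [] , []
  ; joins     = simD-⊔ c r
  }
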